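{- Let $D,m,s\in\mathbb{N}$ with $D\ge3$, and let $k=\lceil \log(10m/s)/\log(D-1)\rceil$. Let $\ell\in\mathbb{N}$ be odd with $\ell\ge 2k+3$. Let $G_1,G_2$ be bipartite graphs with parts $V_1,V_2$, each of size $n$, and let $F$ be a graph on the vertex set $V_1\cup V_2$. Suppose $G_2$ is $m$-bipartite-joined, and $G_1$ contains a $(D,m)$-bipartite-extendable subgraph $H$ such that $|N_{G_1}(U)\setminus V(H)|\ge 50Dm+s(\ell-2k-1)$ for every $i\in[2]$ and every $U\subseteq V_i$ with $m\le|U|\le 2m$. Let $a_1,\dots,a_s\in V_1\cap V(H)$ and $b_1,\dots,b_s\in V_2\cap V(H)$ be distinct vertices with $d_H(a_i),d_H(b_i)\le D-1$ for all $i\in[s]$. Then there exists a path $P$ in $G_1\cup G_2$ of length $\ell$ from $a_i$ to $b_j$ for some $i,j\in[s]$ such that: (i) there is an edge $e\in E(P)$ such that $\{e\}$ is $(2,m,F)$-bounded and $E(P)\setminus\{e\}\subseteq E(G_1)$; (ii) all internal vertices of $P$ lie outside $V(H)$; (iii) $H+(P-e)$ is $(D,m)$-bipartite-extendable in $G_1$.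
   Context: Let $G$ be a bipartite graph with parts $V_1,V_2$, and $D\ge3$, $m\ge1$ integers. A subgraph $H\subseteq G$ is $(D,m)$-bipartite-extendable (in $G$) if $\Delta(H)\le D$ and for all $i\in[2]$ and all $U\subseteq V_i$ with $|U|\le 2m$, $|N_G(U)\setminus V(H)|\ge (D-1)|U|-\sum_{x\in U\cap V(H)}(d_H(x)-1)$, where $N_G(U)$ is the set of vertices outside $U$ adjacent in $G$ to some vertex of $U$. A bipartite graph with parts $V_1,V_2$ is $m$-bipartite-joined if there is an edge between $A$ and $B$ for all $A\subseteq V_1$, $B\subseteq V_2$ with $|A|=|B|=m$. The length of a path is its number of edges. $H+(P-e)$ is the graph obtained from $H$ by adding the vertices and edges of the path $P$ except the edge $e$. For a graph $F$, let $t(F)$ be the number of vertices of degree exactly $\Delta(F)$; the $m$-max degree is $\Delta_m(F)=m\Delta(F)+t(F)$; a set $E$ of pairs of vertices of $F$ is $(i,m,F)$-bounded if $\Delta_m(F\cup E)\le\Delta_m(F)+i$. -}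

module Defs where

open import Data.Nat using (ℕ; zero; suc; _+_; _*_; _∸_; _^_; _≤_; _⊔_; _≡ᵇ_)
open import Data.Integer as ℤ using (ℤ; +_; -[1+_])
open import Data.Bool using (Bool; true; false; _∧_; _∨_; not; if_then_else_)
open import Data.Fin using (Fin; zero; suc; inject₁)
open import Data.Fin.Properties using () renaming (_≟_ to _≟F_)
open import Data.List using (List; []; _∷_; map; _++_; allFin; foldr)
open import Data.Bool.ListAction using (any)
open import Data.Sum using (_⊎_; inj₁; inj₂)
open import Data.Sum.Properties using (≡-dec)
open import Data.Product using (_×_; _,_)
open import Relation.Nullary.Decidable using (⌊_⌋)
open import Relation.Nullary using (¬_)
open import Relation.Binary.PropositionalEquality using (_≡_)

-- Vertex set V₁ ∪ V₂ with V₁ = inj₁ (Fin n), V₂ = inj₂ (Fin n).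

V : ℕ → Set
V n = Fin n ⊎ Fin n

allV : (n : ℕ) → List (V n)
allV n = map inj₁ (allFin n) ++ map inj₂ (allFin n)

_==_ : {n : ℕ} → V n → V n → Bool
x == y = ⌊ ≡-dec _≟F_ _≟F_ x y ⌋

Part : {n : ℕ} → Fin 2 → V n → Bool
Part zero (inj₁ _) = true
Part zero (inj₂ _) = false
Part (suc zero) (inj₁ _) = false
Part (suc zero) (inj₂ _) = true

count : {A : Set} → (A → Bool) → List A → ℕ
count p [] = 0
count p (x ∷ xs) = (if p x then 1 else 0) + count p xs

∣_∣ : {n : ℕ} → (V n → Bool) → ℕ
∣_∣ {n} U = count U (allV n)

record Graph (n : ℕ) : Set where
  field
    adj     : V n → V n → Bool
    sym     : ∀ x y → adj x y ≡ adj y x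
    loopless : ∀ x → adj x x ≡ false
open Graph public

Bipartite : {n : ℕ} → Graph n → Set
Bipartite {n} G = (i : Fin 2) (x y : V n) → Part i x ≡ true → Part i y ≡ true → adj G x y ≡ false

_∪G_ : {n : ℕ} → Graph n → Graph n → V n → V n → Bool
(G₁ ∪G G₂) x y = adj G₁ x y ∨ adj G₂ x y

Joined : {n : ℕ} → ℕ → Graph n → Set
Joined {n} m G = (A B : V n → Bool) →
  (∀ x → A x ≡ true → Part zero x ≡ true) →
  (∀ y → B y ≡ true → Part (suc zero) y ≡ true) →
  ∣ A ∣ ≡ m → ∣ B ∣ ≡ m →
  Data.Product.Σ (V n) λ x → Data.Product.Σ (V n) λ y →
    (A x ≡ true) × (B y ≡ true) × (adj G x y ≡ true)

deg : {n : ℕ} → (V n → V n → Bool) → V n → ℕ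
deg {n} a x = count (a x) (allV n)

maxDeg : {n : ℕ} → (V n → V n → Bool) → ℕ
maxDeg {n} a = foldr (λ x r → deg a x ⊔ r) 0 (allV n)

tMax : {n : ℕ} → (V n → V n → Bool) → ℕ
tMax {n} a = count (λ x → deg a x ≡ᵇ maxDeg a) (allV n)

Δ[_] : {n : ℕ} → ℕ → (V n → V n → Bool) → ℕ
Δ[ m ] a = m * maxDeg a + tMax a

addEdge : {n : ℕ} → (V n → V n → Bool) → V n → V n → (V n → V n → Bool)
addEdge a u v x y = a x y ∨ ((x == u ∧ y == v) ∨ (x == v ∧ y == u))

Bounded1 : {n : ℕ} → ℕ → ℕ → Graph n → V n → V n → Set
Bounded1 i m F u v = Δ[ m ] (addEdge (adj F) u v) ≤ Δ[ m ] (adj F) + i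

N : {n : ℕ} → (V n → V n → Bool) → (V n → Bool) → V n → Bool
N {n} a U y = not (U y) ∧ any (λ x → U x ∧ a x y) (allV n)

∣N∖_∣ : {n : ℕ} → (V n → V n → Bool) → (V n → Bool) → (V n → Bool) → ℕ
∣N∖_∣ {n} a U S = count (λ y → N a U y ∧ not (S y)) (allV n)

-- Subgraphs (with explicit vertex set, since isolated vertices matter)

record Sub {n : ℕ} (G : Graph n) : Set where
  field
    vs       : V n → Bool
    sadj     : V n → V n → Bool
    ssym     : ∀ x y → sadj x y ≡ sadj y x
    sub      : ∀ x y → sadj x y ≡ true → adj G x y ≡ true
    endpoint : ∀ x y → sadj x y ≡ true → vs x ≡ true
open Sub public

sumℤ : {A : Set} → (A → ℤ) → List A → ℤ
sumℤ f [] = + 0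
sumℤ f (x ∷ xs) = f x ℤ.+ sumℤ f xs

Extendable : {n : ℕ} → ℕ → ℕ → (V n → V n → Bool) → (V n → Bool) → (V n → V n → Bool) → Set
Extendable {n} D m aG vH aH =
  ((x : V n) → deg aH x ≤ D) ×
  ((i : Fin 2) (U : V n → Bool) → (∀ x → U x ≡ true → Part i x ≡ true) →
     ∣ U ∣ ≤ 2 * m →
     (+ (D ∸ 1) ℤ.* + ∣ U ∣) ℤ.- sumℤ (λ x → if U x ∧ vH x then (+ deg aH x) ℤ.- + 1 else + 0) (allV n)
       ℤ.≤ + ∣N∖ aG ∣ U vH)

-- k = ⌈ log(10m/s) / log(D-1) ⌉ (an integer), characterised as the least
-- integer k with (D-1)^k ≥ 10m/s.

PowGe : ℕ → ℕ → ℕ → ℤ → Set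
PowGe D m s (+ k)     = 10 * m ≤ s * (D ∸ 1) ^ k
PowGe D m s -[1+ k ]  = 10 * m * (D ∸ 1) ^ suc k ≤ s

IsCeilLog : ℕ → ℕ → ℕ → ℤ → Set
IsCeilLog D m s k = PowGe D m s k × ¬ PowGe D m s (k ℤ.- + 1)

lo : {n ℓ : ℕ} → (Fin (suc ℓ) → V n) → Fin ℓ → V n
lo v t = v (inject₁ t)

hi : {n ℓ : ℕ} → (Fin (suc ℓ) → V n) → Fin ℓ → V n
hi v t = v (suc t)

onPath : {n ℓ : ℕ} → (Fin (suc ℓ) → V n) → V n → Bool
onPath {ℓ = ℓ} v x = any (λ t → v t == x) (allFin (suc ℓ))

pathEdgeExcept : {n ℓ : ℕ} → (Fin (suc ℓ) → V n) → Fin ℓ → V n → V n → Bool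
pathEdgeExcept {ℓ = ℓ} v t₀ x y =
  any (λ t → not ⌊ t ≟F t₀ ⌋ ∧ ((lo v t == x ∧ hi v t == y) ∨ (lo v t == y ∧ hi v t == x)))
      (allFin ℓ)

{-# OPTIONS --safe #-}
module Submission where

-- Write the extendability inequality as demand ≤ supply, with
-- demand U = (D-1)|U| + |U ∩ V(H)| and supply U = |N(U) ∖ V(H)| + Σ_{x ∈ U ∩ V(H)} d_H(x).
-- Demand is modular and supply submodular in U, so the tight sets (supply ≤ demand) of a part are
-- closed under union, and the margin |N(U) ∖ V(H)| > 2Dm for m ≤ |U| ≤ 2m forces them to have
-- fewer than m vertices. Hence every p ∈ V(H) with d_H(p) < D has a neighbour outside V(H) that can
-- be hung on p as a leaf keeping H extendable, at the cost of one unit of margin; removing a leaf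
-- always keeps H extendable. Growing trees from the a_i and then from the b_j in this way (paths
-- first, then k levels of branching D - 1) gives at least 2m tips on each side at the right depths;
-- m of them on each side avoid the maximum-degree vertices of F unless F has at least m of those,
-- and m-bipartite-joinedness of G₂ provides an edge e between such tips. Then P is the tree path
-- to one tip, e, and the tree path from the other; {e} is (2,m,F)-bounded, and H + (P - e) is
-- obtained from the grown forest by removing leaves.

open import Defs renaming (sym to adj-sym)
open import Data.Nat using (ℕ; zero; suc; _+_; _*_; _∸_; _^_; _≤_; _<_; _≥_; z≤n; s≤s; s≤s⁻¹; _≤?_; _⊔_; _≡ᵇ_; _≟_)
open import Data.Nat.Properties
open import Data.Nat.Tactic.RingSolver using (solve-∀)
open import Data.Integer.Tactic.RingSolver using () renaming (solve-∀ to solveℤ)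
open import Data.Integer as ℤ using (ℤ; +_; -[1+_])
import Data.Integer.Properties as ℤ
open import Data.Bool using (Bool; true; false; _∧_; _∨_; not; if_then_else_)
open import Data.Bool.ListAction using (any)
open import Data.Bool.Properties using (T-≡; ∧-zeroʳ; ∧-identityʳ; ∨-identityʳ; ∨-comm; ∧-comm; not-involutive) renaming (_≟_ to _≟B_)
open import Data.Fin using (Fin; zero; suc; fromℕ; fromℕ<; toℕ; inject₁)
open import Data.Fin.Properties using (toℕ-injective; toℕ<n; toℕ-fromℕ; toℕ-fromℕ<; toℕ-inject₁) renaming (_≟_ to _≟F_)
import Data.Fin.Subset as Subset
open import Data.Fin.Subset.Properties using (anySubset?)
import Data.Vec as Vec
open import Data.Vec.Properties using (lookup∘tabulate)
open import Data.List using (List; []; _∷_; _++_; [_]; map; length; allFin; tabulate; take; filterᵇ; foldr)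
open import Data.List.Properties using (length-map; length-tabulate; map-tabulate; length-take; ++-assoc)
open import Data.List.Membership.Propositional using (_∈_)
open import Data.List.Membership.Propositional.Properties using (∈-allFin; ∈-map⁺; ∈-map⁻; ∈-++⁺ˡ; ∈-++⁺ʳ; ∈-++⁻; ∈-filter⁺; ∈-filter⁻)
open import Data.List.Relation.Unary.Any using (here; there)
open import Data.List.Relation.Unary.All as All using (All; []; _∷_)
import Data.List.Relation.Unary.All.Properties as All
open import Data.List.Relation.Unary.Unique.Propositional using (Unique; []; _∷_)
import Data.List.Relation.Unary.Unique.Propositional.Properties as Unique
open import Data.Sum using (_⊎_; inj₁; inj₂)
open import Data.Sum.Properties using (≡-dec; inj₁-injective; inj₂-injective)
open import Data.Product using (Σ; ∃; _×_; _,_; proj₁; proj₂; map₂)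
open import Data.Unit using (⊤; tt)
open import Data.Empty using (⊥; ⊥-elim)
open import Function.Base using (_∘_; case_of_)
open import Function.Bundles using (_⇔_; mk⇔; Equivalence)
open import Function.Definitions using (Injective)
open import Relation.Nullary using (¬_; Dec; yes; no)
open import Relation.Nullary.Decidable using (⌊_⌋; T?; _×-dec_; map′)
open import Relation.Binary.PropositionalEquality using (_≡_; _≢_; _≗_; refl; sym; trans; cong; cong₂; subst; subst₂; module ≡-Reasoning)

∨-introˡ : ∀ {a} b → a ≡ true → (a ∨ b) ≡ true
∨-introˡ b refl = refl

∨-introʳ : ∀ a {b} → b ≡ true → (a ∨ b) ≡ true
∨-introʳ true  _ = refl
∨-introʳ false e = e

∨-swapˡ : ∀ a b c → (a ∨ (b ∨ c)) ≡ (b ∨ (a ∨ c))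
∨-swapˡ true  true  c = refl
∨-swapˡ true  false c = refl
∨-swapˡ false b     c = refl

∨-swapʳ : ∀ a b c → ((a ∨ b) ∨ c) ≡ ((a ∨ c) ∨ b)
∨-swapʳ true  b c = refl
∨-swapʳ false b c = ∨-comm b c

∨-elim : ∀ {a b} → (a ∨ b) ≡ true → (a ≡ true) ⊎ (b ≡ true)
∨-elim {true}  _ = inj₁ refl
∨-elim {false} e = inj₂ e

∨-falseˡ : ∀ {a b} → (a ∨ b) ≡ false → a ≡ false
∨-falseˡ {false} _ = refl

∨-falseʳ : ∀ {a b} → (a ∨ b) ≡ false → b ≡ false
∨-falseʳ {false} e = e

∧-false : ∀ {a b} → (a ≡ true → b ≡ false) → (a ∧ b) ≡ false
∧-false {false} _ = refl
∧-false {true}  h = h refl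

∧-false-elim : ∀ {a b} → (a ∧ b) ≡ false → (a ≡ false) ⊎ (b ≡ false)
∧-false-elim {false} _ = inj₁ refl
∧-false-elim {true}  e = inj₂ e

∧-elim : ∀ {a b} → (a ∧ b) ≡ true → (a ≡ true) × (b ≡ true)
∧-elim {true} {true} _ = refl , refl

not-true : ∀ {b} → not b ≡ true → b ≡ false
not-true {false} _ = refl

true≢false : ∀ {b} → b ≡ true → b ≢ false
true≢false refl ()

¬true⇒false : ∀ {b} → (b ≡ true → ⊥) → b ≡ false
¬true⇒false {false} _ = refl
¬true⇒false {true}  h = ⊥-elim (h refl)

Bool-ext : ∀ {b c} → (b ≡ true → c ≡ true) → (c ≡ true → b ≡ true) → b ≡ c
Bool-ext {true}  {true}  _ _ = refl
Bool-ext {true}  {false} f _ = sym (f refl)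
Bool-ext {false} {true}  _ g = g refl
Bool-ext {false} {false} _ _ = refl

==-refl : {n : ℕ} (x : V n) → (x == x) ≡ true
==-refl x with ≡-dec _≟F_ _≟F_ x x
... | yes _   = refl
... | no  x≢x = ⊥-elim (x≢x refl)

==-≢ : {n : ℕ} {x y : V n} → x ≢ y → (x == y) ≡ false
==-≢ {x = x} {y} x≢y with ≡-dec _≟F_ _≟F_ x y
... | yes x≡y = ⊥-elim (x≢y x≡y)
... | no  _   = refl

==-complete : {n : ℕ} {x y : V n} → x ≡ y → (x == y) ≡ true
==-complete {x = x} refl = ==-refl x

==-sound : {n : ℕ} (x y : V n) → (x == y) ≡ true → x ≡ y
==-sound x y e with ≡-dec _≟F_ _≟F_ x y
... | yes x≡y = x≡y

data EqView {n : ℕ} (x y : V n) : Set where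
  equal    : x ≡ y → (x == y) ≡ true  → EqView x y
  distinct : x ≢ y → (x == y) ≡ false → EqView x y

eqView : {n : ℕ} (x y : V n) → EqView x y
eqView x y with ≡-dec _≟F_ _≟F_ x y
... | yes x≡y = equal x≡y (==-complete x≡y)
... | no  x≢y = distinct x≢y (==-≢ x≢y)

⟦_⟧ : Bool → ℕ
⟦ b ⟧ = if b then 1 else 0

⟦⟧≤1 : ∀ b → ⟦ b ⟧ ≤ 1
⟦⟧≤1 true  = s≤s z≤n
⟦⟧≤1 false = z≤n

∨⇒1≤⟦⟧+⟦⟧ : ∀ {c d} → (c ∨ d) ≡ true → 1 ≤ ⟦ c ⟧ + ⟦ d ⟧
∨⇒1≤⟦⟧+⟦⟧ {true}         _ = s≤s z≤n
∨⇒1≤⟦⟧+⟦⟧ {false} {true} _ = s≤s z≤n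

⟦⟧-submodular : ∀ {a b c d} → (a ≡ true → (c ∨ d) ≡ true) → (b ≡ true → (c ∨ d) ≡ true) →
  ((a ∧ b) ≡ true → (c ∧ d) ≡ true) → ⟦ a ⟧ + ⟦ b ⟧ ≤ ⟦ c ⟧ + ⟦ d ⟧
⟦⟧-submodular {false} {false}         _  _  _   = z≤n
⟦⟧-submodular {true}  {false} {c} {d} a⇒ _  _   = ∨⇒1≤⟦⟧+⟦⟧ {c} {d} (a⇒ refl)
⟦⟧-submodular {false} {true}  {c} {d} _  b⇒ _   = ∨⇒1≤⟦⟧+⟦⟧ {c} {d} (b⇒ refl)
⟦⟧-submodular {true}  {true}  {c} {d} _  _  ab⇒ with ∧-elim {c} {d} (ab⇒ refl)
... | refl , refl = ≤-refl

∑ : {A : Set} → (A → ℕ) → List A → ℕ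
∑ f []       = 0
∑ f (x ∷ xs) = f x + ∑ f xs

module _ {A : Set} where

  ∑-cong-∈ : {f g : A → ℕ} (xs : List A) → (∀ {x} → x ∈ xs → f x ≡ g x) → ∑ f xs ≡ ∑ g xs
  ∑-cong-∈ []       _ = refl
  ∑-cong-∈ (x ∷ xs) e = cong₂ _+_ (e (here refl)) (∑-cong-∈ xs (λ x∈xs → e (there x∈xs)))

  ∑-cong : {f g : A → ℕ} (xs : List A) → (∀ x → f x ≡ g x) → ∑ f xs ≡ ∑ g xs
  ∑-cong xs e = ∑-cong-∈ xs (λ {x} _ → e x)

  ∑-mono : {f g : A → ℕ} (xs : List A) → (∀ x → f x ≤ g x) → ∑ f xs ≤ ∑ g xs
  ∑-mono []       _ = z≤n
  ∑-mono (x ∷ xs) h = +-mono-≤ (h x) (∑-mono xs h)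

  ∑-+ : (f g : A → ℕ) (xs : List A) → ∑ (λ x → f x + g x) xs ≡ ∑ f xs + ∑ g xs
  ∑-+ f g []       = refl
  ∑-+ f g (x ∷ xs) = trans (cong (λ t → f x + g x + t) (∑-+ f g xs)) (interchange (f x) (g x) (∑ f xs) (∑ g xs))
    where
    interchange : ∀ a b c d → a + b + (c + d) ≡ a + c + (b + d)
    interchange = solve-∀

  ∑-update-∈ : {f g : A → ℕ} {p : A} → (∀ x → x ≢ p → f x ≡ g x) →
    {xs : List A} → Unique xs → p ∈ xs → ∑ f xs + g p ≡ ∑ g xs + f p
  ∑-update-∈ {f} {g} {p} f≗g {p ∷ ys} (p∉ys ∷ _) (here refl) = begin
    f p + ∑ f ys + g p ≡⟨ cong (λ t → f p + t + g p) (∑-cong-∈ ys (λ y∈ys → f≗g _ (p≢ y∈ys))) ⟩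
    f p + ∑ g ys + g p ≡⟨ swap (f p) (∑ g ys) (g p) ⟩
    g p + ∑ g ys + f p ∎
    where
    open ≡-Reasoning
    p≢ : ∀ {y} → y ∈ ys → y ≢ p
    p≢ y∈ys y≡p = All.lookup p∉ys y∈ys (sym y≡p)
    swap : ∀ a b c → a + b + c ≡ c + b + a
    swap = solve-∀
  ∑-update-∈ {f} {g} {p} f≗g {y ∷ ys} (y∉ys ∷ u) (there p∈ys) = begin
    f y + ∑ f ys + g p   ≡⟨ +-assoc (f y) _ _ ⟩
    f y + (∑ f ys + g p) ≡⟨ cong₂ _+_ (f≗g y (All.lookup y∉ys p∈ys)) (∑-update-∈ f≗g u p∈ys) ⟩
    g y + (∑ g ys + f p) ≡⟨ sym (+-assoc (g y) _ _) ⟩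
    g y + ∑ g ys + f p   ∎
    where open ≡-Reasoning

  count≡∑ : (P : A → Bool) (xs : List A) → count P xs ≡ ∑ (λ x → ⟦ P x ⟧) xs
  count≡∑ P []       = refl
  count≡∑ P (x ∷ xs) = cong (λ t → ⟦ P x ⟧ + t) (count≡∑ P xs)

  count-cong : {P Q : A → Bool} (xs : List A) → (∀ x → P x ≡ Q x) → count P xs ≡ count Q xs
  count-cong {P} {Q} xs P≗Q = begin
    count P xs               ≡⟨ count≡∑ P xs ⟩
    ∑ (λ x → ⟦ P x ⟧) xs     ≡⟨ ∑-cong xs (λ x → cong ⟦_⟧ (P≗Q x)) ⟩
    ∑ (λ x → ⟦ Q x ⟧) xs     ≡⟨ count≡∑ Q xs ⟨
    count Q xs               ∎
    where open ≡-Reasoning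

  count-mono : {P Q : A → Bool} (xs : List A) → (∀ x → P x ≡ true → Q x ≡ true) → count P xs ≤ count Q xs
  count-mono {P} {Q} xs P⊆Q =
    subst₂ _≤_ (sym (count≡∑ P xs)) (sym (count≡∑ Q xs)) (∑-mono xs (λ x → ⟦⟧-mono (P⊆Q x)))
    where
    ⟦⟧-mono : ∀ {a b} → (a ≡ true → b ≡ true) → ⟦ a ⟧ ≤ ⟦ b ⟧
    ⟦⟧-mono {false} _   = z≤n
    ⟦⟧-mono {true}  a⇒b rewrite a⇒b refl = s≤s z≤n

  count-zero : (P : A → Bool) (xs : List A) → (∀ x → P x ≡ false) → count P xs ≡ 0
  count-zero P []       _ = refl
  count-zero P (x ∷ xs) h rewrite h x = count-zero P xs h

  count-+ : (P Q : A → Bool) (xs : List A) → count P xs + count Q xs ≡ ∑ (λ x → ⟦ P x ⟧ + ⟦ Q x ⟧) xs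
  count-+ P Q xs = begin
    count P xs + count Q xs                       ≡⟨ cong₂ _+_ (count≡∑ P xs) (count≡∑ Q xs) ⟩
    ∑ (λ x → ⟦ P x ⟧) xs + ∑ (λ x → ⟦ Q x ⟧) xs   ≡⟨ ∑-+ _ _ xs ⟨
    ∑ (λ x → ⟦ P x ⟧ + ⟦ Q x ⟧) xs                ∎
    where open ≡-Reasoning

  count-∨ : (P Q : A → Bool) (xs : List A) → (∀ x → (P x ∧ Q x) ≡ false) →
    count (λ x → P x ∨ Q x) xs ≡ count P xs + count Q xs
  count-∨ P Q []       _        = refl
  count-∨ P Q (x ∷ xs) disjoint with P x | Q x | disjoint x
  ... | true  | false | _ = cong suc (count-∨ P Q xs disjoint)
  ... | false | true  | _ = trans (cong suc (count-∨ P Q xs disjoint)) (sym (+-suc _ _))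
  ... | false | false | _ = count-∨ P Q xs disjoint

  count-∨≤ : (P Q : A → Bool) (xs : List A) → count (λ x → P x ∨ Q x) xs ≤ count P xs + count Q xs
  count-∨≤ P Q xs = subst₂ _≤_ (sym (count≡∑ _ xs)) (sym (count-+ P Q xs)) (∑-mono xs (λ x → pointwise (P x) (Q x)))
    where
    pointwise : ∀ a b → ⟦ a ∨ b ⟧ ≤ ⟦ a ⟧ + ⟦ b ⟧
    pointwise true  _     = s≤s z≤n
    pointwise false true  = s≤s z≤n
    pointwise false false = z≤n

  count-modular : {P Q R S : A → Bool} (xs : List A) → (∀ x → ⟦ P x ⟧ + ⟦ Q x ⟧ ≡ ⟦ R x ⟧ + ⟦ S x ⟧) →
    count P xs + count Q xs ≡ count R xs + count S xs
  count-modular {P} {Q} {R} {S} xs pointwise =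
    trans (count-+ P Q xs) (trans (∑-cong xs pointwise) (sym (count-+ R S xs)))

  any-cong : {P Q : A → Bool} (xs : List A) → (∀ x → P x ≡ Q x) → any P xs ≡ any Q xs
  any-cong []       _   = refl
  any-cong (x ∷ xs) P≗Q = cong₂ _∨_ (P≗Q x) (any-cong xs P≗Q)

  any-false : (xs : List A) → any (λ _ → false) xs ≡ false
  any-false []       = refl
  any-false (_ ∷ xs) = any-false xs

  any-intro : (P : A → Bool) {x : A} {xs : List A} → x ∈ xs → P x ≡ true → any P xs ≡ true
  any-intro P {xs = y ∷ ys} (here refl) Px = ∨-introˡ (any P ys) Px
  any-intro P {xs = y ∷ ys} (there x∈ys) Px = ∨-introʳ (P y) (any-intro P x∈ys Px)

  any-elim : (P : A → Bool) (xs : List A) → any P xs ≡ true → Σ A λ x → (x ∈ xs) × (P x ≡ true)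
  any-elim P (y ∷ ys) h with ∨-elim {P y} h
  ... | inj₁ Py = y , here refl , Py
  ... | inj₂ rest with any-elim P ys rest
  ...   | x , x∈ys , Px = x , there x∈ys , Px

module _ {n : ℕ} where

  allV-complete : (x : V n) → x ∈ allV n
  allV-complete (inj₁ i) = ∈-++⁺ˡ (∈-map⁺ inj₁ (∈-allFin i))
  allV-complete (inj₂ i) = ∈-++⁺ʳ (map inj₁ (allFin n)) (∈-map⁺ inj₂ (∈-allFin i))

  allV-unique : Unique (allV n)
  allV-unique = Unique.++⁺ (Unique.map⁺ inj₁-injective (Unique.allFin⁺ n))
                           (Unique.map⁺ inj₂-injective (Unique.allFin⁺ n)) disjoint
    where
    disjoint : ∀ {x : V n} → ¬ ((x ∈ map inj₁ (allFin n)) × (x ∈ map inj₂ (allFin n)))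
    disjoint (x∈₁ , x∈₂) with ∈-map⁻ inj₁ x∈₁ | ∈-map⁻ inj₂ x∈₂
    ... | _ , _ , refl | _ , _ , ()

  ∑-extend : {f g : V n → ℕ} (p : V n) → (∀ x → x ≢ p → f x ≡ g x) → f p ≡ 0 →
    ∑ g (allV n) ≡ ∑ f (allV n) + g p
  ∑-extend {f} {g} p f≗g fp≡0 = sym (begin
    ∑ f (allV n) + g p   ≡⟨ ∑-update-∈ f≗g allV-unique (allV-complete p) ⟩
    ∑ g (allV n) + f p   ≡⟨ cong (λ t → ∑ g (allV n) + t) fp≡0 ⟩
    ∑ g (allV n) + 0     ≡⟨ +-identityʳ _ ⟩
    ∑ g (allV n)         ∎)
    where open ≡-Reasoning

  count-extend : {P Q : V n → Bool} (p : V n) → (∀ x → x ≢ p → P x ≡ Q x) → P p ≡ false →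
    count Q (allV n) ≡ count P (allV n) + ⟦ Q p ⟧
  count-extend {P} {Q} p P≗Q Pp = begin
    count Q (allV n)                        ≡⟨ count≡∑ Q (allV n) ⟩
    ∑ (λ x → ⟦ Q x ⟧) (allV n)              ≡⟨ ∑-extend p (λ x x≢p → cong ⟦_⟧ (P≗Q x x≢p)) (cong ⟦_⟧ Pp) ⟩
    ∑ (λ x → ⟦ P x ⟧) (allV n) + ⟦ Q p ⟧    ≡⟨ cong (_+ ⟦ Q p ⟧) (count≡∑ P (allV n)) ⟨
    count P (allV n) + ⟦ Q p ⟧              ∎
    where open ≡-Reasoning

  count-∧== : (P : V n → Bool) (p : V n) → count (λ x → P x ∧ (x == p)) (allV n) ≡ ⟦ P p ⟧
  count-∧== P p = begin
    count (λ x → P x ∧ (x == p)) (allV n)                ≡⟨ count-extend p off-p refl ⟩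
    count (λ _ → false) (allV n) + ⟦ P p ∧ (p == p) ⟧    ≡⟨ cong₂ (λ c b → c + ⟦ P p ∧ b ⟧) (count-zero _ (allV n) (λ _ → refl)) (==-refl p) ⟩
    ⟦ P p ∧ true ⟧                                       ≡⟨ cong ⟦_⟧ (∧-identityʳ (P p)) ⟩
    ⟦ P p ⟧                                              ∎
    where
    open ≡-Reasoning
    off-p : ∀ x → x ≢ p → false ≡ (P x ∧ (x == p))
    off-p x x≢p = sym (trans (cong (P x ∧_) (==-≢ x≢p)) (∧-zeroʳ (P x)))

  count≤2 : (P : V n → Bool) {u v : V n} → (∀ x → P x ≡ true → (x ≡ u) ⊎ (x ≡ v)) → count P (allV n) ≤ 2
  count≤2 P {u} {v} P⊆uv = begin
    count P (allV n)                                  ≤⟨ count-mono (allV n) uv ⟩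
    count (λ x → (x == u) ∨ (x == v)) (allV n)        ≤⟨ count-∨≤ _ _ (allV n) ⟩
    count (_== u) (allV n) + count (_== v) (allV n)   ≡⟨ cong₂ _+_ (count-∧== (λ _ → true) u) (count-∧== (λ _ → true) v) ⟩
    2                                                 ∎
    where
    open ≤-Reasoning
    uv : ∀ x → P x ≡ true → ((x == u) ∨ (x == v)) ≡ true
    uv x Px with P⊆uv x Px
    ... | inj₁ refl = ∨-introˡ _ (==-refl x)
    ... | inj₂ refl = ∨-introʳ _ (==-refl x)

  anyV-intro : (P : V n → Bool) (x : V n) → P x ≡ true → any P (allV n) ≡ true
  anyV-intro P x = any-intro P (allV-complete x)

  anyV-elim : (P : V n → Bool) → any P (allV n) ≡ true → Σ (V n) λ x → P x ≡ true
  anyV-elim P h with any-elim P (allV n) h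
  ... | x , _ , Px = x , Px

VSet : ℕ → Set
VSet n = V n → Bool

Adj : ℕ → Set
Adj n = V n → V n → Bool

module _ {n : ℕ} where

  _∪_ : VSet n → VSet n → VSet n
  (U ∪ W) x = U x ∨ W x

  _∩_ : VSet n → VSet n → VSet n
  (U ∩ W) x = U x ∧ W x

  insert : V n → VSet n → VSet n
  insert c U x = (x == c) ∨ U x

  insert-here : ∀ {c U} → insert c U c ≡ true
  insert-here {c} {U} = ∨-introˡ (U c) (==-refl c)

  insert-there : ∀ {c U x} → x ≢ c → insert c U x ≡ U x
  insert-there {U = U} {x} x≢c = cong (_∨ U x) (==-≢ x≢c)

  ∣insert∣ : ∀ {p} {W : VSet n} → W p ≡ false → ∣ insert p W ∣ ≡ ∣ W ∣ + 1
  ∣insert∣ {p} {W} p∉W = trans (count-extend p (λ x x≢p → sym (insert-there {U = W} x≢p)) p∉W)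
                               (cong (λ b → ∣ W ∣ + ⟦ b ⟧) (insert-here {U = W}))

  InPart : Fin 2 → VSet n → Set
  InPart i U = ∀ x → U x ≡ true → Part i x ≡ true

  deg-addEdge-other : (a : Adj n) {u v x : V n} → x ≢ u → x ≢ v → deg (addEdge a u v) x ≡ deg a x
  deg-addEdge-other a {u} {v} {x} x≢u x≢v = count-cong (allV n) λ y →
    trans (cong₂ (λ s t → a x y ∨ ((s ∧ (y == v)) ∨ (t ∧ (y == u)))) (==-≢ x≢u) (==-≢ x≢v)) (∨-identityʳ (a x y))

  deg-addEdge : (a : Adj n) {u v : V n} → u ≢ v → a u v ≡ false → a v u ≡ false →
    ∀ x → deg (addEdge a u v) x ≡ deg a x + ⟦ x == u ⟧ + ⟦ x == v ⟧
  deg-addEdge a {u} {v} u≢v auv avu x = begin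
    count (λ y → a x y ∨ (UV y ∨ VU y)) (allV n)              ≡⟨ count-∨ _ _ (allV n) (λ y → ∧-false (not-new y)) ⟩
    deg a x + count (λ y → UV y ∨ VU y) (allV n)               ≡⟨ cong (λ t → deg a x + t) (count-∨ _ _ (allV n) (λ _ → ∧-false UV⇒¬VU)) ⟩
    deg a x + (count UV (allV n) + count VU (allV n))          ≡⟨ cong₂ (λ s t → deg a x + (s + t)) (count-∧== _ v) (count-∧== _ u) ⟩
    deg a x + (⟦ x == u ⟧ + ⟦ x == v ⟧)                        ≡⟨ +-assoc (deg a x) _ _ ⟨
    deg a x + ⟦ x == u ⟧ + ⟦ x == v ⟧                          ∎
    where
    open ≡-Reasoning
    UV VU : VSet n
    UV y = (x == u) ∧ (y == v)
    VU y = (x == v) ∧ (y == u)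
    not-new : ∀ y → a x y ≡ true → (UV y ∨ VU y) ≡ false
    not-new y axy = cong₂ _∨_ (absent auv) (absent avu)
      where
      absent : ∀ {s t} → a s t ≡ false → ((x == s) ∧ (y == t)) ≡ false
      absent ast = ∧-false λ xs → ==-≢ λ y≡t →
        true≢false (subst₂ (λ s t → a s t ≡ true) (==-sound x _ xs) y≡t axy) ast
    UV⇒¬VU : ∀ {y} → UV y ≡ true → VU y ≡ false
    UV⇒¬VU {y} h with ∧-elim {x == u} h
    ... | xu , _ = ∧-false λ xv → ⊥-elim (u≢v (trans (sym (==-sound x u xu)) (==-sound x v xv)))

sumℤ-deficit : {A : Set} (P : A → Bool) (d : A → ℕ) (xs : List A) →
  sumℤ (λ x → if P x then + d x ℤ.- + 1 else + 0) xs ≡ + ∑ (λ x → if P x then d x else 0) xs ℤ.- + count P xs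
sumℤ-deficit P d [] = refl
sumℤ-deficit P d (x ∷ xs) with P x
... | false = trans (ℤ.+-identityˡ _) (sumℤ-deficit P d xs)
... | true  = begin
  (+ d x ℤ.- + 1) ℤ.+ sumℤ _ xs                      ≡⟨ cong (λ t → (+ d x ℤ.- + 1) ℤ.+ t) (sumℤ-deficit P d xs) ⟩
  (+ d x ℤ.- + 1) ℤ.+ (+ S ℤ.- + C)                  ≡⟨ regroup (+ d x) (+ S) (+ C) ⟩
  (+ d x ℤ.+ + S) ℤ.- (+ 1 ℤ.+ + C)                  ≡⟨ cong₂ (λ s c → s ℤ.- c) (ℤ.pos-+ (d x) S) (ℤ.pos-+ 1 C) ⟨
  + (d x + S) ℤ.- + (1 + C)                          ∎
  where
  open ≡-Reasoning
  S C : ℕ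
  S = ∑ (λ x → if P x then d x else 0) xs
  C = count P xs
  regroup : ∀ a s c → (a ℤ.- + 1) ℤ.+ (s ℤ.- c) ≡ (a ℤ.+ s) ℤ.- (+ 1 ℤ.+ c)
  regroup = solveℤ

ℤ-≤-rearrange : ∀ a s c k → ((+ a ℤ.- (+ s ℤ.- + c)) ℤ.≤ + k) ⇔ (a + c ≤ k + s)
ℤ-≤-rearrange a s c k = mk⇔ to from
  where
  cancel : ∀ t s → (t ℤ.+ s) ℤ.- s ≡ t
  cancel = solveℤ
  regroup : ∀ a s c → (a ℤ.- (s ℤ.- c)) ℤ.+ s ≡ a ℤ.+ c
  regroup = solveℤ
  lhs+s : (+ a ℤ.- (+ s ℤ.- + c)) ℤ.+ + s ≡ + (a + c)
  lhs+s = trans (regroup (+ a) (+ s) (+ c)) (sym (ℤ.pos-+ a c))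
  to : (+ a ℤ.- (+ s ℤ.- + c)) ℤ.≤ + k → a + c ≤ k + s
  to h = ℤ.drop‿+≤+ (subst₂ ℤ._≤_ lhs+s (sym (ℤ.pos-+ k s)) (ℤ.+-monoˡ-≤ (+ s) h))
  from : a + c ≤ k + s → (+ a ℤ.- (+ s ℤ.- + c)) ℤ.≤ + k
  from h = subst₂ ℤ._≤_ (trans (cong (ℤ._- + s) (sym lhs+s)) (cancel _ (+ s)))
                        (trans (cong (ℤ._- + s) (ℤ.pos-+ k s)) (cancel (+ k) (+ s)))
                        (ℤ.+-monoˡ-≤ (ℤ.- + s) (ℤ.+≤+ h))

opposite : Fin 2 → Fin 2
opposite zero       = suc zero
opposite (suc zero) = zero

opposite-involutive : ∀ i → opposite (opposite i) ≡ i
opposite-involutive zero       = refl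
opposite-involutive (suc zero) = refl

≢⇒opposite : ∀ {i j : Fin 2} → i ≢ j → i ≡ opposite j
≢⇒opposite {zero}     {zero}     i≢j = ⊥-elim (i≢j refl)
≢⇒opposite {zero}     {suc zero} _   = refl
≢⇒opposite {suc zero} {zero}     _   = refl
≢⇒opposite {suc zero} {suc zero} i≢j = ⊥-elim (i≢j refl)

module _ {n : ℕ} where

  Part-opposite : ∀ i (x : V n) → Part i x ≡ false → Part (opposite i) x ≡ true
  Part-opposite zero       (inj₂ _) _ = refl
  Part-opposite (suc zero) (inj₁ _) _ = refl

  Part-exclusive : ∀ i (x : V n) → Part i x ≡ true → Part (opposite i) x ≡ false
  Part-exclusive zero       (inj₁ _) _ = refl
  Part-exclusive (suc zero) (inj₂ _) _ = refl

module _ {n : ℕ} (a : Adj n) (u v : V n) where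

  addEdge-sym : (∀ x y → a x y ≡ a y x) → ∀ x y → addEdge a u v x y ≡ addEdge a u v y x
  addEdge-sym a-sym x y = cong₂ _∨_ (a-sym x y)
    (trans (∨-comm (UV x y) _) (cong₂ _∨_ (∧-comm (x == v) (y == u)) (∧-comm (x == u) (y == v))))
    where
    UV : V n → V n → Bool
    UV x y = (x == u) ∧ (y == v)

  addEdge-old : ∀ {x y} → a x y ≡ true → addEdge a u v x y ≡ true
  addEdge-old axy = ∨-introˡ _ axy

  addEdge-new : addEdge a u v u v ≡ true
  addEdge-new rewrite ==-refl u | ==-refl v = ∨-introʳ (a u v) refl

  addEdge-new′ : addEdge a u v v u ≡ true
  addEdge-new′ rewrite ==-refl u | ==-refl v = ∨-introʳ (a v u) (∨-introʳ ((v == u) ∧ (u == v)) refl)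

  addEdge-elim : ∀ {x y} → addEdge a u v x y ≡ true →
    (a x y ≡ true) ⊎ ((x ≡ u) × (y ≡ v)) ⊎ ((x ≡ v) × (y ≡ u))
  addEdge-elim {x} {y} h with ∨-elim {a x y} h
  ... | inj₁ axy = inj₁ axy
  ... | inj₂ new with ∨-elim {(x == u) ∧ (y == v)} new
  ...   | inj₁ xuyv = let (xu , yv) = ∧-elim xuyv in inj₂ (inj₁ (==-sound x u xu , ==-sound y v yv))
  ...   | inj₂ xvyu = let (xv , yu) = ∧-elim xvyu in inj₂ (inj₂ (==-sound x v xv , ==-sound y u yu))

module _ {n : ℕ} where

  ∣∣-cong : {U W : VSet n} → U ≗ W → ∣ U ∣ ≡ ∣ W ∣
  ∣∣-cong = count-cong (allV n)

  N-cong : (a : Adj n) {U W : VSet n} → U ≗ W → N a U ≗ N a W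
  N-cong a U≗W y = cong₂ (λ u nbr → not u ∧ nbr) (U≗W y) (any-cong (allV n) (λ x → cong (_∧ a x y) (U≗W x)))

  ∣∪∣+∣∩∣ : (U W : VSet n) → ∣ U ∪ W ∣ + ∣ U ∩ W ∣ ≡ ∣ U ∣ + ∣ W ∣
  ∣∪∣+∣∩∣ U W = count-modular (allV n) (λ x → pointwise (U x) (W x))
    where
    pointwise : ∀ a b → ⟦ a ∨ b ⟧ + ⟦ a ∧ b ⟧ ≡ ⟦ a ⟧ + ⟦ b ⟧
    pointwise true  true  = refl
    pointwise true  false = refl
    pointwise false true  = refl
    pointwise false false = refl

  ∑-∪∩ : (U W S : VSet n) (f : V n → ℕ) →
    ∑ (λ x → if ((U ∪ W) ∩ S) x then f x else 0) (allV n) + ∑ (λ x → if ((U ∩ W) ∩ S) x then f x else 0) (allV n) ≡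
    ∑ (λ x → if (U ∩ S) x then f x else 0) (allV n) + ∑ (λ x → if (W ∩ S) x then f x else 0) (allV n)
  ∑-∪∩ U W S f = begin
    _ ≡⟨ ∑-+ _ _ (allV n) ⟨
    _ ≡⟨ ∑-cong (allV n) (λ x → pointwise (U x) (W x) (S x) (f x)) ⟩
    _ ≡⟨ ∑-+ _ _ (allV n) ⟩
    _ ∎
    where
    open ≡-Reasoning
    pointwise : ∀ a b s k → (if (a ∨ b) ∧ s then k else 0) + (if (a ∧ b) ∧ s then k else 0) ≡
                            (if a ∧ s then k else 0) + (if b ∧ s then k else 0)
    pointwise true  true  true  k = refl
    pointwise true  false true  k = refl
    pointwise false true  true  k = +-comm k 0
    pointwise false false true  k = refl
    pointwise a     b     false k rewrite ∧-zeroʳ (a ∨ b) | ∧-zeroʳ (a ∧ b) | ∧-zeroʳ a | ∧-zeroʳ b = refl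

  ∣∪∩∣ : (U W S : VSet n) → ∣ (U ∪ W) ∩ S ∣ + ∣ (U ∩ W) ∩ S ∣ ≡ ∣ U ∩ S ∣ + ∣ W ∩ S ∣
  ∣∪∩∣ U W S = begin
    _ ≡⟨ cong₂ _+_ (count≡∑ _ (allV n)) (count≡∑ _ (allV n)) ⟩
    _ ≡⟨ ∑-∪∩ U W S (λ _ → 1) ⟩
    _ ≡⟨ cong₂ _+_ (count≡∑ _ (allV n)) (count≡∑ _ (allV n)) ⟨
    _ ∎
    where open ≡-Reasoning

  fromSubset : Fin 2 → Subset.Subset n → VSet n
  fromSubset zero       s (inj₁ j) = Vec.lookup s j
  fromSubset zero       s (inj₂ _) = false
  fromSubset (suc zero) s (inj₁ _) = false
  fromSubset (suc zero) s (inj₂ j) = Vec.lookup s j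

  toSubset : Fin 2 → VSet n → Subset.Subset n
  toSubset zero       U = Vec.tabulate (λ j → U (inj₁ j))
  toSubset (suc zero) U = Vec.tabulate (λ j → U (inj₂ j))

  fromSubset-inPart : ∀ i s → InPart i (fromSubset i s)
  fromSubset-inPart zero       s (inj₁ _) _ = refl
  fromSubset-inPart (suc zero) s (inj₂ _) _ = refl

  fromSubset∘toSubset : ∀ i U → InPart i U → fromSubset i (toSubset i U) ≗ U
  fromSubset∘toSubset zero       U _   (inj₁ j) = lookup∘tabulate _ j
  fromSubset∘toSubset (suc zero) U _   (inj₂ j) = lookup∘tabulate _ j
  fromSubset∘toSubset zero       U U⊆i (inj₂ j) with U (inj₂ j) in Uj
  ... | false = refl
  ... | true  with U⊆i (inj₂ j) Uj
  ...   | ()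
  fromSubset∘toSubset (suc zero) U U⊆i (inj₁ j) with U (inj₁ j) in Uj
  ... | false = refl
  ... | true  with U⊆i (inj₁ j) Uj
  ...   | ()

  any-inPart? : ∀ i (Q : VSet n → Set) → (∀ U → Dec (Q U)) → (∀ {U W} → U ≗ W → Q U → Q W) →
    Dec (Σ (VSet n) λ U → InPart i U × Q U)
  any-inPart? i Q Q? Q-resp = map′ to from (anySubset? (λ s → Q? (fromSubset i s)))
    where
    to : ∃ (λ s → Q (fromSubset i s)) → Σ (VSet n) λ U → InPart i U × Q U
    to (s , q) = fromSubset i s , fromSubset-inPart i s , q
    from : (Σ (VSet n) λ U → InPart i U × Q U) → ∃ (λ s → Q (fromSubset i s))
    from (U , U⊆i , q) = toSubset i U , Q-resp (λ x → sym (fromSubset∘toSubset i U U⊆i x)) q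

record IsSubgraph {n : ℕ} (G : Graph n) (vH : VSet n) (aH : Adj n) : Set where
  field
    symmetric : ∀ x y → aH x y ≡ aH y x
    edge∈G    : ∀ x y → aH x y ≡ true → adj G x y ≡ true
    endpoint∈ : ∀ x y → aH x y ≡ true → vH x ≡ true

module Extendability {n : ℕ} (G : Graph n) (bip : Bipartite G) (D m : ℕ) where

  degSum : Adj n → VSet n → VSet n → ℕ
  degSum aH vH U = ∑ (λ x → if (U ∩ vH) x then deg aH x else 0) (allV n)

  demand : VSet n → VSet n → ℕ
  demand vH U = (D ∸ 1) * ∣ U ∣ + ∣ U ∩ vH ∣

  supply : VSet n → Adj n → VSet n → ℕ
  supply vH aH U = ∣N∖ adj G ∣ U vH + degSum aH vH U

  IsExtendable : VSet n → Adj n → Set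
  IsExtendable vH aH =
    (∀ x → deg aH x ≤ D) ×
    (∀ i U → InPart i U → ∣ U ∣ ≤ 2 * m → demand vH U ≤ supply vH aH U)

  extendable⇔ : ∀ vH aH → Extendable D m (adj G) vH aH ⇔ IsExtendable vH aH
  extendable⇔ vH aH =
    mk⇔ (map₂ λ ext i U U⊆i |U|≤2m → Equivalence.to   (inequality⇔ U) (ext i U U⊆i |U|≤2m))
        (map₂ λ ext i U U⊆i |U|≤2m → Equivalence.from (inequality⇔ U) (ext i U U⊆i |U|≤2m))
    where
    deficit : VSet n → ℤ
    deficit U = (+ (D ∸ 1) ℤ.* + ∣ U ∣) ℤ.- sumℤ (λ x → if U x ∧ vH x then (+ deg aH x) ℤ.- + 1 else + 0) (allV n)
    inequality⇔ : ∀ U → (deficit U ℤ.≤ + ∣N∖ adj G ∣ U vH) ⇔ (demand vH U ≤ supply vH aH U)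
    inequality⇔ U = subst (λ d → (d ℤ.≤ + ∣N∖ adj G ∣ U vH) ⇔ (demand vH U ≤ supply vH aH U))
      (cong₂ ℤ._-_ (ℤ.pos-* (D ∸ 1) ∣ U ∣) (sym (sumℤ-deficit (U ∩ vH) (deg aH) (allV n))))
      (ℤ-≤-rearrange ((D ∸ 1) * ∣ U ∣) (degSum aH vH U) ∣ U ∩ vH ∣ (∣N∖ adj G ∣ U vH))

  Part-cross : ∀ i {x y} → Part i x ≡ true → adj G x y ≡ true → Part (opposite i) y ≡ true
  Part-cross i {x} {y} x∈i xy with Part i y in y∈i
  ... | false = Part-opposite i y y∈i
  ... | true  = ⊥-elim (true≢false xy (bip i x y x∈i y∈i))

  neighbour∉ : ∀ i U → InPart i U → ∀ {x y} → U x ≡ true → adj G x y ≡ true → U y ≡ false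
  neighbour∉ i U U⊆i {x} {y} x∈U xy with U y in y∈U
  ... | false = refl
  ... | true  = ⊥-elim (true≢false xy (bip i x y (U⊆i x x∈U) (U⊆i y y∈U)))

  N-intro : ∀ U {x y} → U y ≡ false → U x ≡ true → adj G x y ≡ true → N (adj G) U y ≡ true
  N-intro U {x} {y} y∉U x∈U xy =
    cong₂ _∧_ (cong not y∉U) (anyV-intro (λ z → U z ∧ adj G z y) x (cong₂ _∧_ x∈U xy))

  N-elim : ∀ U y → N (adj G) U y ≡ true → (U y ≡ false) × Σ (V n) λ x → (U x ≡ true) × (adj G x y ≡ true)
  N-elim U y h with ∧-elim {not (U y)} h
  ... | y∉U , nbr with anyV-elim (λ z → U z ∧ adj G z y) nbr
  ...   | x , x∈U∧xy = not-true y∉U , x , ∧-elim x∈U∧xy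

  N-samePart : ∀ i U y → InPart i U → Part i y ≡ true → N (adj G) U y ≡ false
  N-samePart i U y U⊆i y∈i with N (adj G) U y in y∈N
  ... | false = refl
  ... | true with N-elim U y y∈N
  ...   | _ , x , x∈U , xy = ⊥-elim (true≢false xy (bip i x y (U⊆i x x∈U) y∈i))

  N-mono : ∀ {U W} y → (∀ x → U x ≡ true → W x ≡ true) → W y ≡ false → N (adj G) U y ≡ true → N (adj G) W y ≡ true
  N-mono {U} {W} y U⊆W y∉W y∈NU with N-elim U y y∈NU
  ... | _ , x , x∈U , xy = N-intro W y∉W (U⊆W x x∈U) xy

  module AddLeaf {vH aH} (H : IsSubgraph G vH aH) {p c : V n}
                 (p∈H : vH p ≡ true) (c∉H : vH c ≡ false) (pc : adj G p c ≡ true) where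

    open IsSubgraph H

    vH⁺ : VSet n
    vH⁺ = insert c vH

    aH⁺ : Adj n
    aH⁺ = addEdge aH p c

    p≢c : p ≢ c
    p≢c refl = true≢false pc (loopless G p)

    no-edge-at-c : ∀ y → aH c y ≡ false
    no-edge-at-c y with aH c y in cy
    ... | false = refl
    ... | true  = ⊥-elim (true≢false (endpoint∈ c y cy) c∉H)

    deg⁺ : ∀ x → deg aH⁺ x ≡ deg aH x + ⟦ x == p ⟧ + ⟦ x == c ⟧
    deg⁺ = deg-addEdge aH p≢c (trans (symmetric p c) (no-edge-at-c p)) (no-edge-at-c p)

    deg⁺-p : deg aH⁺ p ≡ suc (deg aH p)
    deg⁺-p rewrite deg⁺ p | ==-refl p | ==-≢ p≢c = trans (+-identityʳ _) (+-comm (deg aH p) 1)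

    deg⁺-c : deg aH⁺ c ≡ 1
    deg⁺-c rewrite deg⁺ c | ==-refl c | ==-≢ (λ c≡p → p≢c (sym c≡p)) | count-zero _ (allV n) no-edge-at-c = refl

    deg≤deg⁺ : ∀ x → deg aH x ≤ deg aH⁺ x
    deg≤deg⁺ x = subst (deg aH x ≤_) (sym (deg⁺ x)) (≤-trans (m≤m+n _ _) (m≤m+n _ _))

    demand⁺ : ∀ U → demand vH⁺ U ≡ demand vH U + ⟦ U c ⟧
    demand⁺ U = begin
      (D ∸ 1) * ∣ U ∣ + ∣ U ∩ vH⁺ ∣               ≡⟨ cong (λ t → (D ∸ 1) * ∣ U ∣ + t) grow ⟩
      (D ∸ 1) * ∣ U ∣ + (∣ U ∩ vH ∣ + ⟦ U c ⟧)     ≡⟨ +-assoc ((D ∸ 1) * ∣ U ∣) _ _ ⟨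
      demand vH U + ⟦ U c ⟧                       ∎
      where
      open ≡-Reasoning
      grow : ∣ U ∩ vH⁺ ∣ ≡ ∣ U ∩ vH ∣ + ⟦ U c ⟧
      grow = begin
        ∣ U ∩ vH⁺ ∣                      ≡⟨ count-extend c (λ x x≢c → cong (U x ∧_) (sym (insert-there {U = vH} x≢c)))
                                                            (trans (cong (U c ∧_) c∉H) (∧-zeroʳ (U c))) ⟩
        ∣ U ∩ vH ∣ + ⟦ U c ∧ vH⁺ c ⟧     ≡⟨ cong (λ b → ∣ U ∩ vH ∣ + ⟦ U c ∧ b ⟧) (insert-here {U = vH}) ⟩
        ∣ U ∩ vH ∣ + ⟦ U c ∧ true ⟧      ≡⟨ cong (λ b → ∣ U ∩ vH ∣ + ⟦ b ⟧) (∧-identityʳ (U c)) ⟩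
        ∣ U ∩ vH ∣ + ⟦ U c ⟧             ∎

    nbr⁺ : ∀ U → ∣N∖ adj G ∣ U vH⁺ + ⟦ N (adj G) U c ⟧ ≡ ∣N∖ adj G ∣ U vH
    nbr⁺ U = sym (begin
      ∣N∖ adj G ∣ U vH                                             ≡⟨ count-extend c unchanged c∈H⁺ ⟩
      ∣N∖ adj G ∣ U vH⁺ + ⟦ N (adj G) U c ∧ not (vH c) ⟧            ≡⟨ cong (λ b → ∣N∖ adj G ∣ U vH⁺ + ⟦ N (adj G) U c ∧ not b ⟧) c∉H ⟩
      ∣N∖ adj G ∣ U vH⁺ + ⟦ N (adj G) U c ∧ true ⟧                  ≡⟨ cong (λ b → ∣N∖ adj G ∣ U vH⁺ + ⟦ b ⟧) (∧-identityʳ _) ⟩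
      ∣N∖ adj G ∣ U vH⁺ + ⟦ N (adj G) U c ⟧                         ∎)
      where
      open ≡-Reasoning
      unchanged : ∀ x → x ≢ c → (N (adj G) U x ∧ not (vH⁺ x)) ≡ (N (adj G) U x ∧ not (vH x))
      unchanged x x≢c = cong (λ b → N (adj G) U x ∧ not b) (insert-there {U = vH} x≢c)
      c∈H⁺ : (N (adj G) U c ∧ not (vH⁺ c)) ≡ false
      c∈H⁺ = trans (cong (λ b → N (adj G) U c ∧ not b) (insert-here {U = vH})) (∧-zeroʳ _)

    degSum⁺ : ∀ U → degSum aH⁺ vH⁺ U ≡ degSum aH vH U + ⟦ U p ⟧ + ⟦ U c ⟧
    degSum⁺ U = begin
      ∑ term⁺ (allV n)                                                     ≡⟨ ∑-cong (allV n) pointwise ⟩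
      ∑ (λ x → term x + ⟦ U x ∧ (x == p) ⟧ + ⟦ U x ∧ (x == c) ⟧) (allV n)  ≡⟨ ∑-+ _ _ (allV n) ⟩
      ∑ (λ x → term x + ⟦ U x ∧ (x == p) ⟧) (allV n) + ∑ (at c) (allV n)   ≡⟨ cong (λ t → t + ∑ (at c) (allV n)) (∑-+ _ _ (allV n)) ⟩
      degSum aH vH U + ∑ (at p) (allV n) + ∑ (at c) (allV n)                ≡⟨ cong₂ (λ s t → degSum aH vH U + s + t) (∑-at p) (∑-at c) ⟩
      degSum aH vH U + ⟦ U p ⟧ + ⟦ U c ⟧                                    ∎
      where
      open ≡-Reasoning
      term term⁺ : V n → ℕ
      term  x = if U x ∧ vH x  then deg aH x  else 0
      term⁺ x = if U x ∧ vH⁺ x then deg aH⁺ x else 0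
      at : V n → V n → ℕ
      at q x = ⟦ U x ∧ (x == q) ⟧
      ∑-at : ∀ q → ∑ (at q) (allV n) ≡ ⟦ U q ⟧
      ∑-at q = trans (sym (count≡∑ _ (allV n))) (count-∧== U q)
      deg-c : deg aH c ≡ 0
      deg-c = count-zero _ (allV n) no-edge-at-c
      pointwise : ∀ x → term⁺ x ≡ term x + at p x + at c x
      pointwise x with eqView x c
      ... | equal refl _ rewrite deg⁺ c | ==-refl c | ==-≢ (λ c≡p → p≢c (sym c≡p)) | c∉H | deg-c with U c
      ...   | true  = refl
      ...   | false = refl
      pointwise x | distinct x≢c _ with eqView x p
      ... | equal refl _ rewrite deg⁺ p | ==-refl p | ==-≢ p≢c | p∈H with U p
      ...   | true  = refl
      ...   | false = refl
      pointwise x | distinct x≢c _ | distinct x≢p _ rewrite deg⁺ x | ==-≢ x≢p | ==-≢ x≢c with U x | vH x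
      ...   | true  | true  = refl
      ...   | true  | false = refl
      ...   | false | _     = refl

    supply⁺ : ∀ U → supply vH⁺ aH⁺ U + ⟦ N (adj G) U c ⟧ ≡ supply vH aH U + ⟦ U p ⟧ + ⟦ U c ⟧
    supply⁺ U = begin
      ∣N∖ adj G ∣ U vH⁺ + degSum aH⁺ vH⁺ U + ⟦ N (adj G) U c ⟧        ≡⟨ swap (∣N∖ adj G ∣ U vH⁺) (degSum aH⁺ vH⁺ U) _ ⟩
      ∣N∖ adj G ∣ U vH⁺ + ⟦ N (adj G) U c ⟧ + degSum aH⁺ vH⁺ U        ≡⟨ cong₂ _+_ (nbr⁺ U) (degSum⁺ U) ⟩
      ∣N∖ adj G ∣ U vH + (degSum aH vH U + ⟦ U p ⟧ + ⟦ U c ⟧)         ≡⟨ regroup (∣N∖ adj G ∣ U vH) (degSum aH vH U) ⟦ U p ⟧ ⟦ U c ⟧ ⟩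
      supply vH aH U + ⟦ U p ⟧ + ⟦ U c ⟧                              ∎
      where
      open ≡-Reasoning
      swap : ∀ a b c → a + b + c ≡ a + c + b
      swap = solve-∀
      regroup : ∀ a b c d → a + (b + c + d) ≡ a + b + c + d
      regroup = solve-∀

    ⟦p∈U⟧≤⟦c∈NU⟧ : ∀ i U → InPart i U → ⟦ U p ⟧ ≤ ⟦ N (adj G) U c ⟧
    ⟦p∈U⟧≤⟦c∈NU⟧ i U U⊆i with U p in p∈U
    ... | false = z≤n
    ... | true  rewrite N-intro U (neighbour∉ i U U⊆i p∈U pc) p∈U pc = s≤s z≤n

    extendable⁻ : IsExtendable vH⁺ aH⁺ → IsExtendable vH aH
    extendable⁻ (Δ≤D , ext) = (λ x → ≤-trans (deg≤deg⁺ x) (Δ≤D x)) , ext⁻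
      where
      ext⁻ : ∀ i U → InPart i U → ∣ U ∣ ≤ 2 * m → demand vH U ≤ supply vH aH U
      ext⁻ i U U⊆i |U|≤2m = +-cancelʳ-≤ (u + w) _ _ (begin
        demand vH U + (u + w)                   ≡⟨ +-assoc (demand vH U) u w ⟨
        demand vH U + u + w                     ≡⟨ cong (_+ w) (demand⁺ U) ⟨
        demand vH⁺ U + w                        ≤⟨ +-monoˡ-≤ w (ext i U U⊆i |U|≤2m) ⟩
        supply vH⁺ aH⁺ U + w                    ≡⟨ supply⁺ U ⟩
        supply vH aH U + ⟦ U p ⟧ + u            ≤⟨ +-monoˡ-≤ u (+-monoʳ-≤ (supply vH aH U) (⟦p∈U⟧≤⟦c∈NU⟧ i U U⊆i)) ⟩
        supply vH aH U + w + u                  ≡⟨ +-assoc (supply vH aH U) w u ⟩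
        supply vH aH U + (w + u)                ≡⟨ cong (λ t → supply vH aH U + t) (+-comm w u) ⟩
        supply vH aH U + (u + w)                ∎)
        where
        open ≤-Reasoning
        u w : ℕ
        u = ⟦ U c ⟧
        w = ⟦ N (adj G) U c ⟧

  _≗₂_ : Adj n → Adj n → Set
  a ≗₂ b = ∀ x y → a x y ≡ b x y

  nbr-cong : {vH vH' U W : VSet n} → vH ≗ vH' → U ≗ W → ∣N∖ adj G ∣ U vH ≡ ∣N∖ adj G ∣ W vH'
  nbr-cong vH≗ U≗W = count-cong (allV n) (λ y → cong₂ (λ b h → b ∧ not h) (N-cong (adj G) U≗W y) (vH≗ y))

  degSum-cong : {aH aH' : Adj n} {vH vH' U W : VSet n} → aH ≗₂ aH' → vH ≗ vH' → U ≗ W →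
    degSum aH vH U ≡ degSum aH' vH' W
  degSum-cong aH≗ vH≗ U≗W = ∑-cong (allV n) λ x →
    cong₂ (λ b d → if b then d else 0) (cong₂ _∧_ (U≗W x) (vH≗ x)) (count-cong (allV n) (aH≗ x))

  demand-cong : {vH vH' U W : VSet n} → vH ≗ vH' → U ≗ W → demand vH U ≡ demand vH' W
  demand-cong vH≗ U≗W =
    cong₂ (λ s t → (D ∸ 1) * s + t) (∣∣-cong U≗W) (∣∣-cong (λ x → cong₂ _∧_ (U≗W x) (vH≗ x)))

  supply-cong : {aH aH' : Adj n} {vH vH' U W : VSet n} → aH ≗₂ aH' → vH ≗ vH' → U ≗ W →
    supply vH aH U ≡ supply vH' aH' W
  supply-cong aH≗ vH≗ U≗W = cong₂ _+_ (nbr-cong vH≗ U≗W) (degSum-cong aH≗ vH≗ U≗W)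

  IsExtendable-cong : {aH aH' : Adj n} {vH vH' : VSet n} → aH ≗₂ aH' → vH ≗ vH' →
    IsExtendable vH aH → IsExtendable vH' aH'
  IsExtendable-cong aH≗ vH≗ (Δ≤D , ext) =
    (λ x → subst (_≤ D) (count-cong (allV n) (aH≗ x)) (Δ≤D x)) ,
    (λ i U U⊆i |U|≤2m → subst₂ _≤_ (demand-cong vH≗ (λ _ → refl)) (supply-cong aH≗ vH≗ (λ _ → refl))
                                   (ext i U U⊆i |U|≤2m))

  demand-modular : ∀ vH U W → demand vH (U ∪ W) + demand vH (U ∩ W) ≡ demand vH U + demand vH W
  demand-modular vH U W = begin
    k * ∣ U ∪ W ∣ + ∣ (U ∪ W) ∩ vH ∣ + (k * ∣ U ∩ W ∣ + ∣ (U ∩ W) ∩ vH ∣)  ≡⟨ regroup k _ _ _ _ ⟩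
    k * (∣ U ∪ W ∣ + ∣ U ∩ W ∣) + (∣ (U ∪ W) ∩ vH ∣ + ∣ (U ∩ W) ∩ vH ∣)  ≡⟨ cong₂ (λ s t → k * s + t) (∣∪∣+∣∩∣ U W) (∣∪∩∣ U W vH) ⟩
    k * (∣ U ∣ + ∣ W ∣) + (∣ U ∩ vH ∣ + ∣ W ∩ vH ∣)                      ≡⟨ regroup k _ _ _ _ ⟨
    k * ∣ U ∣ + ∣ U ∩ vH ∣ + (k * ∣ W ∣ + ∣ W ∩ vH ∣)                      ∎
    where
    open ≡-Reasoning
    k : ℕ
    k = D ∸ 1
    regroup : ∀ k a b c d → k * a + b + (k * c + d) ≡ k * (a + c) + (b + d)
    regroup = solve-∀

  nbr-submodular : ∀ vH U W →
    ∣N∖ adj G ∣ (U ∪ W) vH + ∣N∖ adj G ∣ (U ∩ W) vH ≤ ∣N∖ adj G ∣ U vH + ∣N∖ adj G ∣ W vH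
  nbr-submodular vH U W = subst₂ _≤_ (sym (count-+ _ _ (allV n))) (sym (count-+ _ _ (allV n)))
                                     (∑-mono (allV n) pointwise)
    where
    NU NW N∪ N∩ : VSet n
    NU  = N (adj G) U
    NW  = N (adj G) W
    N∪ = N (adj G) (U ∪ W)
    N∩ = N (adj G) (U ∩ W)
    ∪⇒ : ∀ {y} → N∪ y ≡ true → (NU y ∨ NW y) ≡ true
    ∪⇒ {y} h with N-elim (U ∪ W) y h
    ... | y∉U∪W , x , x∈U∪W , xy with ∨-elim {U x} x∈U∪W
    ...   | inj₁ x∈U = ∨-introˡ (NW y) (N-intro U (∨-falseˡ y∉U∪W) x∈U xy)
    ...   | inj₂ x∈W = ∨-introʳ (NU y) (N-intro W (∨-falseʳ {U y} y∉U∪W) x∈W xy)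
    ∩⇒ : ∀ {y} → N∩ y ≡ true → (NU y ∨ NW y) ≡ true
    ∩⇒ {y} h with N-elim (U ∩ W) y h
    ... | y∉U∩W , x , x∈U∩W , xy with ∧-elim {U x} x∈U∩W | ∧-false-elim {U y} y∉U∩W
    ...   | x∈U , x∈W | inj₁ y∉U = ∨-introˡ (NW y) (N-intro U y∉U x∈U xy)
    ...   | x∈U , x∈W | inj₂ y∉W = ∨-introʳ (NU y) (N-intro W y∉W x∈W xy)
    ∪∩⇒ : ∀ {y} → (N∪ y ∧ N∩ y) ≡ true → (NU y ∧ NW y) ≡ true
    ∪∩⇒ {y} h with ∧-elim {N∪ y} h
    ... | y∈N∪ , y∈N∩ with N-elim (U ∪ W) y y∈N∪ | N-elim (U ∩ W) y y∈N∩
    ...   | y∉U∪W , _ | _ , x , x∈U∩W , xy with ∧-elim {U x} x∈U∩W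
    ...     | x∈U , x∈W = cong₂ _∧_ (N-intro U (∨-falseˡ y∉U∪W) x∈U xy)
                                    (N-intro W (∨-falseʳ {U y} y∉U∪W) x∈W xy)
    pointwise : ∀ y → ⟦ N∪ y ∧ not (vH y) ⟧ + ⟦ N∩ y ∧ not (vH y) ⟧ ≤ ⟦ NU y ∧ not (vH y) ⟧ + ⟦ NW y ∧ not (vH y) ⟧
    pointwise y with vH y
    ... | true  rewrite ∧-zeroʳ (N∪ y) | ∧-zeroʳ (N∩ y) = z≤n
    ... | false rewrite ∧-identityʳ (N∪ y) | ∧-identityʳ (N∩ y) | ∧-identityʳ (NU y) | ∧-identityʳ (NW y) =
      ⟦⟧-submodular {N∪ y} {N∩ y} {NU y} {NW y} ∪⇒ ∩⇒ ∪∩⇒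

  supply-submodular : ∀ vH aH U W →
    supply vH aH (U ∪ W) + supply vH aH (U ∩ W) ≤ supply vH aH U + supply vH aH W
  supply-submodular vH aH U W =
    subst₂ _≤_ (interchange (∣N∖ adj G ∣ (U ∪ W) vH) (degSum aH vH (U ∪ W)) (∣N∖ adj G ∣ (U ∩ W) vH) (degSum aH vH (U ∩ W)))
               (interchange (∣N∖ adj G ∣ U vH) (degSum aH vH U) (∣N∖ adj G ∣ W vH) (degSum aH vH W))
               (+-mono-≤ (nbr-submodular vH U W) (≤-reflexive (∑-∪∩ U W vH (deg aH))))
    where
    interchange : ∀ a b c d → a + c + (b + d) ≡ a + b + (c + d)
    interchange = solve-∀

  Tight : VSet n → Adj n → VSet n → Set
  Tight vH aH U = supply vH aH U ≤ demand vH U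

  Margin : VSet n → ℕ → Set
  Margin vH R = ∀ i U → InPart i U → m ≤ ∣ U ∣ → ∣ U ∣ ≤ 2 * m → 2 * D * m + R < ∣N∖ adj G ∣ U vH

  demand≤D*∣∣ : 1 ≤ D → ∀ vH U → demand vH U ≤ D * ∣ U ∣
  demand≤D*∣∣ 1≤D vH U = begin
    (D ∸ 1) * ∣ U ∣ + ∣ U ∩ vH ∣   ≤⟨ +-monoʳ-≤ ((D ∸ 1) * ∣ U ∣) (count-mono (allV n) (λ x → proj₁ ∘ ∧-elim)) ⟩
    (D ∸ 1) * ∣ U ∣ + ∣ U ∣        ≡⟨ cong (λ t → (D ∸ 1) * ∣ U ∣ + t) (*-identityˡ ∣ U ∣) ⟨
    (D ∸ 1) * ∣ U ∣ + 1 * ∣ U ∣    ≡⟨ *-distribʳ-+ ∣ U ∣ (D ∸ 1) 1 ⟨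
    (D ∸ 1 + 1) * ∣ U ∣            ≡⟨ cong (_* ∣ U ∣) (m∸n+n≡m 1≤D) ⟩
    D * ∣ U ∣                      ∎
    where open ≤-Reasoning

  tight⇒small : 1 ≤ D → ∀ {vH aH} → Margin vH 0 → ∀ i U → InPart i U → ∣ U ∣ ≤ 2 * m → Tight vH aH U → ∣ U ∣ < m
  tight⇒small 1≤D {vH} {aH} margin i U U⊆i |U|≤2m tight with m ≤? ∣ U ∣
  ... | no  |U|≱m = ≰⇒> |U|≱m
  ... | yes m≤|U| = ⊥-elim (<-irrefl refl (begin-strict
    2 * D * m                         ≡⟨ +-identityʳ _ ⟨
    2 * D * m + 0                     <⟨ margin i U U⊆i m≤|U| |U|≤2m ⟩
    ∣N∖ adj G ∣ U vH                  ≤⟨ m≤m+n _ _ ⟩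
    supply vH aH U                    ≤⟨ tight ⟩
    demand vH U                       ≤⟨ demand≤D*∣∣ 1≤D vH U ⟩
    D * ∣ U ∣                         ≤⟨ *-monoʳ-≤ D |U|≤2m ⟩
    D * (2 * m)                       ≡⟨ *-assoc D 2 m ⟨
    D * 2 * m                         ≡⟨ cong (_* m) (*-comm D 2) ⟩
    2 * D * m                         ∎))
    where open ≤-Reasoning

  tight-∪ : ∀ {vH aH} → IsExtendable vH aH → ∀ i {U W} → InPart i U → InPart i W →
    ∣ U ∣ < m → ∣ W ∣ < m → Tight vH aH U → Tight vH aH W → Tight vH aH (U ∪ W)
  tight-∪ {vH} {aH} (_ , ext) i {U} {W} U⊆i W⊆i |U|<m |W|<m tightU tightW =
    +-cancelʳ-≤ (demand vH (U ∩ W)) _ _ (begin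
      supply vH aH (U ∪ W) + demand vH (U ∩ W)   ≤⟨ +-monoʳ-≤ (supply vH aH (U ∪ W)) (ext i (U ∩ W) U∩W⊆i |U∩W|≤2m) ⟩
      supply vH aH (U ∪ W) + supply vH aH (U ∩ W) ≤⟨ supply-submodular vH aH U W ⟩
      supply vH aH U + supply vH aH W             ≤⟨ +-mono-≤ tightU tightW ⟩
      demand vH U + demand vH W                   ≡⟨ demand-modular vH U W ⟨
      demand vH (U ∪ W) + demand vH (U ∩ W)       ∎)
    where
    open ≤-Reasoning
    U∩W⊆i : InPart i (U ∩ W)
    U∩W⊆i x x∈U∩W = U⊆i x (proj₁ (∧-elim x∈U∩W))
    |U∩W|≤2m : ∣ U ∩ W ∣ ≤ 2 * m
    |U∩W|≤2m = ≤-trans (count-mono (allV n) (λ x → proj₁ ∘ ∧-elim)) (≤-trans (<⇒≤ |U|<m) (m≤n*m m 2))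

  InPart-∌ : ∀ {i} {U : VSet n} {y} → InPart i U → Part (opposite i) y ≡ true → U y ≡ false
  InPart-∌ {i} {U} {y} U⊆i y∈i' with U y in y∈U
  ... | false = refl
  ... | true  = ⊥-elim (true≢false y∈i' (Part-exclusive i y (U⊆i y y∈U)))

  ∣∪∣≤ : (U W : VSet n) → ∣ U ∪ W ∣ ≤ ∣ U ∣ + ∣ W ∣
  ∣∪∣≤ U W = ≤-trans (m≤m+n _ _) (≤-reflexive (∣∪∣+∣∩∣ U W))

  supply-∅ : ∀ vH aH → supply vH aH (λ _ → false) ≡ 0
  supply-∅ vH aH = cong₂ _+_ (count-zero _ (allV n) (λ y → cong (λ b → b ∧ not (vH y)) (any-false (allV n))))
                             (trans (sym (count≡∑ (λ _ → false) (allV n))) (count-zero _ (allV n) (λ _ → refl)))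

  insert-inPart : ∀ {i p} {W : VSet n} → InPart i W → Part i p ≡ true → InPart i (insert p W)
  insert-inPart {p = p} {W} W⊆i p∈i x x∈ with eqView x p
  ... | equal refl _   = p∈i
  ... | distinct x≢p _ = W⊆i x (trans (sym (insert-there {U = W} x≢p)) x∈)

  demand-insert : 1 ≤ D → ∀ {vH W : VSet n} {p} → W p ≡ false → vH p ≡ true → demand vH (insert p W) ≡ demand vH W + D
  demand-insert 1≤D {vH} {W} {p} p∉W p∈H = begin
    (D ∸ 1) * ∣ insert p W ∣ + ∣ insert p W ∩ vH ∣   ≡⟨ cong₂ (λ s t → (D ∸ 1) * s + t) (∣insert∣ {W = W} p∉W) |W⁺∩H| ⟩
    (D ∸ 1) * (∣ W ∣ + 1) + (∣ W ∩ vH ∣ + 1)         ≡⟨ regroup (D ∸ 1) ∣ W ∣ ∣ W ∩ vH ∣ ⟩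
    demand vH W + (D ∸ 1 + 1)                        ≡⟨ cong (λ t → demand vH W + t) (m∸n+n≡m 1≤D) ⟩
    demand vH W + D                                  ∎
    where
    open ≡-Reasoning
    regroup : ∀ k s t → k * (s + 1) + (t + 1) ≡ k * s + t + (k + 1)
    regroup = solve-∀
    |W⁺∩H| : ∣ insert p W ∩ vH ∣ ≡ ∣ W ∩ vH ∣ + 1
    |W⁺∩H| = trans (count-extend p (λ x x≢p → cong (_∧ vH x) (sym (insert-there {U = W} x≢p))) (cong (_∧ vH p) p∉W))
                   (trans (cong (λ b → ∣ W ∩ vH ∣ + ⟦ b ∧ vH p ⟧) (insert-here {U = W}))
                          (cong (λ b → ∣ W ∩ vH ∣ + ⟦ b ⟧) p∈H))

  degSum-insert : ∀ {aH} {vH W : VSet n} {p} → W p ≡ false → vH p ≡ true → degSum aH vH (insert p W) ≡ degSum aH vH W + deg aH p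
  degSum-insert {aH} {vH} {W} {p} p∉W p∈H =
    trans (∑-extend p (λ x x≢p → cong (λ b → if b ∧ vH x then deg aH x else 0) (sym (insert-there {U = W} x≢p)))
                      (cong (λ b → if b ∧ vH p then deg aH p else 0) p∉W))
          (trans (cong (λ b → degSum aH vH W + (if b ∧ vH p then deg aH p else 0)) (insert-here {U = W}))
                 (cong (λ b → degSum aH vH W + (if b then deg aH p else 0)) p∈H))

  -- If some neighbour y ∉ V(H) of p is not blocked by a tight set, hanging y on p keeps H extendable;
  -- otherwise the blocking sets unite into a barrier, which cannot exist.
  module Extension {vH aH} (H : IsSubgraph G vH aH) (ext : IsExtendable vH aH) (margin : Margin vH 0) (1≤m : 1 ≤ m)
                   {p : V n} {ip : Fin 2} (p∈ip : Part ip p ≡ true) (p∈H : vH p ≡ true) (dp<D : deg aH p < D) where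

    1≤D : 1 ≤ D
    1≤D = ≤-trans (s≤s z≤n) dp<D

    Candidate : V n → Set
    Candidate y = (adj G p y ≡ true) × (vH y ≡ false)

    candidate? : ∀ y → Dec (Candidate y)
    candidate? y = (adj G p y ≟B true) ×-dec (vH y ≟B false)

    Blocks : V n → VSet n → Set
    Blocks y U = (∣ U ∣ ≤ 2 * m) × Tight vH aH U × (N (adj G) U y ≡ true) × (U p ≡ false)

    Blocked : V n → Set
    Blocked y = Σ (VSet n) λ U → InPart ip U × Blocks y U

    blocked? : ∀ y → Dec (Blocked y)
    blocked? y = any-inPart? ip (Blocks y) decide respects
      where
      decide : ∀ U → Dec (Blocks y U)
      decide U = (∣ U ∣ ≤? 2 * m) ×-dec (supply vH aH U ≤? demand vH U) ×-dec
                 (N (adj G) U y ≟B true) ×-dec (U p ≟B false)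
      respects : ∀ {U W} → U ≗ W → Blocks y U → Blocks y W
      respects U≗W (size , tight , y∈N , p∉U) =
        subst (_≤ 2 * m) (∣∣-cong U≗W) size ,
        subst₂ _≤_ (supply-cong (λ _ _ → refl) (λ _ → refl) U≗W) (demand-cong (λ _ → refl) U≗W) tight ,
        trans (sym (N-cong (adj G) U≗W y)) y∈N ,
        trans (sym (U≗W p)) p∉U

    Extension : Set
    Extension = Σ (V n) λ c → Candidate c × IsExtendable (insert c vH) (addEdge aH p c)

    unblocked⇒extension : ∀ {y} → Candidate y → ¬ Blocked y → Extension
    unblocked⇒extension {y} (py , y∉H) unblocked = y , (py , y∉H) , Δ⁺≤D , ext⁺
      where
      open AddLeaf H p∈H y∉H py
      Δ⁺≤D : ∀ x → deg aH⁺ x ≤ D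
      Δ⁺≤D x with eqView x p | eqView x y
      ... | equal refl _ | _           = subst (_≤ D) (sym deg⁺-p) dp<D
      ... | distinct _ _ | equal refl _ = subst (_≤ D) (sym deg⁺-c) 1≤D
      ... | distinct x≢p _ | distinct x≢y _ = subst (_≤ D) (sym (deg-addEdge-other aH x≢p x≢y)) (proj₁ ext x)
      -- Only the sets U with y ∈ N(U) and p ∉ U lose supply; these are exactly the ones that could block y.
      key-inequality : ∀ i U → InPart i U → ∣ U ∣ ≤ 2 * m → demand vH U + ⟦ N (adj G) U y ⟧ ≤ supply vH aH U + ⟦ U p ⟧
      key-inequality i U U⊆i |U|≤2m with N (adj G) U y in y∈N | U p in p∈U
      ... | false | _     = ≤-trans (≤-reflexive (+-identityʳ _)) (≤-trans (proj₂ ext i U U⊆i |U|≤2m) (m≤m+n _ _))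
      ... | true  | true  = +-monoˡ-≤ 1 (proj₂ ext i U U⊆i |U|≤2m)
      ... | true  | false with i ≟F ip
      ...   | yes refl = subst₂ _≤_ (+-comm 1 _) (sym (+-identityʳ _))
                                    (≰⇒> λ tight → unblocked (U , U⊆i , |U|≤2m , tight , y∈N , p∈U))
      ...   | no  i≢ip = ⊥-elim (true≢false y∈N (N-samePart i U y U⊆i y∈i))
        where
        y∈i : Part i y ≡ true
        y∈i = subst (λ j → Part j y ≡ true) (sym (≢⇒opposite i≢ip)) (Part-cross ip p∈ip py)
      ext⁺ : ∀ i U → InPart i U → ∣ U ∣ ≤ 2 * m → demand vH⁺ U ≤ supply vH⁺ aH⁺ U
      ext⁺ i U U⊆i |U|≤2m = +-cancelʳ-≤ w _ _ (begin
        demand vH⁺ U + w                ≡⟨ cong (_+ w) (demand⁺ U) ⟩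
        demand vH U + u + w             ≡⟨ +-assoc (demand vH U) u w ⟩
        demand vH U + (u + w)           ≡⟨ cong (λ t → demand vH U + t) (+-comm u w) ⟩
        demand vH U + (w + u)           ≡⟨ +-assoc (demand vH U) w u ⟨
        demand vH U + w + u             ≤⟨ +-monoˡ-≤ u (key-inequality i U U⊆i |U|≤2m) ⟩
        supply vH aH U + ⟦ U p ⟧ + u    ≡⟨ supply⁺ U ⟨
        supply vH⁺ aH⁺ U + w            ∎)
        where
        open ≤-Reasoning
        u w : ℕ
        u = ⟦ U y ⟧
        w = ⟦ N (adj G) U y ⟧

    record Barrier (ys : List (V n)) : Set where
      field
        W      : VSet n
        W⊆ip   : InPart ip W
        tight  : Tight vH aH W
        small  : ∣ W ∣ < m
        p∉W    : W p ≡ false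
        covers : ∀ {y} → y ∈ ys → Candidate y → N (adj G) W y ≡ true

    empty-barrier : Barrier []
    empty-barrier = record
      { W = λ _ → false ; W⊆ip = λ _ () ; tight = ≤-trans (≤-reflexive (supply-∅ vH aH)) z≤n
      ; small = subst (_< m) (sym (count-zero _ (allV n) (λ _ → refl))) 1≤m ; p∉W = refl ; covers = λ () }

    candidate∉ : ∀ {U y} → InPart ip U → Candidate y → U y ≡ false
    candidate∉ U⊆ip (py , _) = InPart-∌ U⊆ip (Part-cross ip p∈ip py)

    barrier-∪ : ∀ {y ys} → Barrier ys → Blocked y → Barrier (y ∷ ys)
    barrier-∪ {y} {ys} B (U , U⊆ip , |U|≤2m , tightU , y∈NU , p∉U) = record
      { W = W ∪ U ; W⊆ip = W∪U⊆ip ; tight = tight∪ ; small = small∪ ; p∉W = cong₂ _∨_ p∉W p∉U ; covers = covers∪ }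
      where
      open Barrier B
      W∪U⊆ip : InPart ip (W ∪ U)
      W∪U⊆ip x x∈W∪U with ∨-elim {W x} x∈W∪U
      ... | inj₁ x∈W = W⊆ip x x∈W
      ... | inj₂ x∈U = U⊆ip x x∈U
      |U|<m : ∣ U ∣ < m
      |U|<m = tight⇒small 1≤D margin ip U U⊆ip |U|≤2m tightU
      tight∪ : Tight vH aH (W ∪ U)
      tight∪ = tight-∪ ext ip W⊆ip U⊆ip small |U|<m tight tightU
      small∪ : ∣ W ∪ U ∣ < m
      small∪ = tight⇒small 1≤D margin ip (W ∪ U) W∪U⊆ip
        (≤-trans (∣∪∣≤ W U) (≤-trans (+-mono-≤ (<⇒≤ small) (<⇒≤ |U|<m)) (≤-reflexive (cong (λ t → m + t) (sym (+-identityʳ m))))))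
        tight∪
      covers∪ : ∀ {z} → z ∈ y ∷ ys → Candidate z → N (adj G) (W ∪ U) z ≡ true
      covers∪ (here refl)  cand = N-mono y (λ x → ∨-introʳ (W x)) (candidate∉ W∪U⊆ip cand) y∈NU
      covers∪ (there z∈ys) cand = N-mono _ (λ x → ∨-introˡ (U x)) (candidate∉ W∪U⊆ip cand) (covers z∈ys cand)

    extend-barrier : ∀ {y ys} → Barrier ys → ¬ Candidate y → Barrier (y ∷ ys)
    extend-barrier B ¬cand = record { W = W ; W⊆ip = W⊆ip ; tight = tight ; small = small ; p∉W = p∉W ; covers = λ where
      (here refl)  cand → ⊥-elim (¬cand cand)
      (there z∈ys) cand → covers z∈ys cand }
      where open Barrier B

    search : (ys : List (V n)) → Extension ⊎ Barrier ys
    search []       = inj₂ empty-barrier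
    search (y ∷ ys) with search ys
    ... | inj₁ found = inj₁ found
    ... | inj₂ B with candidate? y
    ...   | no  ¬cand = inj₂ (extend-barrier B ¬cand)
    ...   | yes cand with blocked? y
    ...     | no  unblocked = inj₁ (unblocked⇒extension cand unblocked)
    ...     | yes blocked   = inj₂ (barrier-∪ B blocked)

    -- Adding p to a barrier W raises the demand by D but the supply by at most d_H(p) < D,
    -- since every neighbour of p outside V(H) already lies in N(W).
    no-barrier : Barrier (allV n) → ⊥
    no-barrier B = <⇒≱ dp<D (+-cancelˡ-≤ (demand vH W) _ _ (begin
      demand vH W + D                                ≡⟨ demand-insert 1≤D p∉W p∈H ⟨
      demand vH (insert p W)                         ≤⟨ proj₂ ext ip (insert p W) (insert-inPart W⊆ip p∈ip) |W⁺|≤2m ⟩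
      supply vH aH (insert p W)                      ≤⟨ +-mono-≤ nbr-W⁺ (≤-reflexive (degSum-insert p∉W p∈H)) ⟩
      ∣N∖ adj G ∣ W vH + (degSum aH vH W + deg aH p) ≡⟨ +-assoc (∣N∖ adj G ∣ W vH) _ _ ⟨
      supply vH aH W + deg aH p                      ≤⟨ +-monoˡ-≤ (deg aH p) tight ⟩
      demand vH W + deg aH p                         ∎))
      where
      open Barrier B
      open ≤-Reasoning
      |W⁺|≤2m : ∣ insert p W ∣ ≤ 2 * m
      |W⁺|≤2m = ≤-trans (≤-reflexive (trans (∣insert∣ {W = W} p∉W) (+-comm ∣ W ∣ 1))) (≤-trans small (m≤n*m m 2))
      nbr-W⁺ : ∣N∖ adj G ∣ (insert p W) vH ≤ ∣N∖ adj G ∣ W vH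
      nbr-W⁺ = count-mono (allV n) pointwise
        where
        pointwise : ∀ y → (N (adj G) (insert p W) y ∧ not (vH y)) ≡ true → (N (adj G) W y ∧ not (vH y)) ≡ true
        pointwise y h with ∧-elim {N (adj G) (insert p W) y} h
        ... | y∈NW⁺ , y∉H with N-elim (insert p W) y y∈NW⁺
        ...   | y∉W⁺ , x , x∈W⁺ , xy with eqView x p
        ...     | equal refl _   = trans (cong (_∧ not (vH y)) (covers (allV-complete y) (xy , not-true y∉H))) y∉H
        ...     | distinct x≢p _ = trans (cong (_∧ not (vH y)) (N-intro W (∨-falseʳ y∉W⁺) x∈W xy)) y∉H
          where
          x∈W : W x ≡ true
          x∈W = trans (sym (insert-there {U = W} x≢p)) x∈W⁺

    extension : Extension
    extension with search (allV n)
    ... | inj₁ found   = found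
    ... | inj₂ barrier = ⊥-elim (no-barrier barrier)

module Forests {n : ℕ} (G : Graph n) (bip : Bipartite G) (D m : ℕ) (vH : VSet n) (aH : Adj n) where

  open Extendability G bip D m

  Edge : Set
  Edge = V n × V n

  parent child : Edge → V n
  parent = proj₁
  child  = proj₂

  vsOf : List Edge → VSet n
  vsOf []             = vH
  vsOf ((_ , c) ∷ es) = insert c (vsOf es)

  adjOf : List Edge → Adj n
  adjOf []             = aH
  adjOf ((p , c) ∷ es) = addEdge (adjOf es) p c

  -- The list records leaves hung onto H one at a time, the most recent first.
  Forest : List Edge → Set
  Forest []             = ⊤
  Forest ((p , c) ∷ es) = Forest es × (vsOf es p ≡ true) × (vsOf es c ≡ false) × (adj G p c ≡ true)

  Joins : Edge → V n → V n → Set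
  Joins e x y = ((x ≡ parent e) × (y ≡ child e)) ⊎ ((x ≡ child e) × (y ≡ parent e))

  vH⊆vsOf : ∀ es {x} → vH x ≡ true → vsOf es x ≡ true
  vH⊆vsOf []             x∈H = x∈H
  vH⊆vsOf ((_ , c) ∷ es) x∈H = ∨-introʳ _ (vH⊆vsOf es x∈H)

  vsOf-++ : ∀ X es {x} → vsOf es x ≡ true → vsOf (X ++ es) x ≡ true
  vsOf-++ []             es x∈ = x∈
  vsOf-++ ((_ , c) ∷ X) es x∈ = ∨-introʳ _ (vsOf-++ X es x∈)

  child∈vsOf : ∀ es {e} → e ∈ es → vsOf es (child e) ≡ true
  child∈vsOf ((_ , c) ∷ es) (here refl)  = insert-here {U = vsOf es}
  child∈vsOf ((_ , c) ∷ es) (there e∈es) = ∨-introʳ _ (child∈vsOf es e∈es)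

  vsOf⁻ : ∀ es {x} → vsOf es x ≡ true → (vH x ≡ true) ⊎ (Σ Edge λ e → (e ∈ es) × (x ≡ child e))
  vsOf⁻ []             x∈ = inj₁ x∈
  vsOf⁻ ((p , c) ∷ es) {x} x∈ with eqView x c
  ... | equal x≡c _     = inj₂ ((p , c) , here refl , x≡c)
  ... | distinct x≢c x==c with vsOf⁻ es (trans (sym (insert-there {U = vsOf es} x≢c)) x∈)
  ...   | inj₁ x∈H            = inj₁ x∈H
  ...   | inj₂ (e , e∈ , x≡) = inj₂ (e , there e∈ , x≡)

  adjOf-H : ∀ es {x y} → aH x y ≡ true → adjOf es x y ≡ true
  adjOf-H []             xy = xy
  adjOf-H ((p , c) ∷ es) xy = addEdge-old (adjOf es) p c (adjOf-H es xy)

  adjOf⁺ : ∀ es {e x y} → e ∈ es → Joins e x y → adjOf es x y ≡ true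
  adjOf⁺ ((p , c) ∷ es) (here refl) (inj₁ (refl , refl)) = addEdge-new (adjOf es) p c
  adjOf⁺ ((p , c) ∷ es) (here refl) (inj₂ (refl , refl)) = addEdge-new′ (adjOf es) p c
  adjOf⁺ ((p , c) ∷ es) (there e∈) joins = addEdge-old (adjOf es) p c (adjOf⁺ es e∈ joins)

  adjOf⁻ : ∀ es {x y} → adjOf es x y ≡ true → (aH x y ≡ true) ⊎ (Σ Edge λ e → (e ∈ es) × Joins e x y)
  adjOf⁻ []             xy = inj₁ xy
  adjOf⁻ ((p , c) ∷ es) xy with addEdge-elim (adjOf es) p c xy
  ... | inj₁ old     = Data.Sum.map₂ (λ (e , e∈ , j) → e , there e∈ , j) (adjOf⁻ es old)
  ... | inj₂ (inj₁ (x≡p , y≡c)) = inj₂ ((p , c) , here refl , inj₁ (x≡p , y≡c))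
  ... | inj₂ (inj₂ (x≡c , y≡p)) = inj₂ ((p , c) , here refl , inj₂ (x≡c , y≡p))

  vsOf-⊆ : ∀ L′ L → (∀ {e} → e ∈ L′ → e ∈ L) → ∀ {x} → vsOf L′ x ≡ true → vsOf L x ≡ true
  vsOf-⊆ L′ L L′⊆L x∈ with vsOf⁻ L′ x∈
  ... | inj₁ x∈H              = vH⊆vsOf L x∈H
  ... | inj₂ (e , e∈ , refl) = child∈vsOf L (L′⊆L e∈)

  isSubgraphOf : IsSubgraph G vH aH → ∀ es → (∀ {e} → e ∈ es → adj G (parent e) (child e) ≡ true) →
    (∀ {e} → e ∈ es → vsOf es (parent e) ≡ true) → IsSubgraph G (vsOf es) (adjOf es)
  isSubgraphOf H es inG parents∈ = record { symmetric = symmetric es ; edge∈G = edge∈G ; endpoint∈ = endpoint∈ }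
    where
    symmetric : ∀ es x y → adjOf es x y ≡ adjOf es y x
    symmetric []             = IsSubgraph.symmetric H
    symmetric ((p , c) ∷ es) = addEdge-sym (adjOf es) p c (symmetric es)
    edge∈G : ∀ x y → adjOf es x y ≡ true → adj G x y ≡ true
    edge∈G x y xy with adjOf⁻ es xy
    ... | inj₁ xy∈H                        = IsSubgraph.edge∈G H x y xy∈H
    ... | inj₂ (e , e∈ , inj₁ (refl , refl)) = inG e∈
    ... | inj₂ (e , e∈ , inj₂ (refl , refl)) = trans (adj-sym G (child e) (parent e)) (inG e∈)
    endpoint∈ : ∀ x y → adjOf es x y ≡ true → vsOf es x ≡ true
    endpoint∈ x y xy with adjOf⁻ es xy
    ... | inj₁ xy∈H                        = vH⊆vsOf es (IsSubgraph.endpoint∈ H x y xy∈H)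
    ... | inj₂ (e , e∈ , inj₁ (refl , refl)) = parents∈ e∈
    ... | inj₂ (e , e∈ , inj₂ (refl , refl)) = child∈vsOf es e∈

  Forest-edge∈G : ∀ es → Forest es → ∀ {e} → e ∈ es → adj G (parent e) (child e) ≡ true
  Forest-edge∈G ((p , c) ∷ es) (_ , _ , _ , pc) (here refl) = pc
  Forest-edge∈G ((p , c) ∷ es) (F , _ , _ , _)  (there e∈)  = Forest-edge∈G es F e∈

  Forest-parent∈ : ∀ es → Forest es → ∀ {e} → e ∈ es → vsOf es (parent e) ≡ true
  Forest-parent∈ ((p , c) ∷ es) (_ , p∈ , _ , _) (here refl) = ∨-introʳ _ p∈
  Forest-parent∈ ((p , c) ∷ es) (F , _ , _ , _)  (there e∈)  = ∨-introʳ _ (Forest-parent∈ es F e∈)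

  Forest-isSubgraph : IsSubgraph G vH aH → ∀ es → Forest es → IsSubgraph G (vsOf es) (adjOf es)
  Forest-isSubgraph H es F = isSubgraphOf H es (Forest-edge∈G es F) (Forest-parent∈ es F)

  vsOf-swap : ∀ K p c es → vsOf (K ++ (p , c) ∷ es) ≗ insert c (vsOf (K ++ es))
  vsOf-swap []              p c es x = refl
  vsOf-swap ((_ , c′) ∷ K) p c es x rewrite vsOf-swap K p c es x = ∨-swapˡ (x == c′) (x == c) _

  adjOf-swap : ∀ K p c es → adjOf (K ++ (p , c) ∷ es) ≗₂ addEdge (adjOf (K ++ es)) p c
  adjOf-swap []              p c es x y = refl
  adjOf-swap ((p′ , c′) ∷ K) p c es x y rewrite adjOf-swap K p c es x y = ∨-swapʳ (adjOf (K ++ es) x y) _ _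

  -- K holds the kept edges newer than es. A dropped edge (p , c) then ends in a leaf c: older edges
  -- predate c, and the kept ones have their parents among the kept vertices.
  prune : IsSubgraph G vH aH → (keep : Edge → Bool) → ∀ es K → Forest es →
    (∀ {e} → e ∈ K → adj G (parent e) (child e) ≡ true) →
    (∀ {e} → e ∈ K → vsOf es (child e) ≡ false) →
    (∀ {e} → e ∈ K ++ filterᵇ keep es → vsOf (K ++ filterᵇ keep es) (parent e) ≡ true) →
    IsExtendable (vsOf (K ++ es)) (adjOf (K ++ es)) →
    IsExtendable (vsOf (K ++ filterᵇ keep es)) (adjOf (K ++ filterᵇ keep es))
  prune H keep []             K _                     _    _    _      ext = ext
  prune H keep ((p , c) ∷ es) K (F , p∈ , c∉ , pc) K⊆G K-new closed ext with keep (p , c)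
  ... | true rewrite sym (++-assoc K [ (p , c) ] (filterᵇ keep es)) | sym (++-assoc K [ (p , c) ] es) =
    prune H keep es (K ++ [ (p , c) ]) F K⊆G′ K-new′ closed ext
    where
    K⊆G′ : ∀ {e} → e ∈ K ++ [ (p , c) ] → adj G (parent e) (child e) ≡ true
    K⊆G′ e∈ with ∈-++⁻ K e∈
    ... | inj₁ e∈K        = K⊆G e∈K
    ... | inj₂ (here refl) = pc
    K-new′ : ∀ {e} → e ∈ K ++ [ (p , c) ] → vsOf es (child e) ≡ false
    K-new′ e∈ with ∈-++⁻ K e∈
    ... | inj₁ e∈K        = ∨-falseʳ (K-new e∈K)
    ... | inj₂ (here refl) = c∉
  ... | false = prune H keep es K F K⊆G (λ e∈K → ∨-falseʳ (K-new e∈K)) closed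
                  (AddLeaf.extendable⁻ L-isSubgraph (vsOf-++ K es p∈) c∉L pc
                     (IsExtendable-cong (adjOf-swap K p c es) (vsOf-swap K p c es) ext))
    where
    L : List Edge
    L = K ++ es
    L-isSubgraph : IsSubgraph G (vsOf L) (adjOf L)
    L-isSubgraph = isSubgraphOf H L inG parents∈
      where
      inG : ∀ {e} → e ∈ L → adj G (parent e) (child e) ≡ true
      inG e∈ with ∈-++⁻ K e∈
      ... | inj₁ e∈K  = K⊆G e∈K
      ... | inj₂ e∈es = Forest-edge∈G es F e∈es
      kept⊆L : ∀ {e} → e ∈ K ++ filterᵇ keep es → e ∈ L
      kept⊆L e∈ with ∈-++⁻ K e∈
      ... | inj₁ e∈K   = ∈-++⁺ˡ e∈K
      ... | inj₂ e∈kept = ∈-++⁺ʳ K (proj₁ (∈-filter⁻ (T? ∘ keep) e∈kept))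
      parents∈ : ∀ {e} → e ∈ L → vsOf L (parent e) ≡ true
      parents∈ e∈ with ∈-++⁻ K e∈
      ... | inj₁ e∈K  = vsOf-⊆ (K ++ filterᵇ keep es) L kept⊆L (closed (∈-++⁺ˡ e∈K))
      ... | inj₂ e∈es = vsOf-++ K es (Forest-parent∈ es F e∈es)
    c∉L : vsOf L c ≡ false
    c∉L = ¬true⇒false λ c∈L → case vsOf⁻ L c∈L of λ where
      (inj₁ c∈H)             → true≢false (vH⊆vsOf es c∈H) c∉
      (inj₂ (e , e∈ , c≡e)) → case ∈-++⁻ K e∈ of λ where
        (inj₁ e∈K)  → true≢false (subst (λ z → insert c (vsOf es) z ≡ true) c≡e (insert-here {U = vsOf es})) (K-new e∈K)
        (inj₂ e∈es) → true≢false (subst (λ z → vsOf es z ≡ true) (sym c≡e) (child∈vsOf es e∈es)) c∉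

extendPath : {A : Set} → (ℕ → A) → ℕ → A → ℕ → A
extendPath u d y j with j ≤? d
... | yes _ = u j
... | no  _ = y

extendPath-old : {A : Set} (u : ℕ → A) → ∀ {d} {y : A} {j} → j ≤ d → extendPath u d y j ≡ u j
extendPath-old u {d} {y} {j} j≤d with j ≤? d
... | yes _   = refl
... | no  j≰d = ⊥-elim (j≰d j≤d)

extendPath-new : {A : Set} (u : ℕ → A) → ∀ {d} {y : A} → extendPath u d y (suc d) ≡ y
extendPath-new u {d} with suc d ≤? d
... | yes sd≤d = ⊥-elim (1+n≰n sd≤d)
... | no  _    = refl

flips : ℕ → Fin 2 → Fin 2
flips zero    i = i
flips (suc t) i = flips t (opposite i)

depthAfter : ℕ → ℕ → ℕ
depthAfter zero    d = d
depthAfter (suc t) d = depthAfter t (suc d)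

tipsAfter : ℕ → ℕ → ℕ → ℕ
tipsAfter zero    c L = L
tipsAfter (suc t) c L = tipsAfter t c (c * L)

cost : ℕ → ℕ → ℕ → ℕ
cost zero    c L = 0
cost (suc t) c L = c * L + cost t c (c * L)

module Growth {n : ℕ} (G : Graph n) (bip : Bipartite G) (D m : ℕ) {vH : VSet n} {aH : Adj n}
              (H : IsSubgraph G vH aH) (1≤m : 1 ≤ m) where

  open Extendability G bip D m
  open Forests G bip D m vH aH

  Viable : List Edge → ℕ → Set
  Viable es R = Forest es × IsExtendable (vsOf es) (adjOf es) × Margin (vsOf es) R

  record NewLeaf (es : List Edge) (R : ℕ) (p : V n) : Set where
    field
      leaf     : V n
      viable   : Viable ((p , leaf) ∷ es) R
      edge     : adj G p leaf ≡ true
      fresh    : vsOf es leaf ≡ false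
      deg-p    : deg (adjOf ((p , leaf) ∷ es)) p ≡ suc (deg (adjOf es) p)
      deg-leaf : deg (adjOf ((p , leaf) ∷ es)) leaf ≡ 1

  Margin-weaken : ∀ {vs R} → Margin vs R → Margin vs 0
  Margin-weaken margin i U U⊆i m≤ ≤2m = ≤-trans (s≤s (+-monoʳ-≤ (2 * D * m) z≤n)) (margin i U U⊆i m≤ ≤2m)

  addLeaf : ∀ {es R} → Viable es (suc R) → ∀ {p ip} → Part ip p ≡ true → vsOf es p ≡ true →
    deg (adjOf es) p < D → NewLeaf es R p
  addLeaf {es} {R} (F , ext , margin) {p} p∈ip p∈ dp<D
    with Extension.extension (Forest-isSubgraph H es F) ext (Margin-weaken margin) 1≤m p∈ip p∈ dp<D
  ... | y , (py , y∉) , ext⁺ = record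
    { leaf = y ; viable = (F , p∈ , y∉ , py) , ext⁺ , margin⁺ ; edge = py ; fresh = y∉
    ; deg-p = deg⁺-p ; deg-leaf = deg⁺-c }
    where
    open AddLeaf (Forest-isSubgraph H es F) p∈ y∉ py
    -- Each added vertex removes at most one vertex from any N(U) ∖ V(H).
    margin⁺ : Margin vH⁺ R
    margin⁺ i U U⊆i m≤ ≤2m = +-cancelʳ-≤ _ _ _ (begin
      suc (2 * D * m + R) + 1              ≡⟨ cong (_+ 1) (sym (+-suc (2 * D * m) R)) ⟩
      2 * D * m + suc R + 1                ≡⟨ +-comm _ 1 ⟩
      suc (2 * D * m + suc R)              ≤⟨ margin i U U⊆i m≤ ≤2m ⟩
      ∣N∖ adj G ∣ U (vsOf es)              ≡⟨ nbr⁺ U ⟨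
      ∣N∖ adj G ∣ U vH⁺ + ⟦ N (adj G) U y ⟧ ≤⟨ +-monoʳ-≤ (∣N∖ adj G ∣ U vH⁺) (⟦⟧≤1 _) ⟩
      ∣N∖ adj G ∣ U vH⁺ + 1                ∎)
      where open ≤-Reasoning

  -- A path is the sequence u 0 , … , u d; the values u j for j > d are irrelevant.
  record RootedPath (es : List Edge) (B : VSet n) (Root : V n → Set) (d : ℕ) (ip : Fin 2) (u : ℕ → V n) : Set where
    field
      rooted    : Root (u 0)
      edges     : ∀ j → j < d → (u j , u (suc j)) ∈ es
      inForest  : ∀ j → j ≤ d → vsOf es (u j) ≡ true
      avoids    : ∀ j → 1 ≤ j → j ≤ d → B (u j) ≡ false
      injective : ∀ j j′ → j ≤ d → j′ ≤ d → u j ≡ u j′ → j ≡ j′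
      endsIn    : Part ip (u d) ≡ true

  open RootedPath public

  trivialPath : ∀ {es B Root ip r} → Root r → vH r ≡ true → Part ip r ≡ true → RootedPath es B Root 0 ip (λ _ → r)
  trivialPath {es} r∈Root r∈H r∈ip = record
    { rooted = r∈Root ; edges = λ _ () ; inForest = λ { zero _ → vH⊆vsOf es r∈H }
    ; avoids = λ { zero () _ ; (suc _) _ () } ; injective = λ { zero zero _ _ _ → refl } ; endsIn = r∈ip }

  RootedPath-++ : ∀ {es B Root d ip u} X → RootedPath es B Root d ip u → RootedPath (X ++ es) B Root d ip u
  RootedPath-++ X P = record
    { rooted = rooted P ; edges = λ j j<d → ∈-++⁺ʳ X (edges P j j<d) ; inForest = λ j j≤d → vsOf-++ X _ (inForest P j j≤d)
    ; avoids = avoids P ; injective = injective P ; endsIn = endsIn P }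

  RootedPath-extend : ∀ {es B Root d ip u y} → RootedPath es B Root d ip u → (∀ {x} → B x ≡ true → vsOf es x ≡ true) →
    adj G (u d) y ≡ true → vsOf es y ≡ false → RootedPath ((u d , y) ∷ es) B Root (suc d) (opposite ip) (extendPath u d y)
  RootedPath-extend {es} {B} {Root} {d} {ip} {u} {y} P B⊆ uy y∉ = record
    { rooted = subst Root (sym (extendPath-old u {d} {y} z≤n)) (rooted P) ; edges = edges′ ; inForest = inForest′
    ; avoids = avoids′ ; injective = injective′ ; endsIn = subst (λ z → Part (opposite ip) z ≡ true) (sym (extendPath-new u {d} {y})) (Part-cross ip (endsIn P) uy) }
    where
    u⁺ : ℕ → V n
    u⁺ = extendPath u d y
    u≢y : ∀ {j} → j ≤ d → u j ≢ y
    u≢y j≤d uj≡y = true≢false (subst (λ z → vsOf es z ≡ true) uj≡y (inForest P _ j≤d)) y∉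
    edges′ : ∀ j → j < suc d → (u⁺ j , u⁺ (suc j)) ∈ ((u d , y) ∷ es)
    edges′ j j<sd with m≤n⇒m<n∨m≡n (s≤s⁻¹ j<sd)
    ... | inj₁ j<d  rewrite extendPath-old u {y = y} (<⇒≤ j<d) | extendPath-old u {y = y} j<d = there (edges P j j<d)
    ... | inj₂ refl rewrite extendPath-old u {y = y} (≤-refl {j}) | extendPath-new u {j} {y} = here refl
    inForest′ : ∀ j → j ≤ suc d → vsOf ((u d , y) ∷ es) (u⁺ j) ≡ true
    inForest′ j j≤sd with m≤n⇒m<n∨m≡n j≤sd
    ... | inj₁ j<sd rewrite extendPath-old u {y = y} (s≤s⁻¹ j<sd) = ∨-introʳ _ (inForest P j (s≤s⁻¹ j<sd))
    ... | inj₂ refl rewrite extendPath-new u {d} {y} = insert-here {U = vsOf es}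
    avoids′ : ∀ j → 1 ≤ j → j ≤ suc d → B (u⁺ j) ≡ false
    avoids′ j 1≤j j≤sd with m≤n⇒m<n∨m≡n j≤sd
    ... | inj₁ j<sd rewrite extendPath-old u {y = y} (s≤s⁻¹ j<sd) = avoids P j 1≤j (s≤s⁻¹ j<sd)
    ... | inj₂ refl rewrite extendPath-new u {d} {y} = ¬true⇒false (λ y∈B → true≢false (B⊆ y∈B) y∉)
    injective′ : ∀ j j′ → j ≤ suc d → j′ ≤ suc d → u⁺ j ≡ u⁺ j′ → j ≡ j′
    injective′ j j′ j≤ j′≤ eq with m≤n⇒m<n∨m≡n j≤ | m≤n⇒m<n∨m≡n j′≤
    ... | inj₁ j<  | inj₁ j′< rewrite extendPath-old u {y = y} (s≤s⁻¹ j<) | extendPath-old u {y = y} (s≤s⁻¹ j′<) =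
          injective P j j′ (s≤s⁻¹ j<) (s≤s⁻¹ j′<) eq
    ... | inj₂ refl | inj₂ refl = refl
    ... | inj₁ j<  | inj₂ refl rewrite extendPath-old u {y = y} (s≤s⁻¹ j<) | extendPath-new u {d} {y} = ⊥-elim (u≢y (s≤s⁻¹ j<) eq)
    ... | inj₂ refl | inj₁ j′< rewrite extendPath-old u {y = y} (s≤s⁻¹ j′<) | extendPath-new u {d} {y} = ⊥-elim (u≢y (s≤s⁻¹ j′<) (sym eq))

  -- One round gives every bud c children. Reserved vertices (the roots of the other side)
  -- are never touched, so their degrees are preserved.
  module Round (c d : ℕ) (ip : Fin 2) (B : VSet n) (Root Reserved : V n → Set) (es₀ : List Edge)
               (B⊆ : ∀ {x} → B x ≡ true → vsOf es₀ x ≡ true)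
               (Reserved⊆ : ∀ {z} → Reserved z → vsOf es₀ z ≡ true) where

    tip tip′ : (ℕ → V n) → V n
    tip  u = u d
    tip′ u = u (suc d)

    Bud : List Edge → (ℕ → V n) → Set
    Bud es u = RootedPath es B Root d ip u × (deg (adjOf es) (u d) + c ≤ D) × (vsOf es₀ (u d) ≡ true) ×
               (∀ {z} → Reserved z → u d ≢ z)

    Shoot : List Edge → (ℕ → V n) → Set
    Shoot es u = RootedPath es B Root (suc d) (opposite ip) u × (deg (adjOf es) (u (suc d)) ≤ 1) ×
                 (vsOf es₀ (u (suc d)) ≡ false)

    Preserved : List Edge → Set
    Preserved es = (∀ {x} → vsOf es₀ x ≡ true → vsOf es x ≡ true) ×
                   (∀ {z} → Reserved z → deg (adjOf es) z ≡ deg (adjOf es₀) z)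

    record Outcome (es : List Edge) (R L : ℕ) : Set where
      field
        added     : List Edge
        shoots    : List (ℕ → V n)
        viable    : Viable (added ++ es) R
        #shoots   : length shoots ≡ L
        areShoots : All (Shoot (added ++ es)) shoots
        uniqueTips : Unique (map tip′ shoots)
        preserved : Preserved (added ++ es)

    Outcome-cast : ∀ {es R L L′} → L ≡ L′ → Outcome es R L → Outcome es R L′
    Outcome-cast refl out = out

    Outcome-unshift : ∀ {es R L} p y → Outcome ((p , y) ∷ es) R L → Outcome es R L
    Outcome-unshift {es} {R} p y out = record
      { added = added ++ [ (p , y) ] ; shoots = shoots ; viable = subst (λ z → Viable z R) shift viable
      ; #shoots = #shoots ; areShoots = subst (λ z → All (Shoot z) shoots) shift areShoots
      ; uniqueTips = uniqueTips ; preserved = subst Preserved shift preserved }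
      where
      open Outcome out
      shift : added ++ (p , y) ∷ es ≡ (added ++ [ (p , y) ]) ++ es
      shift = sym (++-assoc added [ (p , y) ] es)

    Bud-after : ∀ {es p y} → vsOf es y ≡ false → ∀ P → All (Bud es) P → All (λ u → u d ≢ p) P →
      All (Bud ((p , y) ∷ es)) P
    Bud-after y∉ []      []                                 []            = []
    Bud-after {es} {p} {y} y∉ (u ∷ P) ((Pu , du , u∈₀ , u∉Res) ∷ buds) (u≢p ∷ others) =
      (RootedPath-++ [ (p , y) ] Pu , subst (λ k → k + c ≤ D) (sym (deg-addEdge-other (adjOf es) u≢p u≢y)) du , u∈₀ , u∉Res)
      ∷ Bud-after y∉ P buds others
      where
      u≢y : u d ≢ y
      u≢y u≡y = true≢false (subst (λ z → vsOf es z ≡ true) u≡y (inForest Pu d ≤-refl)) y∉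

    Shoot-after : ∀ {es p y} → vsOf es y ≡ false → vsOf es₀ p ≡ true → ∀ Q → All (Shoot es) Q →
      All (Shoot ((p , y) ∷ es)) Q
    Shoot-after y∉ p∈₀ []      []                          = []
    Shoot-after {es} {p} {y} y∉ p∈₀ (q ∷ Q) ((Pq , dq , q∉₀) ∷ shoots) =
      (RootedPath-++ [ (p , y) ] Pq , subst (_≤ 1) (sym (deg-addEdge-other (adjOf es) q≢p q≢y)) dq , q∉₀)
      ∷ Shoot-after y∉ p∈₀ Q shoots
      where
      q≢p : q (suc d) ≢ p
      q≢p q≡p = true≢false (subst (λ z → vsOf es₀ z ≡ true) (sym q≡p) p∈₀) q∉₀
      q≢y : q (suc d) ≢ y
      q≢y q≡y = true≢false (subst (λ z → vsOf es z ≡ true) q≡y (inForest Pq (suc d) ≤-refl)) y∉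

    mutual
      sprout : ∀ j u rest es Q R → Viable es (j + c * length rest + R) →
        RootedPath es B Root d ip u → deg (adjOf es) (u d) + j ≤ D → vsOf es₀ (u d) ≡ true →
        (∀ {z} → Reserved z → u d ≢ z) →
        All (Bud es) rest → All (λ u′ → u′ d ≢ u d) rest → Unique (map tip rest) →
        All (Shoot es) Q → Unique (map tip′ Q) → Preserved es →
        Outcome es R (j + c * length rest + length Q)
      sprout zero    u rest es Q R viable _ _ _ _ buds _ uniqueBuds shoots uniqueShoots preserved =
        round rest es Q R viable buds uniqueBuds shoots uniqueShoots preserved
      sprout (suc j) u rest es Q R viable Pu du u∈₀ u∉Res buds others uniqueBuds shoots uniqueShoots preserved =
        Outcome-cast (+-suc (j + c * length rest) (length Q))
          (Outcome-unshift (u d) y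
            (sprout j u rest ((u d , y) ∷ es) (extendPath u d y ∷ Q) R (NewLeaf.viable new)
               (RootedPath-++ [ (u d , y) ] Pu) du′ u∈₀ u∉Res
               (Bud-after y∉ rest buds others) others uniqueBuds
               (shoot ∷ Shoot-after y∉ u∈₀ Q shoots) (y-new ∷ uniqueShoots) preserved′))
        where
        dp<D : deg (adjOf es) (u d) < D
        dp<D = ≤-trans (≤-reflexive (+-comm 1 _)) (≤-trans (+-monoʳ-≤ (deg (adjOf es) (u d)) (s≤s z≤n)) du)
        new : NewLeaf es (j + c * length rest + R) (u d)
        new = addLeaf viable (endsIn Pu) (inForest Pu d ≤-refl) dp<D
        y : V n
        y = NewLeaf.leaf new
        y∉ : vsOf es y ≡ false
        y∉ = NewLeaf.fresh new
        du′ : deg (adjOf ((u d , y) ∷ es)) (u d) + j ≤ D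
        du′ = subst (λ k → k + j ≤ D) (sym (NewLeaf.deg-p new)) (subst (_≤ D) (+-suc _ j) du)
        y∉₀ : vsOf es₀ y ≡ false
        y∉₀ = ¬true⇒false λ y∈₀ → true≢false (proj₁ preserved y∈₀) y∉
        shoot : Shoot ((u d , y) ∷ es) (extendPath u d y)
        shoot = RootedPath-extend Pu (λ x∈B → proj₁ preserved (B⊆ x∈B)) (NewLeaf.edge new) y∉ ,
                subst (λ z → deg (adjOf ((u d , y) ∷ es)) z ≤ 1) (sym (extendPath-new u {d} {y}))
                      (≤-reflexive (NewLeaf.deg-leaf new)) ,
                subst (λ z → vsOf es₀ z ≡ false) (sym (extendPath-new u {d} {y})) y∉₀
        y-new : All (extendPath u d y (suc d) ≢_) (map tip′ Q)
        y-new = All.map⁺ (All.map (λ (Pq , _ , _) y≡q → true≢false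
                  (subst (λ z → vsOf es z ≡ true) (trans (sym y≡q) (extendPath-new u {d} {y})) (inForest Pq (suc d) ≤-refl)) y∉) shoots)
        z≢y : ∀ {z} → Reserved z → z ≢ y
        z≢y z∈Res z≡y = true≢false (subst (λ w → vsOf es w ≡ true) z≡y (proj₁ preserved (Reserved⊆ z∈Res))) y∉
        preserved′ : Preserved ((u d , y) ∷ es)
        preserved′ = (λ x∈₀ → ∨-introʳ _ (proj₁ preserved x∈₀)) ,
                     (λ z∈Res → trans (deg-addEdge-other (adjOf es) (λ z≡ → u∉Res z∈Res (sym z≡)) (z≢y z∈Res))
                                      (proj₂ preserved z∈Res))

      round : ∀ P es Q R → Viable es (c * length P + R) → All (Bud es) P → Unique (map tip P) →
        All (Shoot es) Q → Unique (map tip′ Q) → Preserved es → Outcome es R (c * length P + length Q)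
      round [] es Q R viable [] [] shoots uniqueShoots preserved =
        Outcome-cast (cong (_+ length Q) (sym (*-zeroʳ c))) (record
          { added = [] ; shoots = Q ; viable = subst (λ k → Viable es (k + R)) (*-zeroʳ c) viable ; #shoots = refl
          ; areShoots = shoots ; uniqueTips = uniqueShoots ; preserved = preserved })
      round (u ∷ P) es Q R viable ((Pu , du , u∈₀ , u∉Res) ∷ buds) (u-distinct ∷ uniqueBuds) shoots uniqueShoots preserved =
        Outcome-cast (cong (_+ length Q) (sym (*-suc c (length P))))
          (sprout c u P es Q R (subst (λ k → Viable es (k + R)) (*-suc c (length P)) viable)
                  Pu du u∈₀ u∉Res buds others uniqueBuds shoots uniqueShoots preserved)
        where
        others : All (λ u′ → u′ d ≢ u d) P
        others = All.map (λ u≢u′ u′≡u → u≢u′ (sym u′≡u)) (All.map⁻ u-distinct)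

  module _ (B : VSet n) (Root Reserved : V n → Set) where

    Start : ℕ → List Edge → ℕ → Fin 2 → (ℕ → V n) → Set
    Start c es d ip u = RootedPath es B Root d ip u × (deg (adjOf es) (u d) + c ≤ D) × (∀ {z} → Reserved z → u d ≢ z)

    Tip : List Edge → ℕ → Fin 2 → (ℕ → V n) → Set
    Tip es d ip u = RootedPath es B Root d ip u × (deg (adjOf es) (u d) ≤ 1) × (∀ {z} → Reserved z → u d ≢ z)

    record Grown (es : List Edge) (R d : ℕ) (ip : Fin 2) (L : ℕ) : Set where
      field
        added       : List Edge
        tips        : List (ℕ → V n)
        viable      : Viable (added ++ es) R
        #tips       : length tips ≡ L
        areTips     : All (Tip (added ++ es) d ip) tips
        uniqueTips  : Unique (map (λ u → u d) tips)
        reservedDeg : ∀ {z} → Reserved z → deg (adjOf (added ++ es)) z ≡ deg (adjOf es) z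
        grows       : ∀ {x} → vsOf es x ≡ true → vsOf (added ++ es) x ≡ true

    module OneRound (c d : ℕ) (ip : Fin 2) (es : List Edge)
                    (B⊆ : ∀ {x} → B x ≡ true → vsOf es x ≡ true) (Reserved⊆ : ∀ {z} → Reserved z → vsOf es z ≡ true) where

      open Round c d ip B Root Reserved es B⊆ Reserved⊆ public

      oneRound : ∀ P R → Viable es (c * length P + R) → All (Start c es d ip) P → Unique (map (λ u → u d) P) →
        Outcome es R (c * length P + 0)
      oneRound P R viable starts uniqueStarts =
        round P es [] R viable (All.map (λ (Pu , du , u∉Res) → Pu , du , inForest Pu d ≤-refl , λ {z} → u∉Res {z}) starts)
              uniqueStarts [] [] ((λ x∈ → x∈) , (λ _ → refl))

      shoot⇒tip : ∀ {es′ u} → Shoot es′ u → Tip es′ (suc d) (opposite ip) u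
      shoot⇒tip (Pu , du , u∉₀) = Pu , du , λ z∈Res u≡z → true≢false (subst (λ w → vsOf es w ≡ true) (sym u≡z) (Reserved⊆ z∈Res)) u∉₀

    Grown-++ : ∀ {es R R′ d d′ ip ip′ L L′} (g : Grown es R′ d ip L) → Grown (Grown.added g ++ es) R d′ ip′ L′ →
      Grown es R d′ ip′ L′
    Grown-++ {es} {R} {d′ = d′} {ip′ = ip′} g g′ = record
      { added = Grown.added g′ ++ Grown.added g
      ; tips = Grown.tips g′
      ; viable = subst (λ z → Viable z R) reassoc (Grown.viable g′)
      ; #tips = Grown.#tips g′
      ; areTips = subst (λ z → All (Tip z d′ ip′) (Grown.tips g′)) reassoc (Grown.areTips g′)
      ; uniqueTips = Grown.uniqueTips g′
      ; reservedDeg = λ z∈Res → trans (subst (λ z → deg (adjOf z) _ ≡ deg (adjOf (Grown.added g ++ es)) _) reassoc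
                                              (Grown.reservedDeg g′ z∈Res))
                                       (Grown.reservedDeg g z∈Res)
      ; grows = λ x∈ → subst (λ z → vsOf z _ ≡ true) reassoc (Grown.grows g′ (Grown.grows g x∈)) }
      where
      reassoc : Grown.added g′ ++ (Grown.added g ++ es) ≡ (Grown.added g′ ++ Grown.added g) ++ es
      reassoc = sym (++-assoc (Grown.added g′) (Grown.added g) es)

    Tip⇒Start : ∀ {c es d ip u} → suc c ≤ D → Tip es d ip u → Start c es d ip u
    Tip⇒Start {c} c<D (Pu , du , u∉Res) = Pu , ≤-trans (+-monoˡ-≤ c du) c<D , λ {z} → u∉Res {z}

    rounds : ∀ t c → suc c ≤ D → ∀ d ip es P R →
      (∀ {x} → B x ≡ true → vsOf es x ≡ true) → (∀ {z} → Reserved z → vsOf es z ≡ true) →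
      Viable es (cost (suc t) c (length P) + R) → All (Start c es d ip) P → Unique (map (λ u → u d) P) →
      Grown es R (depthAfter (suc t) d) (flips (suc t) ip) (tipsAfter (suc t) c (length P))
    rounds zero c c<D d ip es P R B⊆ Reserved⊆ viable₀ starts uniqueStarts = record
      { added = added ; tips = shoots ; viable = viable ; #tips = trans #shoots (+-identityʳ _)
      ; areTips = All.map shoot⇒tip areShoots ; uniqueTips = uniqueTips
      ; reservedDeg = proj₂ preserved ; grows = proj₁ preserved }
      where
      open OneRound c d ip es B⊆ Reserved⊆
      open Outcome (oneRound P R (subst (λ k → Viable es (k + R)) (+-identityʳ (c * length P)) viable₀) starts uniqueStarts)
    rounds (suc t) c c<D d ip es P R B⊆ Reserved⊆ viable₀ starts uniqueStarts =
      Grown-++ first (subst (Grown _ R _ _) (cong (tipsAfter (suc t) c) (Grown.#tips first))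
        (rounds t c c<D (suc d) (opposite ip) (Grown.added first ++ es) (Grown.tips first) R
          (λ x∈B → Grown.grows first (B⊆ x∈B)) (λ z∈Res → Grown.grows first (Reserved⊆ z∈Res))
          (subst (λ k → Viable (Grown.added first ++ es) (cost (suc t) c k + R)) (sym (Grown.#tips first)) (Grown.viable first))
          (All.map (Tip⇒Start c<D) (Grown.areTips first)) (Grown.uniqueTips first)))
      where
      split : c * length P + cost (suc t) c (c * length P) + R ≡ c * length P + 0 + (cost (suc t) c (c * length P) + R)
      split = trans (+-assoc (c * length P) _ R) (cong (_+ (cost (suc t) c (c * length P) + R)) (sym (+-identityʳ (c * length P))))
      first : Grown es (cost (suc t) c (c * length P) + R) (suc d) (opposite ip) (c * length P)
      first = rounds zero c c<D d ip es P (cost (suc t) c (c * length P) + R) B⊆ Reserved⊆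
                     (subst (Viable es) split viable₀) starts uniqueStarts

≡ᵇ-true : ∀ {a b} → a ≡ b → (a ≡ᵇ b) ≡ true
≡ᵇ-true {a} refl = Equivalence.to T-≡ (≡⇒≡ᵇ a a refl)

≡ᵇ-sound : ∀ {a b} → (a ≡ᵇ b) ≡ true → a ≡ b
≡ᵇ-sound {a} {b} h = ≡ᵇ⇒≡ a b (Equivalence.from T-≡ h)

module _ {n : ℕ} where

  deg≤maxDeg : (a : Adj n) (x : V n) → deg a x ≤ maxDeg a
  deg≤maxDeg a x = go (allV n) (allV-complete x)
    where
    go : ∀ xs → x ∈ xs → deg a x ≤ foldr (λ y r → deg a y ⊔ r) 0 xs
    go (y ∷ xs) (here refl) = m≤m⊔n (deg a x) _
    go (y ∷ xs) (there x∈)  = ≤-trans (go xs x∈) (m≤n⊔m (deg a y) _)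

  maxDeg-lub : (a : Adj n) {k : ℕ} → (∀ x → deg a x ≤ k) → maxDeg a ≤ k
  maxDeg-lub a {k} bound = go (allV n)
    where
    go : ∀ xs → foldr (λ y r → deg a y ⊔ r) 0 xs ≤ k
    go []       = z≤n
    go (y ∷ xs) = ⊔-lub (bound y) (go xs)

  Δ[]-cong : ∀ m {a b : Adj n} → (∀ x → deg a x ≡ deg b x) → Δ[ m ] a ≡ Δ[ m ] b
  Δ[]-cong m {a} {b} deg≡ = cong₂ (λ M t → m * M + t) maxDeg≡ (count-cong (allV n) (λ x → cong₂ _≡ᵇ_ (deg≡ x) maxDeg≡))
    where
    maxDeg≡ : maxDeg a ≡ maxDeg b
    maxDeg≡ = ≤-antisym (maxDeg-lub a (λ x → subst (_≤ maxDeg b) (sym (deg≡ x)) (deg≤maxDeg b x)))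
                        (maxDeg-lub b (λ x → subst (_≤ maxDeg a) (deg≡ x) (deg≤maxDeg a x)))

  addEdge-present : (a : Adj n) {u v : V n} → a u v ≡ true → a v u ≡ true → ∀ x y → addEdge a u v x y ≡ a x y
  addEdge-present a {u} {v} uv vu x y = Bool-ext to (addEdge-old a u v)
    where
    to : addEdge a u v x y ≡ true → a x y ≡ true
    to h with addEdge-elim a u v h
    ... | inj₁ xy                    = xy
    ... | inj₂ (inj₁ (refl , refl)) = uv
    ... | inj₂ (inj₂ (refl , refl)) = vu

module _ {n : ℕ} where

  _∈ᵇ_ : V n → List (V n) → Bool
  x ∈ᵇ L = any (_== x) L

  ∈ᵇ-sound : ∀ {x} L → (x ∈ᵇ L) ≡ true → x ∈ L
  ∈ᵇ-sound {x} L h with any-elim (_== x) L h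
  ... | y , y∈L , y==x rewrite ==-sound y x y==x = y∈L

  count-unique : (P : V n → Bool) {L : List (V n)} → Unique L → count P L ≡ count (λ x → P x ∧ (x ∈ᵇ L)) (allV n)
  count-unique P {[]}    []            = sym (count-zero _ (allV n) (λ x → ∧-zeroʳ (P x)))
  count-unique P {y ∷ L} (y∉L ∷ uniq) = begin
    ⟦ P y ⟧ + count P L                                             ≡⟨ +-comm ⟦ P y ⟧ _ ⟩
    count P L + ⟦ P y ⟧                                             ≡⟨ cong₂ _+_ (count-unique P uniq) (cong ⟦_⟧ (sym P-at-y)) ⟩
    count (λ x → P x ∧ (x ∈ᵇ L)) (allV n) + ⟦ P y ∧ (y ∈ᵇ (y ∷ L)) ⟧ ≡⟨ count-extend y off-y (¬true⇒false y∉) ⟨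
    count (λ x → P x ∧ (x ∈ᵇ (y ∷ L))) (allV n)                      ∎
    where
    open ≡-Reasoning
    P-at-y : (P y ∧ (y ∈ᵇ (y ∷ L))) ≡ P y
    P-at-y = trans (cong (λ b → P y ∧ (b ∨ (y ∈ᵇ L))) (==-refl y)) (∧-identityʳ (P y))
    off-y : ∀ x → x ≢ y → (P x ∧ (x ∈ᵇ L)) ≡ (P x ∧ (x ∈ᵇ (y ∷ L)))
    off-y x x≢y = cong (λ b → P x ∧ (b ∨ (x ∈ᵇ L))) (sym (==-≢ (λ y≡x → x≢y (sym y≡x))))
    y∉ : (P y ∧ (y ∈ᵇ L)) ≡ true → ⊥
    y∉ h = All.lookup y∉L (∈ᵇ-sound L (proj₂ (∧-elim {P y} h))) refl

  ∣∈ᵇ∣ : {L : List (V n)} → Unique L → ∣ (_∈ᵇ L) ∣ ≡ length L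
  ∣∈ᵇ∣ {L} uniq = sym (trans (count-true L) (count-unique (λ _ → true) uniq))
    where
    count-true : ∀ L → length L ≡ count (λ _ → true) L
    count-true []      = refl
    count-true (_ ∷ L) = cong suc (count-true L)

  length-filterᵇ : (P : V n → Bool) (L : List (V n)) → length (filterᵇ P L) + count (λ x → not (P x)) L ≡ length L
  length-filterᵇ P []      = refl
  length-filterᵇ P (x ∷ L) with P x
  ... | true  = cong suc (length-filterᵇ P L)
  ... | false = trans (+-suc _ _) (cong suc (length-filterᵇ P L))

  ∈-take⁻ : ∀ {x} k (L : List (V n)) → x ∈ take k L → x ∈ L
  ∈-take⁻ (suc k) (y ∷ L) (here x≡y)  = here x≡y
  ∈-take⁻ (suc k) (y ∷ L) (there x∈) = there (∈-take⁻ k L x∈)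

  choose : (P : V n → Bool) {L : List (V n)} → Unique L → (k : ℕ) → k + count (λ x → not (P x)) (allV n) ≤ length L →
    Σ (List (V n)) λ L′ → Unique L′ × (length L′ ≡ k) × (∀ {x} → x ∈ L′ → x ∈ L) × (∀ {x} → x ∈ L′ → P x ≡ true)
  choose P {L} uniq k room =
    take k good , Unique.take⁺ k (Unique.filter⁺ (T? ∘ P) uniq) ,
    trans (length-take k good) (m≤n⇒m⊓n≡m k≤#good) ,
    (λ x∈ → proj₁ (∈-filter⁻ (T? ∘ P) {xs = L} (∈-take⁻ k good x∈))) ,
    (λ x∈ → Equivalence.to T-≡ (proj₂ (∈-filter⁻ (T? ∘ P) {xs = L} (∈-take⁻ k good x∈))))
    where
    good : List (V n)
    good = filterᵇ P L
    bad≤ : count (λ x → not (P x)) L ≤ count (λ x → not (P x)) (allV n)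
    bad≤ = subst (_≤ _) (sym (count-unique _ uniq)) (count-mono (allV n) (λ x → proj₁ ∘ ∧-elim))
    k≤#good : k ≤ length good
    k≤#good = +-cancelʳ-≤ _ k (length good) (begin
      k + count (λ x → not (P x)) L           ≤⟨ +-monoʳ-≤ k bad≤ ⟩
      k + count (λ x → not (P x)) (allV n)    ≤⟨ room ⟩
      length L                                ≡⟨ length-filterᵇ P L ⟨
      length good + count (λ x → not (P x)) L ∎)
      where open ≤-Reasoning

module BoundedEdges {n : ℕ} (F : Graph n) (m : ℕ) where

  -- Raising the degree of a safe vertex cannot create a new vertex of degree Δ(F) + 1
  -- unless F already has at least m vertices of degree Δ(F).
  Safe : V n → Set
  Safe x = (m ≤ tMax (adj F)) ⊎ (deg (adj F) x ≢ maxDeg (adj F))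

  module NewEdge {u v : V n} (u≢v : u ≢ v) (uv : adj F u v ≡ false) where

    F⁺ : Adj n
    F⁺ = addEdge (adj F) u v

    M M⁺ : ℕ
    M  = maxDeg (adj F)
    M⁺ = maxDeg F⁺

    deg⁺ : ∀ x → deg F⁺ x ≡ deg (adj F) x + ⟦ x == u ⟧ + ⟦ x == v ⟧
    deg⁺ = deg-addEdge (adj F) u≢v uv (trans (adj-sym F v u) uv)

    deg⁺-u : deg F⁺ u ≡ suc (deg (adj F) u)
    deg⁺-u rewrite deg⁺ u | ==-refl u | ==-≢ u≢v = trans (+-identityʳ _) (+-comm _ 1)

    deg⁺-v : deg F⁺ v ≡ suc (deg (adj F) v)
    deg⁺-v rewrite deg⁺ v | ==-refl v | ==-≢ (λ v≡u → u≢v (sym v≡u)) = trans (cong (_+ 1) (+-identityʳ _)) (+-comm _ 1)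

    deg⁺-other : ∀ {x} → x ≢ u → x ≢ v → deg F⁺ x ≡ deg (adj F) x
    deg⁺-other = deg-addEdge-other (adj F)

    deg≤deg⁺ : ∀ x → deg (adj F) x ≤ deg F⁺ x
    deg≤deg⁺ x = subst (deg (adj F) x ≤_) (sym (deg⁺ x)) (≤-trans (m≤m+n _ _) (m≤m+n _ _))

    deg⁺≤suc : ∀ x → deg F⁺ x ≤ suc (deg (adj F) x)
    deg⁺≤suc x with eqView x u | eqView x v
    ... | equal refl _   | _              = ≤-reflexive deg⁺-u
    ... | distinct _ _   | equal refl _   = ≤-reflexive deg⁺-v
    ... | distinct x≢u _ | distinct x≢v _ = ≤-trans (≤-reflexive (deg⁺-other x≢u x≢v)) (n≤1+n _)

    M≤M⁺ : M ≤ M⁺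
    M≤M⁺ = maxDeg-lub (adj F) λ x → ≤-trans (deg≤deg⁺ x) (deg≤maxDeg F⁺ x)

    M⁺≤1+M : M⁺ ≤ suc M
    M⁺≤1+M = maxDeg-lub F⁺ λ x → ≤-trans (deg⁺≤suc x) (s≤s (deg≤maxDeg (adj F) x))

    same-max : M⁺ ≡ M → tMax F⁺ ≤ tMax (adj F) + 2
    same-max M⁺≡M = begin
      tMax F⁺                                                        ≤⟨ count-mono (allV n) was-max-or-end ⟩
      count (λ x → (deg (adj F) x ≡ᵇ M) ∨ ((x == u) ∨ (x == v))) (allV n) ≤⟨ count-∨≤ _ _ (allV n) ⟩
      tMax (adj F) + count (λ x → (x == u) ∨ (x == v)) (allV n)        ≤⟨ +-monoʳ-≤ (tMax (adj F)) (count≤2 _ end) ⟩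
      tMax (adj F) + 2                                               ∎
      where
      open ≤-Reasoning
      was-max-or-end : ∀ x → (deg F⁺ x ≡ᵇ M⁺) ≡ true → ((deg (adj F) x ≡ᵇ M) ∨ ((x == u) ∨ (x == v))) ≡ true
      was-max-or-end x h with eqView x u | eqView x v
      ... | equal _ x==u   | _              = ∨-introʳ (deg (adj F) x ≡ᵇ M) (∨-introˡ (x == v) x==u)
      ... | distinct _ _   | equal _ x==v   = ∨-introʳ (deg (adj F) x ≡ᵇ M) (∨-introʳ (x == u) x==v)
      ... | distinct x≢u _ | distinct x≢v _ =
        ∨-introˡ ((x == u) ∨ (x == v)) (≡ᵇ-true (trans (sym (deg⁺-other x≢u x≢v)) (trans (≡ᵇ-sound h) M⁺≡M)))
      end : ∀ x → ((x == u) ∨ (x == v)) ≡ true → (x ≡ u) ⊎ (x ≡ v)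
      end x h with ∨-elim {x == u} h
      ... | inj₁ x==u = inj₁ (==-sound x u x==u)
      ... | inj₂ x==v = inj₂ (==-sound x v x==v)

    new-max-ends : M⁺ ≡ suc M → tMax F⁺ ≤ 2
    new-max-ends M⁺≡1+M = count≤2 _ λ x h → case-end x (≡ᵇ-sound h)
      where
      case-end : ∀ x → deg F⁺ x ≡ M⁺ → (x ≡ u) ⊎ (x ≡ v)
      case-end x d≡ with eqView x u | eqView x v
      ... | equal x≡u _    | _              = inj₁ x≡u
      ... | distinct _ _   | equal x≡v _    = inj₂ x≡v
      ... | distinct x≢u _ | distinct x≢v _ = ⊥-elim (1+n≰n (subst (_≤ M) (trans (sym (deg⁺-other x≢u x≢v)) (trans d≡ M⁺≡1+M))
                                                                   (deg≤maxDeg (adj F) x)))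

    new-max-needs-max : M⁺ ≢ M → deg (adj F) u ≢ M → deg (adj F) v ≢ M → ⊥
    new-max-needs-max M⁺≢M du dv = M⁺≢M (≤-antisym (maxDeg-lub F⁺ bound) M≤M⁺)
      where
      bound : ∀ x → deg F⁺ x ≤ M
      bound x with eqView x u | eqView x v
      ... | equal refl _   | _              = subst (_≤ M) (sym deg⁺-u) (≤∧≢⇒< (deg≤maxDeg (adj F) u) du)
      ... | distinct _ _   | equal refl _   = subst (_≤ M) (sym deg⁺-v) (≤∧≢⇒< (deg≤maxDeg (adj F) v) dv)
      ... | distinct x≢u _ | distinct x≢v _ = subst (_≤ M) (sym (deg⁺-other x≢u x≢v)) (deg≤maxDeg (adj F) x)

    bounded⁺ : Safe u → Safe v → Δ[ m ] F⁺ ≤ Δ[ m ] (adj F) + 2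
    bounded⁺ safe-u safe-v with M⁺ ≟ M
    ... | yes M⁺≡M = begin
      m * M⁺ + tMax F⁺           ≡⟨ cong (λ k → m * k + tMax F⁺) M⁺≡M ⟩
      m * M + tMax F⁺            ≤⟨ +-monoʳ-≤ (m * M) (same-max M⁺≡M) ⟩
      m * M + (tMax (adj F) + 2) ≡⟨ +-assoc (m * M) _ 2 ⟨
      m * M + tMax (adj F) + 2   ∎
      where open ≤-Reasoning
    ... | no  M⁺≢M = begin
      m * M⁺ + tMax F⁺             ≡⟨ cong (λ k → m * k + tMax F⁺) M⁺≡1+M ⟩
      m * suc M + tMax F⁺          ≡⟨ cong (_+ tMax F⁺) (*-suc m M) ⟩
      m + m * M + tMax F⁺          ≡⟨ cong (_+ tMax F⁺) (+-comm m (m * M)) ⟩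
      m * M + m + tMax F⁺          ≡⟨ +-assoc (m * M) m _ ⟩
      m * M + (m + tMax F⁺)        ≤⟨ +-monoʳ-≤ (m * M) (+-mono-≤ many-max (new-max-ends M⁺≡1+M)) ⟩
      m * M + (tMax (adj F) + 2)   ≡⟨ +-assoc (m * M) _ 2 ⟨
      m * M + tMax (adj F) + 2     ∎
      where
      open ≤-Reasoning
      M⁺≡1+M : M⁺ ≡ suc M
      M⁺≡1+M = ≤-antisym M⁺≤1+M (≤∧≢⇒< M≤M⁺ (λ M≡M⁺ → M⁺≢M (sym M≡M⁺)))
      many-max : m ≤ tMax (adj F)
      many-max = pick safe-u safe-v
        where
        pick : Safe u → Safe v → m ≤ tMax (adj F)
        pick (inj₁ enough) _             = enough
        pick (inj₂ _)      (inj₁ enough) = enough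
        pick (inj₂ du)     (inj₂ dv)     = ⊥-elim (new-max-needs-max M⁺≢M du dv)

  bounded : ∀ {u v} → u ≢ v → Safe u → Safe v → Bounded1 2 m F u v
  bounded {u} {v} u≢v safe-u safe-v with adj F u v in uv
  ... | true  = ≤-trans (≤-reflexive (Δ[]-cong m λ x → count-cong (allV n) (addEdge-present (adj F) uv vu x)))
                        (m≤m+n _ 2)
    where
    vu : adj F v u ≡ true
    vu = trans (adj-sym F v u) uv
  ... | false = NewEdge.bounded⁺ u≢v uv safe-u safe-v

  safeTest : Σ (V n → Bool) λ P → (∀ {x} → P x ≡ true → Safe x) × (count (λ x → not (P x)) (allV n) ≤ m)
  safeTest with m ≤? tMax (adj F)
  ... | yes enough = (λ _ → true) , (λ _ → inj₁ enough) , subst (_≤ m) (sym (count-zero _ (allV n) (λ _ → refl))) z≤n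
  ... | no  few    = (λ x → not (deg (adj F) x ≡ᵇ maxDeg (adj F))) ,
                     (λ {x} h → inj₂ λ d≡M → true≢false h (cong not (≡ᵇ-true d≡M))) ,
                     subst (_≤ m) (count-cong (allV n) (λ x → sym (not-involutive _))) (<⇒≤ (≰⇒> few))

-- uA read forwards up to dA, followed by uB read backwards from dB.
glue : {A : Set} → (ℕ → A) → ℕ → (ℕ → A) → ℕ → ℕ → A
glue uA dA uB dB j with j ≤? dA
... | yes _ = uA j
... | no  _ = uB (dA + suc dB ∸ j)

module _ {A : Set} (uA : ℕ → A) (dA : ℕ) (uB : ℕ → A) (dB : ℕ) where

  glue-A : ∀ {j} → j ≤ dA → glue uA dA uB dB j ≡ uA j
  glue-A {j} j≤dA with j ≤? dA
  ... | yes _    = refl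
  ... | no  j≰dA = ⊥-elim (j≰dA j≤dA)

  glue-B : ∀ k → glue uA dA uB dB (dA + suc k) ≡ uB (dB ∸ k)
  glue-B k with dA + suc k ≤? dA
  ... | yes le = ⊥-elim (m+1+n≰m dA le)
  ... | no  _  = cong uB ([m+n]∸[m+o]≡n∸o dA (suc dB) (suc k))

data Segment (d j : ℕ) : Set where
  left  : j ≤ d → Segment d j
  right : ∀ k → j ≡ d + suc k → Segment d j

segment : ∀ d j → Segment d j
segment d j with j ≤? d
... | yes j≤d = left j≤d
... | no  j≰d = right (j ∸ suc d) (sym (trans (+-suc d _) (m+[n∸m]≡n (≰⇒> j≰d))))

∸≡suc∸suc : ∀ {d k} → k < d → d ∸ k ≡ suc (d ∸ suc k)
∸≡suc∸suc {suc d} {zero}  _         = refl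
∸≡suc∸suc {suc d} {suc k} (s≤s k<d) = ∸≡suc∸suc k<d

module PathAssembly {n : ℕ} (G₁ G₂ F : Graph n) (bip : Bipartite G₁) (D m s : ℕ) (H : Sub G₁)
                    (a b : Fin s → Fin n) (a∈H : ∀ i → vs H (inj₁ (a i)) ≡ true) (b∈H : ∀ i → vs H (inj₂ (b i)) ≡ true)
                    (1≤m : 1 ≤ m) where

  open Extendability G₁ bip D m
  open Forests G₁ bip D m (vs H) (sadj H)
  open BoundedEdges F m

  H-isSubgraph : IsSubgraph G₁ (vs H) (sadj H)
  H-isSubgraph = record { symmetric = ssym H ; edge∈G = sub H ; endpoint∈ = endpoint H }

  open Growth G₁ bip D m H-isSubgraph 1≤m

  RootA RootB : V n → Set
  RootA x = Σ (Fin s) λ i → x ≡ inj₁ (a i)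
  RootB x = Σ (Fin s) λ j → x ≡ inj₂ (b j)

  Conclusion : ℕ → Set
  Conclusion ℓ = Σ (Fin s) λ i → Σ (Fin s) λ j → Σ (Fin (suc ℓ) → V n) λ v → Σ (Fin ℓ) λ t₀ →
    Injective _≡_ _≡_ v × v zero ≡ inj₁ (a i) × v (fromℕ ℓ) ≡ inj₂ (b j) ×
    (∀ t → (G₁ ∪G G₂) (lo v t) (hi v t) ≡ true) ×
    Bounded1 2 m F (lo v t₀) (hi v t₀) ×
    (∀ t → t ≢ t₀ → adj G₁ (lo v t) (hi v t) ≡ true) ×
    (∀ t → t ≢ zero → t ≢ fromℕ ℓ → vs H (v t) ≡ false) ×
    Extendable D m (adj G₁) (λ x → vs H x ∨ onPath v x) (λ x y → sadj H x y ∨ pathEdgeExcept v t₀ x y)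

  module Join (esA XB : List Edge) (forest : Forest (XB ++ esA))
              (ext : IsExtendable (vsOf (XB ++ esA)) (adjOf (XB ++ esA)))
              {dA dB : ℕ} {ipA : Fin 2} {uA uB : ℕ → V n}
              (PA : RootedPath esA (vs H) RootA dA ipA uA)
              (PB : RootedPath (XB ++ esA) (vsOf esA) RootB dB (opposite ipA) uB)
              (bridge : adj G₂ (uA dA) (uB dB) ≡ true) (safeA : Safe (uA dA)) (safeB : Safe (uB dB)) where

    esF : List Edge
    esF = XB ++ esA

    ℓ : ℕ
    ℓ = dA + suc dB

    w : ℕ → V n
    w = glue uA dA uB dB

    dA<ℓ : dA < ℓ
    dA<ℓ = m<m+n dA (s≤s z≤n)

    w-A : ∀ {j} → j ≤ dA → w j ≡ uA j
    w-A = glue-A uA dA uB dB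

    w-B : ∀ k → w (dA + suc k) ≡ uB (dB ∸ k)
    w-B = glue-B uA dA uB dB

    w-bridge : w (suc dA) ≡ uB dB
    w-bridge = trans (cong w (trans (cong suc (sym (+-identityʳ dA))) (sym (+-suc dA 0)))) (w-B 0)

    right<ℓ⇒<dB : ∀ {k} → dA + suc k < ℓ → k < dB
    right<ℓ⇒<dB {k} k< = s≤s⁻¹ (+-cancelˡ-≤ dA _ _ (subst (_≤ ℓ) (sym (+-suc dA (suc k))) k<))

    right≤ℓ⇒≤dB : ∀ {k} → dA + suc k ≤ ℓ → k ≤ dB
    right≤ℓ⇒≤dB k≤ = s≤s⁻¹ (+-cancelˡ-≤ dA _ _ k≤)

    A≢B : ∀ {i j} → i ≤ dA → j ≤ dB → uA i ≢ uB j
    A≢B {i} {zero} i≤ _ uAi≡uB0 with rooted PB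
    ... | jb , uB0≡b with i | rooted PA
    ...   | zero  | ia , uA0≡a with trans (sym uA0≡a) (trans uAi≡uB0 uB0≡b)
    ...     | ()
    A≢B {i} {zero} i≤ _ uAi≡uB0 | jb , uB0≡b | suc i′ | _ =
      true≢false (subst (λ z → vs H z ≡ true) (sym (trans uAi≡uB0 uB0≡b)) (b∈H jb)) (avoids PA (suc i′) (s≤s z≤n) i≤)
    A≢B {i} {suc j} i≤ j≤ uAi≡uBj =
      true≢false (subst (λ z → vsOf esA z ≡ true) uAi≡uBj (inForest PA i i≤)) (avoids PB (suc j) (s≤s z≤n) j≤)

    w-injective : ∀ {j j′} → j ≤ ℓ → j′ ≤ ℓ → w j ≡ w j′ → j ≡ j′
    w-injective {j} {j′} j≤ j′≤ eq with segment dA j | segment dA j′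
    ... | left j≤dA | left j′≤dA = injective PA j j′ j≤dA j′≤dA (trans (sym (w-A j≤dA)) (trans eq (w-A j′≤dA)))
    ... | left j≤dA | right k′ refl =
      ⊥-elim (A≢B j≤dA (m∸n≤m dB k′) (trans (sym (w-A j≤dA)) (trans eq (w-B k′))))
    ... | right k refl | left j′≤dA =
      ⊥-elim (A≢B j′≤dA (m∸n≤m dB k) (trans (sym (w-A j′≤dA)) (trans (sym eq) (w-B k))))
    ... | right k refl | right k′ refl = cong (λ z → dA + suc z)
      (∸-cancelˡ-≡ (right≤ℓ⇒≤dB j≤) (right≤ℓ⇒≤dB j′≤)
        (injective PB (dB ∸ k) (dB ∸ k′) (m∸n≤m dB k) (m∸n≤m dB k′) (trans (sym (w-B k)) (trans eq (w-B k′)))))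

    edgeA : ∀ i → i < dA → Σ Edge λ e → (e ∈ esF) × (w i ≡ parent e) × (w (suc i) ≡ child e)
    edgeA i i<dA = (uA i , uA (suc i)) , ∈-++⁺ʳ XB (edges PA i i<dA) , w-A (<⇒≤ i<dA) , w-A i<dA

    edgeB : ∀ k → k < dB → Σ Edge λ e → (e ∈ esF) × (w (dA + suc k) ≡ child e) × (w (suc (dA + suc k)) ≡ parent e)
    edgeB k k<dB = (uB i , uB (suc i)) , edges PB i i<dB ,
                   trans (w-B k) (cong uB (∸≡suc∸suc k<dB)) , trans (cong w (sym (+-suc dA (suc k)))) (w-B (suc k))
      where
      i : ℕ
      i = dB ∸ suc k
      i<dB : i < dB
      i<dB = subst (_≤ dB) (∸≡suc∸suc k<dB) (m∸n≤m dB k)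

    edgeAt : ∀ j → j < ℓ → j ≢ dA → Σ Edge λ e → (e ∈ esF) × Joins e (w j) (w (suc j))
    edgeAt j j<ℓ j≢dA with segment dA j
    ... | left j≤dA with edgeA j (≤∧≢⇒< j≤dA j≢dA)
    ...   | e , e∈ , p , c = e , e∈ , inj₁ (p , c)
    edgeAt j j<ℓ j≢dA | right k refl with edgeB k (right<ℓ⇒<dB j<ℓ)
    ...   | e , e∈ , c , p = e , e∈ , inj₂ (c , p)

    edge∈G₁ : ∀ j → j < ℓ → j ≢ dA → adj G₁ (w j) (w (suc j)) ≡ true
    edge∈G₁ j j<ℓ j≢dA with edgeAt j j<ℓ j≢dA
    ... | e , e∈ , inj₁ (wj≡ , wsj≡) = subst₂ (λ x y → adj G₁ x y ≡ true) (sym wj≡) (sym wsj≡) (Forest-edge∈G esF forest e∈)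
    ... | e , e∈ , inj₂ (wj≡ , wsj≡) =
      subst₂ (λ x y → adj G₁ x y ≡ true) (sym wj≡) (sym wsj≡) (trans (adj-sym G₁ (child e) (parent e)) (Forest-edge∈G esF forest e∈))

    internal : ∀ {j} → 1 ≤ j → j < ℓ → vs H (w j) ≡ false
    internal {j} 1≤j j<ℓ with segment dA j
    ... | left j≤dA    = subst (λ z → vs H z ≡ false) (sym (w-A j≤dA)) (avoids PA j 1≤j j≤dA)
    ... | right k refl = subst (λ z → vs H z ≡ false) (sym (w-B k)) (¬true⇒false λ u∈H →
      true≢false (vH⊆vsOf esA u∈H) (avoids PB (dB ∸ k) (subst (1 ≤_) (sym (∸≡suc∸suc (right<ℓ⇒<dB j<ℓ))) (s≤s z≤n)) (m∸n≤m dB k)))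

    start : Σ (Fin s) λ i → w 0 ≡ inj₁ (a i)
    start = proj₁ (rooted PA) , trans (w-A z≤n) (proj₂ (rooted PA))

    end : Σ (Fin s) λ j → w ℓ ≡ inj₂ (b j)
    end = proj₁ (rooted PB) , trans (w-B dB) (trans (cong uB (n∸n≡0 dB)) (proj₂ (rooted PB)))

    v : Fin (suc ℓ) → V n
    v t = w (toℕ t)

    t₀ : Fin ℓ
    t₀ = fromℕ< dA<ℓ

    lo≡ : ∀ t → lo v t ≡ w (toℕ t)
    lo≡ t = cong w (toℕ-inject₁ t)

    toℕ-t₀ : toℕ t₀ ≡ dA
    toℕ-t₀ = toℕ-fromℕ< dA<ℓ

    ≢t₀ : ∀ {t} → t ≢ t₀ → toℕ t ≢ dA
    ≢t₀ t≢t₀ t≡dA = t≢t₀ (toℕ-injective (trans t≡dA (sym toℕ-t₀)))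

    lo-t₀ : lo v t₀ ≡ uA dA
    lo-t₀ = trans (lo≡ t₀) (trans (cong w toℕ-t₀) (w-A ≤-refl))

    hi-t₀ : hi v t₀ ≡ uB dB
    hi-t₀ = trans (cong (λ j → w (suc j)) toℕ-t₀) w-bridge

    v-injective : Injective _≡_ _≡_ v
    v-injective {t} {t′} eq = toℕ-injective (w-injective (s≤s⁻¹ (toℕ<n t)) (s≤s⁻¹ (toℕ<n t′)) eq)

    G₁-edges : ∀ t → t ≢ t₀ → adj G₁ (lo v t) (hi v t) ≡ true
    G₁-edges t t≢t₀ rewrite lo≡ t = edge∈G₁ (toℕ t) (toℕ<n t) (≢t₀ t≢t₀)

    all-edges : ∀ t → (G₁ ∪G G₂) (lo v t) (hi v t) ≡ true
    all-edges t with t ≟F t₀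
    ... | no  t≢t₀ = ∨-introˡ _ (G₁-edges t t≢t₀)
    ... | yes refl rewrite lo-t₀ | hi-t₀ = ∨-introʳ _ bridge

    bounded-t₀ : Bounded1 2 m F (lo v t₀) (hi v t₀)
    bounded-t₀ rewrite lo-t₀ | hi-t₀ = bounded uA≢uB safeA safeB
      where
      uA≢uB : uA dA ≢ uB dB
      uA≢uB eq = true≢false (subst (λ z → Part (opposite ipA) z ≡ true) (sym eq) (endsIn PB)) (Part-exclusive ipA _ (endsIn PA))

    internal-v : ∀ t → t ≢ zero → t ≢ fromℕ ℓ → vs H (v t) ≡ false
    internal-v t t≢0 t≢ℓ = internal 1≤t t<ℓ
      where
      1≤t : 1 ≤ toℕ t
      1≤t with toℕ t in eq
      ... | zero  = ⊥-elim (t≢0 (toℕ-injective eq))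
      ... | suc _ = s≤s z≤n
      t<ℓ : toℕ t < ℓ
      t<ℓ = ≤∧≢⇒< (s≤s⁻¹ (toℕ<n t)) λ t≡ℓ → t≢ℓ (toℕ-injective (trans t≡ℓ (sym (toℕ-fromℕ ℓ))))

    PE : Adj n
    PE = pathEdgeExcept v t₀

    step : Fin ℓ → Edge
    step t = lo v t , hi v t

    PE-intro : ∀ t → t ≢ t₀ → ∀ {x y} → Joins (step t) x y → PE x y ≡ true
    PE-intro t t≢t₀ {x} {y} joins = any-intro _ (∈-allFin t) (cong₂ _∧_ not-t₀ (matches joins))
      where
      not-t₀ : not ⌊ t ≟F t₀ ⌋ ≡ true
      not-t₀ with t ≟F t₀
      ... | yes t≡t₀ = ⊥-elim (t≢t₀ t≡t₀)
      ... | no  _    = refl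
      matches : Joins (step t) x y → ((lo v t == x ∧ hi v t == y) ∨ (lo v t == y ∧ hi v t == x)) ≡ true
      matches (inj₁ (x≡ , y≡)) = ∨-introˡ _ (cong₂ _∧_ (==-complete (sym x≡)) (==-complete (sym y≡)))
      matches (inj₂ (x≡ , y≡)) = ∨-introʳ _ (cong₂ _∧_ (==-complete (sym y≡)) (==-complete (sym x≡)))

    PE-elim : ∀ {x y} → PE x y ≡ true → Σ (Fin ℓ) λ t → (t ≢ t₀) × Joins (step t) x y
    PE-elim {x} {y} h with any-elim _ (allFin ℓ) h
    ... | t , _ , hit with ∧-elim {not ⌊ t ≟F t₀ ⌋} hit
    ...   | not-t₀ , match = t , t≢t₀ , joins (∨-elim match)
      where
      t≢t₀ : t ≢ t₀
      t≢t₀ refl with t ≟F t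
      ... | yes _   = true≢false not-t₀ refl
      ... | no  t≢t = t≢t refl
      joins : ((lo v t == x ∧ hi v t == y) ≡ true) ⊎ ((lo v t == y ∧ hi v t == x) ≡ true) → Joins (step t) x y
      joins (inj₁ h₁) = let (lx , hy) = ∧-elim h₁ in inj₁ (sym (==-sound _ _ lx) , sym (==-sound _ _ hy))
      joins (inj₂ h₂) = let (ly , hx) = ∧-elim h₂ in inj₂ (sym (==-sound _ _ hx) , sym (==-sound _ _ ly))

    PE-sym : ∀ x y → PE x y ≡ PE y x
    PE-sym x y = any-cong (allFin ℓ) λ t → cong (not ⌊ t ≟F t₀ ⌋ ∧_) (∨-comm (lo v t == x ∧ hi v t == y) _)

    onPath-intro : ∀ t → onPath v (v t) ≡ true
    onPath-intro t = any-intro _ (∈-allFin t) (==-refl (v t))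

    onPath-elim : ∀ {x} → onPath v x ≡ true → Σ (Fin (suc ℓ)) λ t → v t ≡ x
    onPath-elim h with any-elim _ (allFin (suc ℓ)) h
    ... | t , _ , vt==x = t , ==-sound _ _ vt==x

    keep : Edge → Bool
    keep e = PE (parent e) (child e)

    kept : List Edge
    kept = filterᵇ keep esF

    keep-step : ∀ t → t ≢ t₀ → ∀ {e} → Joins e (lo v t) (hi v t) → keep e ≡ true
    keep-step t t≢t₀ (inj₁ (lo≡ , hi≡)) = PE-intro t t≢t₀ (inj₁ (sym lo≡ , sym hi≡))
    keep-step t t≢t₀ (inj₂ (lo≡ , hi≡)) = PE-intro t t≢t₀ (inj₂ (sym hi≡ , sym lo≡))

    kept-∈ : ∀ {e} → e ∈ esF → keep e ≡ true → e ∈ kept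
    kept-∈ e∈ ke = ∈-filter⁺ (T? ∘ keep) e∈ (Equivalence.from T-≡ ke)

    kept-keep : ∀ {e} → e ∈ kept → keep e ≡ true
    kept-keep e∈ = Equivalence.to T-≡ (proj₂ (∈-filter⁻ (T? ∘ keep) {xs = esF} e∈))

    position : ∀ {j} → j < ℓ → Σ (Fin ℓ) λ t → toℕ t ≡ j
    position j<ℓ = fromℕ< j<ℓ , toℕ-fromℕ< j<ℓ

    kept-child : ∀ {j x} → j < ℓ → j ≢ dA → ∀ {e} → e ∈ esF → Joins e (w j) (w (suc j)) → x ≡ child e → vsOf kept x ≡ true
    kept-child {j} j<ℓ j≢dA {e} e∈ joins refl with position j<ℓ
    ... | t , refl = child∈vsOf kept (kept-∈ e∈ (keep-step t (λ t≡t₀ → j≢dA (trans (cong toℕ t≡t₀) toℕ-t₀))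
                                                          (subst (λ z → Joins e z (hi v t)) (sym (lo≡ t)) joins)))

    onPath⇒kept : ∀ {x} → onPath v x ≡ true → vsOf kept x ≡ true
    onPath⇒kept h with onPath-elim h
    ... | t , refl with segment dA (toℕ t)
    ...   | left j≤dA with toℕ t
    ...     | zero  = vH⊆vsOf kept (subst (λ z → vs H z ≡ true) (sym (proj₂ start)) (a∈H (proj₁ start)))
    ...     | suc i with edgeA i j≤dA
    ...       | e , e∈ , p , c = kept-child (<-≤-trans j≤dA (<⇒≤ dA<ℓ)) (<⇒≢ j≤dA) e∈ (inj₁ (p , c)) c
    onPath⇒kept h | t , refl | right k eq with m≤n⇒m<n∨m≡n (right≤ℓ⇒≤dB (subst (_≤ ℓ) eq (s≤s⁻¹ (toℕ<n t))))
    ...   | inj₂ refl = vH⊆vsOf kept (subst (λ z → vs H z ≡ true) (sym (trans (cong w eq) (proj₂ end))) (b∈H (proj₁ end)))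
    ...   | inj₁ k<dB with edgeB k k<dB
    ...     | e , e∈ , c , p = kept-child (+-monoʳ-< dA (s≤s k<dB)) (λ j≡dA → m+1+n≰m dA (≤-reflexive j≡dA)) e∈ (inj₂ (c , p))
                                           (trans (cong w eq) c)

    step-onPath : ∀ t {x y} → Joins (step t) x y → (onPath v x ≡ true) × (onPath v y ≡ true)
    step-onPath t (inj₁ (refl , refl)) = onPath-intro (inject₁ t) , onPath-intro (suc t)
    step-onPath t (inj₂ (refl , refl)) = onPath-intro (suc t) , onPath-intro (inject₁ t)

    kept-onPath : ∀ {e} → e ∈ kept → (onPath v (parent e) ≡ true) × (onPath v (child e) ≡ true)
    kept-onPath e∈ with PE-elim (kept-keep e∈)
    ... | t , _ , joins = step-onPath t joins

    vertices≗ : (λ x → vs H x ∨ onPath v x) ≗ vsOf kept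
    vertices≗ x = Bool-ext to from
      where
      to : (vs H x ∨ onPath v x) ≡ true → vsOf kept x ≡ true
      to h with ∨-elim {vs H x} h
      ... | inj₁ x∈H      = vH⊆vsOf kept x∈H
      ... | inj₂ x∈path   = onPath⇒kept x∈path
      from : vsOf kept x ≡ true → (vs H x ∨ onPath v x) ≡ true
      from h with vsOf⁻ kept h
      ... | inj₁ x∈H              = ∨-introˡ _ x∈H
      ... | inj₂ (e , e∈ , refl) = ∨-introʳ (vs H x) (proj₂ (kept-onPath e∈))

    edges≗ : (λ x y → sadj H x y ∨ PE x y) ≗₂ adjOf kept
    edges≗ x y = Bool-ext to from
      where
      to : (sadj H x y ∨ PE x y) ≡ true → adjOf kept x y ≡ true
      to h with ∨-elim {sadj H x y} h
      ... | inj₁ xy∈H = adjOf-H kept xy∈H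
      ... | inj₂ xy∈P with PE-elim xy∈P
      ...   | t , t≢t₀ , joins with edgeAt (toℕ t) (toℕ<n t) (≢t₀ t≢t₀)
      ...     | e , e∈ , e-joins = adjOf⁺ kept (kept-∈ e∈ (keep-step t t≢t₀ e-joins′)) (compose joins e-joins′)
        where
        e-joins′ : Joins e (lo v t) (hi v t)
        e-joins′ = subst (λ z → Joins e z (hi v t)) (sym (lo≡ t)) e-joins
        compose : Joins (step t) x y → Joins e (lo v t) (hi v t) → Joins e x y
        compose (inj₁ (refl , refl)) j = j
        compose (inj₂ (refl , refl)) (inj₁ (p , c)) = inj₂ (c , p)
        compose (inj₂ (refl , refl)) (inj₂ (c , p)) = inj₁ (p , c)
      from : adjOf kept x y ≡ true → (sadj H x y ∨ PE x y) ≡ true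
      from h with adjOf⁻ kept h
      ... | inj₁ xy∈H                          = ∨-introˡ _ xy∈H
      ... | inj₂ (e , e∈ , inj₁ (refl , refl)) = ∨-introʳ (sadj H x y) (kept-keep e∈)
      ... | inj₂ (e , e∈ , inj₂ (refl , refl)) = ∨-introʳ (sadj H x y) (trans (PE-sym (child e) (parent e)) (kept-keep e∈))

    path-extendable : Extendable D m (adj G₁) (λ x → vs H x ∨ onPath v x) (λ x y → sadj H x y ∨ PE x y)
    path-extendable = Equivalence.from (extendable⇔ _ _)
      (IsExtendable-cong (λ x y → sym (edges≗ x y)) (λ x → sym (vertices≗ x))
        (prune H-isSubgraph keep esF [] forest (λ ()) (λ ())
               (λ e∈ → onPath⇒kept (proj₁ (kept-onPath e∈))) ext))

    conclusion : Conclusion ℓ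
    conclusion = proj₁ start , proj₁ end , v , t₀ , v-injective , proj₂ start ,
                 trans (cong w (toℕ-fromℕ ℓ)) (proj₂ end) , all-edges , bounded-t₀ , G₁-edges , internal-v , path-extendable

^-positive : ∀ {c} → 1 ≤ c → ∀ t → 1 ≤ c ^ t
^-positive 1≤c zero    = s≤s z≤n
^-positive 1≤c (suc t) = *-mono-≤ 1≤c (^-positive 1≤c t)

depthAfter≡+ : ∀ t d → depthAfter t d ≡ t + d
depthAfter≡+ zero    d = refl
depthAfter≡+ (suc t) d = trans (depthAfter≡+ t (suc d)) (+-suc t d)

flips-opposite : ∀ t i → flips t (opposite i) ≡ opposite (flips t i)
flips-opposite zero    i = refl
flips-opposite (suc t) i = flips-opposite t (opposite i)

flips-even : ∀ p i → flips (p + p) i ≡ i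
flips-even zero    i = refl
flips-even (suc p) i = begin
  flips (suc p + suc p) i           ≡⟨ cong (λ t → flips (suc t) i) (+-suc p p) ⟩
  flips (p + p) (opposite (opposite i)) ≡⟨ flips-even p _ ⟩
  opposite (opposite i)              ≡⟨ opposite-involutive i ⟩
  i                                  ∎
  where open ≡-Reasoning

tipsAfter-1 : ∀ t L → tipsAfter t 1 L ≡ L
tipsAfter-1 zero    L = refl
tipsAfter-1 (suc t) L = trans (tipsAfter-1 t (1 * L)) (*-identityˡ L)

tipsAfter≡^ : ∀ t c L → tipsAfter t c L ≡ c ^ t * L
tipsAfter≡^ zero    c L = sym (+-identityʳ L)
tipsAfter≡^ (suc t) c L = trans (tipsAfter≡^ t c (c * L)) (regroup (c ^ t) c L)
  where
  regroup : ∀ x c L → x * (c * L) ≡ c * x * L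
  regroup = solve-∀

cost-1 : ∀ t L → cost t 1 L ≡ t * L
cost-1 zero    L = refl
cost-1 (suc t) L = cong₂ _+_ (*-identityˡ L) (trans (cost-1 t (1 * L)) (cong (λ z → t * z) (*-identityˡ L)))

cost-geometric : ∀ t c L → 2 ≤ c → cost t c L + 2 * L ≤ 2 * (c ^ t * L)
cost-geometric zero    c L _   = ≤-reflexive (cong (λ z → 2 * z) (sym (+-identityʳ L)))
cost-geometric (suc t) c L 2≤c = begin
  c * L + cost t c (c * L) + 2 * L        ≡⟨ regroup (c * L) (cost t c (c * L)) L ⟩
  cost t c (c * L) + (c * L + 2 * L)      ≤⟨ +-monoʳ-≤ (cost t c (c * L)) (+-monoʳ-≤ (c * L) (*-monoˡ-≤ L 2≤c)) ⟩
  cost t c (c * L) + (c * L + c * L)      ≡⟨ double (cost t c (c * L)) (c * L) ⟩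
  cost t c (c * L) + 2 * (c * L)          ≤⟨ cost-geometric t c (c * L) 2≤c ⟩
  2 * (c ^ t * (c * L))                   ≡⟨ cong (λ z → 2 * z) (regroup′ (c ^ t) c L) ⟩
  2 * (c ^ suc t * L)                     ∎
  where
  open ≤-Reasoning
  regroup : ∀ a b L → a + b + 2 * L ≡ b + (a + 2 * L)
  regroup = solve-∀
  regroup′ : ∀ x c L → x * (c * L) ≡ c * x * L
  regroup′ = solve-∀
  double : ∀ x y → x + (y + y) ≡ x + 2 * y
  double = solve-∀

module Assembly {n : ℕ} (G₁ G₂ F : Graph n) (bip : Bipartite G₁) (D m s : ℕ) (3≤D : 3 ≤ D) (1≤m : 1 ≤ m)
                (joined : Joined m G₂) (H : Sub G₁) (a b : Fin s → Fin n)
                (a-injective : Injective _≡_ _≡_ a) (b-injective : Injective _≡_ _≡_ b)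
                (a∈H : ∀ i → vs H (inj₁ (a i)) ≡ true) (b∈H : ∀ i → vs H (inj₂ (b i)) ≡ true)
                (a-deg : ∀ i → deg (sadj H) (inj₁ (a i)) ≤ D ∸ 1) (b-deg : ∀ i → deg (sadj H) (inj₂ (b i)) ≤ D ∸ 1) where

  open Extendability G₁ bip D m
  open Forests G₁ bip D m (vs H) (sadj H)
  open BoundedEdges F m
  open PathAssembly G₁ G₂ F bip D m s H a b a∈H b∈H 1≤m
  open Growth G₁ bip D m H-isSubgraph 1≤m

  record Side (es : List Edge) (B : VSet n) (Root : V n → Set) (d : ℕ) (ip : Fin 2) : Set where
    field
      tips   : List (ℕ → V n)
      paths  : All (RootedPath es B Root d ip) tips
      unique : Unique (map (λ u → u d) tips)
      enough : 2 * m ≤ length tips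

  chooseSafe : ∀ {es B Root d ip} (S : Side es B Root d ip) →
    Σ (List (V n)) λ L → Unique L × (length L ≡ m) ×
      (∀ {x} → x ∈ L → Σ (ℕ → V n) λ u → (u ∈ Side.tips S) × (x ≡ u d)) × (∀ {x} → x ∈ L → Safe x)
  chooseSafe {d = d} S with choose (proj₁ safeTest) unique m room
    where
    open Side S
    room : m + count (λ x → not (proj₁ safeTest x)) (allV n) ≤ length (map (λ u → u d) tips)
    room = begin
      m + count (λ x → not (proj₁ safeTest x)) (allV n) ≤⟨ +-monoʳ-≤ m (proj₂ (proj₂ safeTest)) ⟩
      m + m                                             ≡⟨ cong (λ t → m + t) (+-identityʳ m) ⟨
      2 * m                                             ≤⟨ enough ⟩
      length tips                                       ≡⟨ length-map _ tips ⟨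
      length (map (λ u → u d) tips)                     ∎
      where open ≤-Reasoning
  ... | L , uniq , #L , L⊆ , L-safe =
    L , uniq , #L , (λ x∈ → ∈-map⁻ (λ u → u d) (L⊆ x∈)) , (λ x∈ → proj₁ (proj₂ safeTest) (L-safe x∈))

  joined-across : ∀ ip {A B : VSet n} → InPart ip A → InPart (opposite ip) B → ∣ A ∣ ≡ m → ∣ B ∣ ≡ m →
    Σ (V n) λ x → Σ (V n) λ y → (A x ≡ true) × (B y ≡ true) × (adj G₂ x y ≡ true)
  joined-across zero       {A} {B} A⊆ B⊆ #A #B = joined A B A⊆ B⊆ #A #B
  joined-across (suc zero) {A} {B} A⊆ B⊆ #A #B with joined B A B⊆ A⊆ #B #A
  ... | y , x , y∈B , x∈A , yx = x , y , x∈A , y∈B , trans (adj-sym G₂ x y) yx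

  endsAt : ∀ {es B Root d ip} (S : Side es B Root d ip) {x} → (Σ (ℕ → V n) λ u → (u ∈ Side.tips S) × (x ≡ u d)) →
    Part ip x ≡ true
  endsAt S (u , u∈ , refl) = endsIn (All.lookup (Side.paths S) u∈)

  ∈ᵇ-inPart : ∀ {ip} (L : List (V n)) → (∀ {x} → x ∈ L → Part ip x ≡ true) → InPart ip (_∈ᵇ L)
  ∈ᵇ-inPart L L⊆ x x∈ = L⊆ (∈ᵇ-sound L x∈)

  connect : ∀ {dA dB ipA} esA XB → Forest (XB ++ esA) → IsExtendable (vsOf (XB ++ esA)) (adjOf (XB ++ esA)) →
    Side esA (vs H) RootA dA ipA → Side (XB ++ esA) (vsOf esA) RootB dB (opposite ipA) → Conclusion (dA + suc dB)
  connect {dA} {dB} {ipA} esA XB forest ext SA SB =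
    let LA , uniqA , #LA , tipA , safeA = chooseSafe SA
        LB , uniqB , #LB , tipB , safeB = chooseSafe SB
        x , y , x∈ , y∈ , xy = joined-across ipA (∈ᵇ-inPart LA (λ x∈ → endsAt SA (tipA x∈)))
                                                (∈ᵇ-inPart LB (λ y∈ → endsAt SB (tipB y∈)))
                                                (trans (∣∈ᵇ∣ uniqA) #LA) (trans (∣∈ᵇ∣ uniqB) #LB)
    in join-tips (tipA (∈ᵇ-sound LA x∈)) (tipB (∈ᵇ-sound LB y∈)) xy (safeA (∈ᵇ-sound LA x∈)) (safeB (∈ᵇ-sound LB y∈))
    where
    join-tips : ∀ {x y} → (Σ (ℕ → V n) λ u → (u ∈ Side.tips SA) × (x ≡ u dA)) → (Σ (ℕ → V n) λ u → (u ∈ Side.tips SB) × (y ≡ u dB)) →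
      adj G₂ x y ≡ true → Safe x → Safe y → Conclusion (dA + suc dB)
    join-tips (uA , uA∈ , refl) (uB , uB∈ , refl) =
      Join.conclusion esA XB forest ext (All.lookup (Side.paths SA) uA∈) (All.lookup (Side.paths SB) uB∈)

  1≤D : 1 ≤ D
  1≤D = ≤-trans (s≤s z≤n) 3≤D

  2≤D : 2 ≤ D
  2≤D = ≤-trans (s≤s (s≤s z≤n)) 3≤D

  branching : ℕ
  branching = D ∸ 1

  1+branching≤D : suc branching ≤ D
  1+branching≤D = ≤-reflexive (trans (+-comm 1 branching) (m∸n+n≡m 1≤D))

  room-for-child : ∀ {k} → k ≤ D ∸ 1 → k + 1 ≤ D
  room-for-child k≤ = ≤-trans (+-monoˡ-≤ 1 k≤) (≤-reflexive (m∸n+n≡m 1≤D))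

  NbrBound : ℕ → Set
  NbrBound X = ∀ i U → InPart i U → m ≤ ∣ U ∣ → ∣ U ∣ ≤ 2 * m → 50 * D * m + s * X ≤ ∣N∖ adj G₁ ∣ U (vs H)

  margin : ∀ {X R} → NbrBound X → 2 * D * m + R < 50 * D * m + s * X → Margin (vs H) R
  margin bound R< i U U⊆i m≤ ≤2m = ≤-trans R< (bound i U U⊆i m≤ ≤2m)

  rootsA rootsB : List (ℕ → V n)
  rootsA = tabulate (λ i _ → inj₁ (a i))
  rootsB = tabulate (λ j _ → inj₂ (b j))

  #rootsA : length rootsA ≡ s
  #rootsA = length-tabulate _

  #rootsB : length rootsB ≡ s
  #rootsB = length-tabulate _

  unique-rootsA : Unique (map (λ u → u 0) rootsA)
  unique-rootsA = subst Unique (sym (map-tabulate _ (λ u → u 0))) (Unique.tabulate⁺ (λ eq → a-injective (inj₁-injective eq)))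

  unique-rootsB : Unique (map (λ u → u 0) rootsB)
  unique-rootsB = subst Unique (sym (map-tabulate _ (λ u → u 0))) (Unique.tabulate⁺ (λ eq → b-injective (inj₂-injective eq)))

  paths-rootsA : ∀ {es B} → All (RootedPath es B RootA 0 zero) rootsA
  paths-rootsA = All.tabulate⁺ (λ i → trivialPath (i , refl) (a∈H i) refl)

  paths-rootsB : ∀ {es B} → All (RootedPath es B RootB 0 (suc zero)) rootsB
  paths-rootsB = All.tabulate⁺ (λ j → trivialPath (j , refl) (b∈H j) refl)

  side-rootsA : ∀ {es B} → 2 * m ≤ s → Side es B RootA 0 zero
  side-rootsA 2m≤s = record { tips = rootsA ; paths = paths-rootsA ; unique = unique-rootsA ; enough = subst (2 * m ≤_) (sym #rootsA) 2m≤s }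

  side-rootsB : ∀ {es B} → 2 * m ≤ s → Side es B RootB 0 (suc zero)
  side-rootsB 2m≤s = record { tips = rootsB ; paths = paths-rootsB ; unique = unique-rootsB ; enough = subst (2 * m ≤_) (sym #rootsB) 2m≤s }

  side-grown : ∀ {B Root Reserved es R d ip L} (g : Grown B Root Reserved es R d ip L) → 2 * m ≤ L →
    Side (Grown.added g ++ es) B Root d ip
  side-grown g 2m≤L = record { tips = Grown.tips g ; paths = All.map proj₁ (Grown.areTips g) ; unique = Grown.uniqueTips g
                             ; enough = subst (2 * m ≤_) (sym (Grown.#tips g)) 2m≤L }

  2m≤10m : 2 * m ≤ 10 * m
  2m≤10m = *-monoˡ-≤ m {2} {10} (s≤s (s≤s z≤n))

  Dm-gap : ∀ j k {x y} → x ≤ y → j * D * m + x < (j + suc k) * D * m + y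
  Dm-gap j k x≤y = +-mono-<-≤ (begin-strict
    j * D * m                    <⟨ m<m+n (j * D * m) (≤-trans (*-mono-≤ 1≤D 1≤m) (*-monoˡ-≤ m (m≤n*m D (suc k)))) ⟩
    j * D * m + suc k * D * m    ≡⟨ regroup j k D m ⟩
    (j + suc k) * D * m          ∎) x≤y
    where
    open ≤-Reasoning
    regroup : ∀ j k D m → j * D * m + (1 + k) * D * m ≡ (j + (1 + k)) * D * m
    regroup = solve-∀

  direct-case : 10 * m ≤ s → IsExtendable (vs H) (sadj H) → Conclusion 1
  direct-case 10m≤s ext = connect [] [] tt ext (side-rootsA 2m≤s) (side-rootsB 2m≤s)
    where
    2m≤s : 2 * m ≤ s
    2m≤s = ≤-trans 2m≤10m 10m≤s

  starts-rootsA : ∀ {Reserved : V n → Set} → (∀ {i z} → Reserved z → inj₁ (a i) ≢ z) →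
    All (Start (vs H) RootA Reserved 1 [] 0 zero) rootsA
  starts-rootsA avoid = All.tabulate⁺ λ i → trivialPath (i , refl) (a∈H i) refl , room-for-child (a-deg i) , avoid

  path-case : ∀ r → 10 * m ≤ s → NbrBound (2 * suc r) → IsExtendable (vs H) (sadj H) → Conclusion (1 + 2 * suc r)
  path-case r 10m≤s bound ext = subst Conclusion ℓ≡ (connect esA [] forest ext⁺ SA (side-rootsB 2m≤s))
    where
    2m≤s : 2 * m ≤ s
    2m≤s = ≤-trans 2m≤10m 10m≤s
    t : ℕ
    t = r + suc r
    budget : 2 * D * m + (cost (suc t) 1 (length rootsA) + 0) < 50 * D * m + s * (2 * suc r)
    budget = Dm-gap 2 47 (≤-reflexive (trans (cong (λ L → cost (suc t) 1 L + 0) #rootsA)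
                                          (trans (cong (_+ 0) (cost-1 (suc t) s)) (arith r s))))
      where
      arith : ∀ r s → (1 + (r + (1 + r))) * s + 0 ≡ s * (2 * (1 + r))
      arith = solve-∀
    grown : Grown (vs H) RootA (λ _ → ⊥) [] 0 (depthAfter (suc t) 0) (flips (suc t) zero) (tipsAfter (suc t) 1 (length rootsA))
    grown = rounds (vs H) RootA (λ _ → ⊥) t 1 2≤D 0 zero [] rootsA 0 (λ x∈ → x∈) (λ ())
                   (tt , ext , margin bound budget) (starts-rootsA (λ ())) unique-rootsA
    esA : List Edge
    esA = Grown.added grown ++ []
    forest : Forest esA
    forest = proj₁ (Grown.viable grown)
    ext⁺ : IsExtendable (vsOf esA) (adjOf esA)
    ext⁺ = proj₁ (proj₂ (Grown.viable grown))
    SA : Side esA (vs H) RootA (depthAfter (suc t) 0) zero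
    SA = subst (Side esA (vs H) RootA _) (flips-even (suc r) zero)
               (side-grown grown (subst (2 * m ≤_) (sym (trans (tipsAfter-1 (suc t) _) #rootsA)) 2m≤s))
    ℓ≡ : depthAfter (suc t) 0 + 1 ≡ 1 + 2 * suc r
    ℓ≡ = trans (cong (_+ 1) (depthAfter≡+ (suc t) 0)) (arith r)
      where
      arith : ∀ r → (1 + (r + (1 + r))) + 0 + 1 ≡ 1 + 2 * (1 + r)
      arith = solve-∀

  2≤branching : 2 ≤ branching
  2≤branching = ∸-monoˡ-≤ 1 3≤D

  tree-cost : ∀ K → s * branching ^ K < 10 * m → cost (suc K) branching s ≤ 20 * D * m
  tree-cost K small = begin
    cost (suc K) branching s                 ≤⟨ m≤m+n _ (2 * s) ⟩
    cost (suc K) branching s + 2 * s         ≤⟨ cost-geometric (suc K) branching s 2≤branching ⟩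
    2 * (branching ^ suc K * s)              ≡⟨ cong (λ z → 2 * z) (regroup branching (branching ^ K) s) ⟩
    2 * (branching * (s * branching ^ K))    ≤⟨ *-monoʳ-≤ 2 (*-mono-≤ (m∸n≤m D 1) (<⇒≤ small)) ⟩
    2 * (D * (10 * m))                       ≡⟨ twenty D m ⟩
    20 * D * m                               ∎
    where
    open ≤-Reasoning
    regroup : ∀ c x s → c * x * s ≡ c * (s * x)
    regroup = solve-∀
    twenty : ∀ D m → 2 * (D * (10 * m)) ≡ 20 * D * m
    twenty = solve-∀

  many-tips : ∀ K {L} → 10 * m ≤ s * branching ^ suc K → L ≡ s → 2 * m ≤ tipsAfter (suc K) branching L
  many-tips K large refl = begin
    2 * m                                   ≤⟨ 2m≤10m ⟩
    10 * m                                  ≤⟨ large ⟩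
    s * branching ^ suc K                   ≡⟨ *-comm s _ ⟩
    branching ^ suc K * s                   ≡⟨ tipsAfter≡^ (suc K) branching s ⟨
    tipsAfter (suc K) branching s           ∎
    where open ≤-Reasoning

  twoPhase : ∀ (B : VSet n) (Root Reserved : V n → Set) t K {ip} es P {L} R → length P ≡ L →
    (∀ {x} → B x ≡ true → vsOf es x ≡ true) → (∀ {z} → Reserved z → vsOf es z ≡ true) →
    Viable es (cost (suc t) 1 L + (cost (suc K) branching L + R)) →
    All (Start B Root Reserved 1 es 0 ip) P → Unique (map (λ u → u 0) P) →
    Grown B Root Reserved es R (depthAfter (suc K) (depthAfter (suc t) 0)) (flips (suc K) (flips (suc t) ip))
          (tipsAfter (suc K) branching L)
  twoPhase B Root Reserved t K {ip} es P {L} R refl B⊆ Reserved⊆ viable starts unique =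
    Grown-++ B Root Reserved paths (subst (Grown B Root Reserved _ R _ _) (cong (tipsAfter (suc K) branching) #paths)
      (rounds B Root Reserved K branching 1+branching≤D _ _ (Grown.added paths ++ es) (Grown.tips paths) R
         (λ x∈B → Grown.grows paths (B⊆ x∈B)) (λ z∈Res → Grown.grows paths (Reserved⊆ z∈Res))
         (subst (λ L′ → Viable (Grown.added paths ++ es) (cost (suc K) branching L′ + R)) (sym #paths) (Grown.viable paths))
         (All.map (Tip⇒Start B Root Reserved 1+branching≤D) (Grown.areTips paths)) (Grown.uniqueTips paths)))
    where
    paths : Grown B Root Reserved es (cost (suc K) branching L + R) (depthAfter (suc t) 0) (flips (suc t) ip) (tipsAfter (suc t) 1 L)
    paths = rounds B Root Reserved t 1 2≤D 0 ip es P _ B⊆ Reserved⊆ viable starts unique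
    #paths : length (Grown.tips paths) ≡ L
    #paths = trans (Grown.#tips paths) (tipsAfter-1 (suc t) L)

  tree-budget : ∀ K p → s * branching ^ K < 10 * m →
    2 * D * m + (cost (suc (p + p)) 1 s + (cost (suc K) branching s + (cost 1 1 s + (cost (suc K) branching s + 0)))) <
    50 * D * m + s * (2 * p + 2)
  tree-budget K p small = begin-strict
    2 * D * m + (cost (suc (p + p)) 1 s + (tree + (cost 1 1 s + (tree + 0))))   ≡⟨ cong (λ z → 2 * D * m + (z + (tree + (cost 1 1 s + (tree + 0))))) (cost-1 (suc (p + p)) s) ⟩
    2 * D * m + ((1 + (p + p)) * s + (tree + (1 * s + 0 + (tree + 0))))        ≤⟨ +-monoʳ-≤ (2 * D * m) (+-monoʳ-≤ ((1 + (p + p)) * s)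
                                                                                  (+-mono-≤ (tree-cost K small) (+-monoʳ-≤ (1 * s + 0) (+-monoˡ-≤ 0 (tree-cost K small))))) ⟩
    2 * D * m + ((1 + (p + p)) * s + (20 * D * m + (1 * s + 0 + (20 * D * m + 0)))) ≡⟨ regroup D m s p ⟩
    42 * D * m + s * (2 * p + 2)                                               <⟨ Dm-gap 42 7 ≤-refl ⟩
    50 * D * m + s * (2 * p + 2)                                               ∎
    where
    open ≤-Reasoning
    tree : ℕ
    tree = cost (suc K) branching s
    regroup : ∀ D m s p → 2 * D * m + ((1 + (p + p)) * s + (20 * D * m + (1 * s + 0 + (20 * D * m + 0)))) ≡ 42 * D * m + s * (2 * p + 2)
    regroup = solve-∀

  -- The a_i grow 2p+1 path rounds and K+1 branching rounds, the b_j one path round and K+1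
  -- branching rounds; with the middle edge the path has length 2K+2p+5.
  tree-case : ∀ K p → 10 * m ≤ s * branching ^ suc K → s * branching ^ K < 10 * m → NbrBound (2 * p + 2) →
    IsExtendable (vs H) (sadj H) → Conclusion (1 + 2 * (suc K + 1 + p))
  tree-case K p large small bound ext = subst Conclusion ℓ≡ (connect esA XB forest ext⁺ SA SB)
    where
    R : ℕ
    R = cost 1 1 s + (cost (suc K) branching s + 0)
    a∉RootB : ∀ {i z} → RootB z → inj₁ (a i) ≢ z
    a∉RootB (j , refl) ()
    RootB⊆H : ∀ {z} → RootB z → vs H z ≡ true
    RootB⊆H (j , refl) = b∈H j
    dA : ℕ
    dA = depthAfter (suc K) (depthAfter (suc (p + p)) 0)
    ipA : Fin 2
    ipA = flips (suc K) (flips (suc (p + p)) zero)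
    A : Grown (vs H) RootA RootB [] R dA ipA (tipsAfter (suc K) branching s)
    A = twoPhase (vs H) RootA RootB (p + p) K [] rootsA R #rootsA (λ x∈ → x∈) RootB⊆H
                 (tt , ext , margin bound (tree-budget K p small)) (starts-rootsA a∉RootB) unique-rootsA
    esA : List Edge
    esA = Grown.added A ++ []
    startsB : All (Start (vsOf esA) RootB (λ _ → ⊥) 1 esA 0 (suc zero)) rootsB
    startsB = All.tabulate⁺ λ j → trivialPath (j , refl) (b∈H j) refl ,
      subst (λ k → k + 1 ≤ D) (sym (Grown.reservedDeg A (j , refl))) (room-for-child (b-deg j)) , λ ()
    dB : ℕ
    dB = depthAfter (suc K) 1
    B : Grown (vsOf esA) RootB (λ _ → ⊥) esA 0 dB (flips (suc K) zero) (tipsAfter (suc K) branching s)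
    B = twoPhase (vsOf esA) RootB (λ _ → ⊥) 0 K esA rootsB 0 #rootsB (λ x∈ → x∈) (λ ()) (Grown.viable A) startsB unique-rootsB
    XB : List Edge
    XB = Grown.added B
    forest : Forest (XB ++ esA)
    forest = proj₁ (Grown.viable B)
    ext⁺ : IsExtendable (vsOf (XB ++ esA)) (adjOf (XB ++ esA))
    ext⁺ = proj₁ (proj₂ (Grown.viable B))
    SA : Side esA (vs H) RootA dA ipA
    SA = side-grown A (many-tips K large refl)
    opposite-parts : flips (suc K) zero ≡ opposite ipA
    opposite-parts = trans (flips-opposite (suc K) (suc zero)) (cong (λ i → opposite (flips (suc K) i)) (sym (flips-even p (suc zero))))
    SB : Side (XB ++ esA) (vsOf esA) RootB dB (opposite ipA)
    SB = subst (Side (XB ++ esA) (vsOf esA) RootB dB) opposite-parts (side-grown B (many-tips K large refl))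
    ℓ≡ : dA + suc dB ≡ 1 + 2 * (suc K + 1 + p)
    ℓ≡ = trans (cong₂ (λ x y → x + suc y) (trans (depthAfter≡+ (suc K) _) (cong (λ z → suc K + z) (depthAfter≡+ (suc (p + p)) 0)))
                                          (depthAfter≡+ (suc K) 1))
               (arith K p)
      where
      arith : ∀ K p → (1 + K) + ((1 + (p + p)) + 0) + (1 + ((1 + K) + 1)) ≡ 1 + 2 * ((1 + K) + 1 + p)
      arith = solve-∀


  drop-power : ∀ t → 10 * m * branching ^ t ≤ s → 10 * m ≤ s
  drop-power t h = ≤-trans (subst (_≤ 10 * m * branching ^ t) (*-identityʳ (10 * m))
                                  (*-monoʳ-≤ (10 * m) (^-positive (≤-trans (s≤s z≤n) 2≤branching) t))) h

  small-k-case : ∀ r → 10 * m ≤ s → NbrBound (2 * r) → IsExtendable (vs H) (sadj H) → Conclusion (1 + 2 * r)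
  small-k-case zero    10m≤s _     ext = direct-case 10m≤s ext
  small-k-case (suc r) 10m≤s bound ext = path-case r 10m≤s bound ext

  NbrBoundℤ : ℤ → Set
  NbrBoundℤ E = ∀ i U → InPart i U → m ≤ ∣ U ∣ → ∣ U ∣ ≤ 2 * m →
    + ∣N∖ adj G₁ ∣ U (vs H) ℤ.≥ + (50 * D * m) ℤ.+ + s ℤ.* E

  NbrBound-ℕ : ∀ {E X} → E ≡ + X → NbrBoundℤ E → NbrBound X
  NbrBound-ℕ {X = X} refl bound i U U⊆i m≤ ≤2m =
    ℤ.drop‿+≤+ (subst (ℤ._≤ _) (trans (cong (λ z → + (50 * D * m) ℤ.+ z) (sym (ℤ.pos-* s X))) (sym (ℤ.pos-+ _ (s * X))))
                                (bound i U U⊆i m≤ ≤2m))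

  NbrBound-mono : ∀ {X Y} → X ≤ Y → NbrBound Y → NbrBound X
  NbrBound-mono X≤Y bound i U U⊆i m≤ ≤2m = ≤-trans (+-monoʳ-≤ (50 * D * m) (*-monoʳ-≤ s X≤Y)) (bound i U U⊆i m≤ ≤2m)


+[1+2r] : ∀ r → + (1 + 2 * r) ≡ + 1 ℤ.+ + 2 ℤ.* + r
+[1+2r] r = trans (ℤ.pos-+ 1 (2 * r)) (cong (λ z → + 1 ℤ.+ z) (ℤ.pos-* 2 r))

excess-zero : ∀ r → + (1 + 2 * r) ℤ.- + 2 ℤ.* + 0 ℤ.- + 1 ≡ + (2 * r)
excess-zero r = trans (cong (λ z → z ℤ.- + 2 ℤ.* + 0 ℤ.- + 1) (+[1+2r] r)) (trans (identity (+ r)) (sym (ℤ.pos-* 2 r)))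
  where
  identity : ∀ r → (+ 1 ℤ.+ + 2 ℤ.* r) ℤ.- + 2 ℤ.* + 0 ℤ.- + 1 ≡ + 2 ℤ.* r
  identity = solveℤ

excess-negative : ∀ r j → + (1 + 2 * r) ℤ.- + 2 ℤ.* -[1+ j ] ℤ.- + 1 ≡ + (2 * r + 2 * suc j)
excess-negative r j = trans (cong (λ z → z ℤ.- + 2 ℤ.* -[1+ j ] ℤ.- + 1) (+[1+2r] r))
                            (trans (identity (+ r) (+ suc j))
                                   (sym (trans (ℤ.pos-+ (2 * r) (2 * suc j)) (cong₂ ℤ._+_ (ℤ.pos-* 2 r) (ℤ.pos-* 2 (suc j))))))
  where
  identity : ∀ r k → (+ 1 ℤ.+ + 2 ℤ.* r) ℤ.- + 2 ℤ.* (ℤ.- k) ℤ.- + 1 ≡ + 2 ℤ.* r ℤ.+ + 2 ℤ.* k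
  identity = solveℤ

excess-positive : ∀ K p → + (1 + 2 * (suc K + 1 + p)) ℤ.- + 2 ℤ.* + suc K ℤ.- + 1 ≡ + (2 * p + 2)
excess-positive K p = trans (cong (λ z → z ℤ.- + 2 ℤ.* + suc K ℤ.- + 1) (+[1+2r] (suc K + 1 + p)))
  (trans (cong (λ z → (+ 1 ℤ.+ + 2 ℤ.* z) ℤ.- + 2 ℤ.* + suc K ℤ.- + 1) (trans (ℤ.pos-+ (suc K + 1) p) (cong (ℤ._+ + p) (ℤ.pos-+ (suc K) 1))))
    (trans (identity (+ suc K) (+ p)) (sym (trans (ℤ.pos-+ (2 * p) 2) (cong (ℤ._+ + 2) (ℤ.pos-* 2 p))))))
  where
  identity : ∀ k p → (+ 1 ℤ.+ + 2 ℤ.* (k ℤ.+ + 1 ℤ.+ p)) ℤ.- + 2 ℤ.* k ℤ.- + 1 ≡ + 2 ℤ.* p ℤ.+ + 2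
  identity = solveℤ

length-split : ∀ K r → + (1 + 2 * r) ℤ.≥ + 2 ℤ.* + suc K ℤ.+ + 3 → Σ ℕ λ p → r ≡ suc K + 1 + p
length-split K r ℓ≥ = r ∸ (suc K + 1) , sym (m+[n∸m]≡n {suc K + 1} {r} (*-cancelˡ-≤ 2 (+-cancelˡ-≤ 1 (2 * (suc K + 1)) (2 * r) (≤-trans (≤-reflexive (arith K)) 2k+3≤ℓ))))
  where
  2k+3≤ℓ : 2 * suc K + 3 ≤ 1 + 2 * r
  2k+3≤ℓ = ℤ.drop‿+≤+ (subst (ℤ._≤ + (1 + 2 * r)) (sym (trans (ℤ.pos-+ (2 * suc K) 3) (cong (ℤ._+ + 3) (ℤ.pos-* 2 (suc K))))) ℓ≥)
  arith : ∀ K → 1 + 2 * (suc K + 1) ≡ 2 * suc K + 3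
  arith = solve-∀

lemmaA2 : (D m s : ℕ) → D ≥ 3 → m ≥ 1 →
  (k : ℤ) → IsCeilLog D m s k →
  (ℓ : ℕ) → Σ ℕ (λ r → ℓ ≡ 1 + 2 * r) → + ℓ ℤ.≥ + 2 ℤ.* k ℤ.+ + 3 →
  (n : ℕ) (G₁ G₂ F : Graph n) → Bipartite G₁ → Bipartite G₂ →
  Joined m G₂ →
  (H : Sub G₁) → Extendable D m (adj G₁) (vs H) (sadj H) →
  ((i : Fin 2) (U : V n → Bool) → (∀ x → U x ≡ true → Part i x ≡ true) →
    m ≤ ∣ U ∣ → ∣ U ∣ ≤ 2 * m →
    + ∣N∖ adj G₁ ∣ U (vs H) ℤ.≥ + (50 * D * m) ℤ.+ + s ℤ.* (+ ℓ ℤ.- + 2 ℤ.* k ℤ.- + 1)) →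
  (a b : Fin s → Fin n) → Injective _≡_ _≡_ a → Injective _≡_ _≡_ b →
  (∀ i → vs H (inj₁ (a i)) ≡ true) → (∀ i → vs H (inj₂ (b i)) ≡ true) →
  (∀ i → deg (sadj H) (inj₁ (a i)) ≤ D ∸ 1) → (∀ i → deg (sadj H) (inj₂ (b i)) ≤ D ∸ 1) →
  Σ (Fin s) λ i → Σ (Fin s) λ j → Σ (Fin (suc ℓ) → V n) λ v → Σ (Fin ℓ) λ t₀ →
    -- P = v₀ v₁ … v_ℓ is a path of length ℓ in G₁ ∪ G₂ from a_i to b_j
    Injective _≡_ _≡_ v × v zero ≡ inj₁ (a i) × v (fromℕ ℓ) ≡ inj₂ (b j) ×
    (∀ t → (G₁ ∪G G₂) (lo v t) (hi v t) ≡ true) ×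
    -- (i) e = the t₀-th edge: {e} is (2,m,F)-bounded and E(P) ∖ {e} ⊆ E(G₁)
    Bounded1 2 m F (lo v t₀) (hi v t₀) ×
    (∀ t → t ≢ t₀ → adj G₁ (lo v t) (hi v t) ≡ true) ×
    -- (ii) internal vertices avoid V(H)
    (∀ t → t ≢ zero → t ≢ fromℕ ℓ → vs H (v t) ≡ false) ×
    -- (iii) H + (P - e) is (D,m)-bipartite-extendable in G₁
    Extendable D m (adj G₁) (λ x → vs H x ∨ onPath v x) (λ x y → sadj H x y ∨ pathEdgeExcept v t₀ x y)
lemmaA2 D m s 3≤D 1≤m k ceil ℓ (r , refl) ℓ≥ n G₁ G₂ F bip₁ _ joined H ext nbr a b a-inj b-inj a∈H b∈H a-deg b-deg =
  by-cases k r ceil ℓ≥ nbr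
  where
  open Extendability G₁ bip₁ D m
  open Assembly G₁ G₂ F bip₁ D m s 3≤D 1≤m joined H a b a-inj b-inj a∈H b∈H a-deg b-deg
  open PathAssembly G₁ G₂ F bip₁ D m s H a b a∈H b∈H 1≤m using (Conclusion)
  ext′ : IsExtendable (vs H) (sadj H)
  ext′ = Equivalence.to (extendable⇔ (vs H) (sadj H)) ext
  by-cases : ∀ k r → IsCeilLog D m s k → + (1 + 2 * r) ℤ.≥ + 2 ℤ.* k ℤ.+ + 3 →
    NbrBoundℤ (+ (1 + 2 * r) ℤ.- + 2 ℤ.* k ℤ.- + 1) → Conclusion (1 + 2 * r)
  by-cases (+ zero)  r (10m≤s , _) _ nbr =
    small-k-case r (subst (10 * m ≤_) (*-identityʳ s) 10m≤s) (NbrBound-ℕ (excess-zero r) nbr) ext′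
  by-cases -[1+ j ]  r (10m[D-1]^j≤s , _) _ nbr =
    small-k-case r (drop-power (suc j) 10m[D-1]^j≤s) (NbrBound-mono (m≤m+n (2 * r) _) (NbrBound-ℕ (excess-negative r j) nbr)) ext′
  by-cases (+ suc K) r (large , not-large) ℓ≥ nbr with length-split K r ℓ≥
  ... | p , refl = tree-case K p large (≰⇒> not-large) (NbrBound-ℕ (excess-positive K p) nbr) ext′
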